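{- The variety of Boolean-pointed Brouwerian algebras is categorically equivalent to the variety of commutative idempotent involutive residuated lattices which satisfy $x\approx(1\wedge x)\cdot(0\vee x)$. Likewise, the variety of Brouwerian algebras is categorically equivalent to the variety of commutative idempotent involutive residuated lattices which satisfy $0\approx 1$ and $x\approx(1\wedge x)\cdot(0\vee x)$. (In each case the morphisms are the algebraic homomorphisms.)
   Context: A Brouwerian algebra $\langle A,\vee,\wedge,1,\rightarrow\rangle$ is a distributive lattice with top element $1$ and a binary operation satisfying $x\wedge y\leq z\iff y\leq x\rightarrow z$. A Boolean-pointed Brouwerian algebra is a Brouwerian algebra with an additional constant $0$ satisfying $x\vee(x\rightarrow 0)\approx 1$ (equivalently, the interval $[0,1]$ is a Boolean lattice). A commutative involutive residuated lattice $\langle A,\vee,\wedge,\cdot,1,\rightarrow,0\rangle$ is a lattice with a commutative monoid operation $\cdot$ (unit $1$) and a binary operation $\rightarrow$ with $x\cdot y\leq z\iff y\leq x\rightarrow z$, and a constant $0$ such that $(x\rightarrow 0)\rightarrow 0=x$ for all $x$. It is idempotent if $x\cdot x=x$ for all $x$. -}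

module Defs where

open import Level using (Level; _⊔_) renaming (suc to lsuc)
open import Data.Product using (Σ; _×_; _,_; proj₁; proj₂)
open import Relation.Binary.Core using (Rel)
open import Relation.Binary.Structures using (IsEquivalence)
open import Algebra.Core using (Op₂)
open import Algebra.Definitions using (Congruent₂)
open import Algebra.Structures using (IsCommutativeMonoid)
open import Algebra.Lattice.Structures using (IsLattice; IsDistributiveLattice)

record Category (o h e : Level) : Set (lsuc (o ⊔ h ⊔ e)) where
  infixr 9 _∘_
  infix  4 _≈_
  field
    Obj   : Set o
    Hom   : Obj → Obj → Set h
    _≈_   : ∀ {A B} → Rel (Hom A B) e
    id    : ∀ {A} → Hom A A
    _∘_   : ∀ {A B C} → Hom B C → Hom A B → Hom A C
    ≈-equiv  : ∀ {A B} → IsEquivalence (_≈_ {A} {B})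
    ∘-resp-≈ : ∀ {A B C} {f g : Hom B C} {h i : Hom A B} →
               f ≈ g → h ≈ i → f ∘ h ≈ g ∘ i
    identityˡ : ∀ {A B} {f : Hom A B} → id ∘ f ≈ f
    identityʳ : ∀ {A B} {f : Hom A B} → f ∘ id ≈ f
    assoc     : ∀ {A B C D} {f : Hom A B} {g : Hom B C} {h : Hom C D} →
                (h ∘ g) ∘ f ≈ h ∘ (g ∘ f)

record Functor {o₁ h₁ e₁ o₂ h₂ e₂ : Level}
               (C : Category o₁ h₁ e₁) (D : Category o₂ h₂ e₂)
               : Set (o₁ ⊔ h₁ ⊔ e₁ ⊔ o₂ ⊔ h₂ ⊔ e₂) where
  private
    module C = Category C
    module D = Category D
  field
    F₀ : C.Obj → D.Obj
    F₁ : ∀ {A B} → C.Hom A B → D.Hom (F₀ A) (F₀ B)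
    F-resp-≈     : ∀ {A B} {f g : C.Hom A B} → f C.≈ g → F₁ f D.≈ F₁ g
    identity     : ∀ {A} → F₁ (C.id {A}) D.≈ D.id
    homomorphism : ∀ {A B C'} {f : C.Hom A B} {g : C.Hom B C'} →
                   F₁ (g C.∘ f) D.≈ F₁ g D.∘ F₁ f

idF : ∀ {o h e} {C : Category o h e} → Functor C C
idF {C = C} = record
  { F₀ = λ A → A ; F₁ = λ f → f ; F-resp-≈ = λ p → p
  ; identity = IsEquivalence.refl ≈-equiv
  ; homomorphism = IsEquivalence.refl ≈-equiv }
  where open Category C

_∘F_ : ∀ {o₁ h₁ e₁ o₂ h₂ e₂ o₃ h₃ e₃}
         {C : Category o₁ h₁ e₁} {D : Category o₂ h₂ e₂} {E : Category o₃ h₃ e₃} →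
       Functor D E → Functor C D → Functor C E
_∘F_ {C = C} {D} {E} G F = record
  { F₀ = λ A → G.F₀ (F.F₀ A)
  ; F₁ = λ f → G.F₁ (F.F₁ f)
  ; F-resp-≈ = λ p → G.F-resp-≈ (F.F-resp-≈ p)
  ; identity = E.trans (G.F-resp-≈ F.identity) G.identity
  ; homomorphism = E.trans (G.F-resp-≈ F.homomorphism) G.homomorphism }
  where
    module F = Functor F
    module G = Functor G
    module E where
      open Category E public
      trans : ∀ {A B} {f g h : Hom A B} → f ≈ g → g ≈ h → f ≈ h
      trans = IsEquivalence.trans ≈-equiv

record NaturalIsomorphism {o₁ h₁ e₁ o₂ h₂ e₂ : Level}
       {C : Category o₁ h₁ e₁} {D : Category o₂ h₂ e₂}
       (F G : Functor C D) : Set (o₁ ⊔ h₁ ⊔ e₁ ⊔ o₂ ⊔ h₂ ⊔ e₂) where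
  private
    module C = Category C
    module D = Category D
    module F = Functor F
    module G = Functor G
  field
    η   : ∀ X → D.Hom (F.F₀ X) (G.F₀ X)
    η⁻¹ : ∀ X → D.Hom (G.F₀ X) (F.F₀ X)
    isoˡ : ∀ X → η⁻¹ X D.∘ η X D.≈ D.id
    isoʳ : ∀ X → η X D.∘ η⁻¹ X D.≈ D.id
    commute : ∀ {X Y} (f : C.Hom X Y) → η Y D.∘ F.F₁ f D.≈ G.F₁ f D.∘ η X

record Equivalence {o₁ h₁ e₁ o₂ h₂ e₂ : Level}
       (C : Category o₁ h₁ e₁) (D : Category o₂ h₂ e₂)
       : Set (o₁ ⊔ h₁ ⊔ e₁ ⊔ o₂ ⊔ h₂ ⊔ e₂) where
  field
    F : Functor C D
    G : Functor D C
    unit   : NaturalIsomorphism (G ∘F F) idF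
    counit : NaturalIsomorphism (F ∘F G) idF

record BrouwerianAlgebra (c ℓ : Level) : Set (lsuc (c ⊔ ℓ)) where
  infixr 5 _⇒_
  infixr 6 _∨_
  infixr 7 _∧_
  infix  4 _≈_ _≤_
  field
    Carrier : Set c
    _≈_     : Rel Carrier ℓ
    _∨_     : Op₂ Carrier
    _∧_     : Op₂ Carrier
    one     : Carrier
    _⇒_     : Op₂ Carrier
    isDistributiveLattice : IsDistributiveLattice _≈_ _∨_ _∧_
    ⇒-cong  : Congruent₂ _≈_ _⇒_

  _≤_ : Rel Carrier ℓ
  x ≤ y = x ∧ y ≈ x

  field
    one-top     : ∀ x → x ≤ one
    residuation : ∀ x y z → (x ∧ y ≤ z → y ≤ x ⇒ z) × (y ≤ x ⇒ z → x ∧ y ≤ z)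

  open IsDistributiveLattice isDistributiveLattice public

record BooleanPointedBrouwerianAlgebra (c ℓ : Level) : Set (lsuc (c ⊔ ℓ)) where
  field
    brouwerian : BrouwerianAlgebra c ℓ
  open BrouwerianAlgebra brouwerian public
  field
    zero : Carrier
    boolean-pointed : ∀ x → x ∨ (x ⇒ zero) ≈ one

record CommInvResLattice (c ℓ : Level) : Set (lsuc (c ⊔ ℓ)) where
  infixr 5 _⇒_
  infixr 6 _∨_
  infixr 7 _∧_
  infixl 8 _·_
  infix  4 _≈_ _≤_
  field
    Carrier : Set c
    _≈_     : Rel Carrier ℓ
    _∨_     : Op₂ Carrier
    _∧_     : Op₂ Carrier
    _·_     : Op₂ Carrier
    one     : Carrier
    _⇒_     : Op₂ Carrier
    zero    : Carrier
    isLattice : IsLattice _≈_ _∨_ _∧_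
    isCommutativeMonoid : IsCommutativeMonoid _≈_ _·_ one
    ⇒-cong  : Congruent₂ _≈_ _⇒_

  _≤_ : Rel Carrier ℓ
  x ≤ y = x ∧ y ≈ x

  field
    residuation : ∀ x y z → (x · y ≤ z → y ≤ x ⇒ z) × (y ≤ x ⇒ z → x · y ≤ z)
    involutive  : ∀ x → (x ⇒ zero) ⇒ zero ≈ x

  open IsLattice isLattice public

IsIdempotentCIRL : ∀ {c ℓ} → CommInvResLattice c ℓ → Set (c ⊔ ℓ)
IsIdempotentCIRL A = ∀ x → x · x ≈ x
  where open CommInvResLattice A

SatisfiesDecomp : ∀ {c ℓ} → CommInvResLattice c ℓ → Set (c ⊔ ℓ)
SatisfiesDecomp A = ∀ x → x ≈ (one ∧ x) · (zero ∨ x)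
  where open CommInvResLattice A

SatisfiesZeroOne : ∀ {c ℓ} → CommInvResLattice c ℓ → Set ℓ
SatisfiesZeroOne A = zero ≈ one
  where open CommInvResLattice A

record BrHom {c₁ ℓ₁ c₂ ℓ₂} (A : BrouwerianAlgebra c₁ ℓ₁) (B : BrouwerianAlgebra c₂ ℓ₂)
       : Set (c₁ ⊔ ℓ₁ ⊔ c₂ ⊔ ℓ₂) where
  private
    module A = BrouwerianAlgebra A
    module B = BrouwerianAlgebra B
  field
    ⟦_⟧   : A.Carrier → B.Carrier
    cong  : ∀ {x y} → x A.≈ y → ⟦ x ⟧ B.≈ ⟦ y ⟧
    ∨-hom : ∀ x y → ⟦ x A.∨ y ⟧ B.≈ ⟦ x ⟧ B.∨ ⟦ y ⟧
    ∧-hom : ∀ x y → ⟦ x A.∧ y ⟧ B.≈ ⟦ x ⟧ B.∧ ⟦ y ⟧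
    ⇒-hom : ∀ x y → ⟦ x A.⇒ y ⟧ B.≈ ⟦ x ⟧ B.⇒ ⟦ y ⟧
    one-hom : ⟦ A.one ⟧ B.≈ B.one

record BPBrHom {c₁ ℓ₁ c₂ ℓ₂} (A : BooleanPointedBrouwerianAlgebra c₁ ℓ₁)
       (B : BooleanPointedBrouwerianAlgebra c₂ ℓ₂) : Set (c₁ ⊔ ℓ₁ ⊔ c₂ ⊔ ℓ₂) where
  private
    module A = BooleanPointedBrouwerianAlgebra A
    module B = BooleanPointedBrouwerianAlgebra B
  field
    brHom : BrHom A.brouwerian B.brouwerian
  open BrHom brHom public
  field
    zero-hom : ⟦ A.zero ⟧ B.≈ B.zero

record CIRLHom {c₁ ℓ₁ c₂ ℓ₂} (A : CommInvResLattice c₁ ℓ₁) (B : CommInvResLattice c₂ ℓ₂)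
       : Set (c₁ ⊔ ℓ₁ ⊔ c₂ ⊔ ℓ₂) where
  private
    module A = CommInvResLattice A
    module B = CommInvResLattice B
  field
    ⟦_⟧   : A.Carrier → B.Carrier
    cong  : ∀ {x y} → x A.≈ y → ⟦ x ⟧ B.≈ ⟦ y ⟧
    ∨-hom : ∀ x y → ⟦ x A.∨ y ⟧ B.≈ ⟦ x ⟧ B.∨ ⟦ y ⟧
    ∧-hom : ∀ x y → ⟦ x A.∧ y ⟧ B.≈ ⟦ x ⟧ B.∧ ⟦ y ⟧
    ·-hom : ∀ x y → ⟦ x A.· y ⟧ B.≈ ⟦ x ⟧ B.· ⟦ y ⟧
    ⇒-hom : ∀ x y → ⟦ x A.⇒ y ⟧ B.≈ ⟦ x ⟧ B.⇒ ⟦ y ⟧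
    one-hom  : ⟦ A.one ⟧ B.≈ B.one
    zero-hom : ⟦ A.zero ⟧ B.≈ B.zero

module _ {c ℓ : Level} where

  _≗Br_ : {A B : BrouwerianAlgebra c ℓ} → BrHom A B → BrHom A B → Set (c ⊔ ℓ)
  _≗Br_ {A} {B} f g = ∀ x → BrouwerianAlgebra._≈_ B (BrHom.⟦ f ⟧ x) (BrHom.⟦ g ⟧ x)

  idBr : (A : BrouwerianAlgebra c ℓ) → BrHom A A
  idBr A = record
    { ⟦_⟧ = λ x → x ; cong = λ p → p
    ; ∨-hom = λ _ _ → refl ; ∧-hom = λ _ _ → refl ; ⇒-hom = λ _ _ → refl
    ; one-hom = refl }
    where open BrouwerianAlgebra A

  compBr : {A B C : BrouwerianAlgebra c ℓ} → BrHom B C → BrHom A B → BrHom A C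
  compBr {A} {B} {C} g f = record
    { ⟦_⟧ = λ x → g.⟦ f.⟦ x ⟧ ⟧
    ; cong = λ p → g.cong (f.cong p)
    ; ∨-hom = λ x y → C.trans (g.cong (f.∨-hom x y)) (g.∨-hom _ _)
    ; ∧-hom = λ x y → C.trans (g.cong (f.∧-hom x y)) (g.∧-hom _ _)
    ; ⇒-hom = λ x y → C.trans (g.cong (f.⇒-hom x y)) (g.⇒-hom _ _)
    ; one-hom = C.trans (g.cong f.one-hom) g.one-hom }
    where
      module f = BrHom f
      module g = BrHom g
      module C = BrouwerianAlgebra C

  _≗BP_ : {A B : BooleanPointedBrouwerianAlgebra c ℓ} → BPBrHom A B → BPBrHom A B → Set (c ⊔ ℓ)
  _≗BP_ {A} {B} f g = ∀ x → BooleanPointedBrouwerianAlgebra._≈_ B (BPBrHom.⟦ f ⟧ x) (BPBrHom.⟦ g ⟧ x)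

  idBP : (A : BooleanPointedBrouwerianAlgebra c ℓ) → BPBrHom A A
  idBP A = record { brHom = idBr (BooleanPointedBrouwerianAlgebra.brouwerian A)
                  ; zero-hom = BooleanPointedBrouwerianAlgebra.refl A }

  compBP : {A B C : BooleanPointedBrouwerianAlgebra c ℓ} → BPBrHom B C → BPBrHom A B → BPBrHom A C
  compBP {A} {B} {C} g f = record
    { brHom = compBr (BPBrHom.brHom g) (BPBrHom.brHom f)
    ; zero-hom = BooleanPointedBrouwerianAlgebra.trans C
        (BPBrHom.cong g (BPBrHom.zero-hom f)) (BPBrHom.zero-hom g) }

  _≗RL_ : {A B : CommInvResLattice c ℓ} → CIRLHom A B → CIRLHom A B → Set (c ⊔ ℓ)
  _≗RL_ {A} {B} f g = ∀ x → CommInvResLattice._≈_ B (CIRLHom.⟦ f ⟧ x) (CIRLHom.⟦ g ⟧ x)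

  idRL : (A : CommInvResLattice c ℓ) → CIRLHom A A
  idRL A = record
    { ⟦_⟧ = λ x → x ; cong = λ p → p
    ; ∨-hom = λ _ _ → refl ; ∧-hom = λ _ _ → refl ; ·-hom = λ _ _ → refl
    ; ⇒-hom = λ _ _ → refl ; one-hom = refl ; zero-hom = refl }
    where open CommInvResLattice A

  compRL : {A B C : CommInvResLattice c ℓ} → CIRLHom B C → CIRLHom A B → CIRLHom A C
  compRL {A} {B} {C} g f = record
    { ⟦_⟧ = λ x → g.⟦ f.⟦ x ⟧ ⟧
    ; cong = λ p → g.cong (f.cong p)
    ; ∨-hom = λ x y → C.trans (g.cong (f.∨-hom x y)) (g.∨-hom _ _)
    ; ∧-hom = λ x y → C.trans (g.cong (f.∧-hom x y)) (g.∧-hom _ _)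
    ; ·-hom = λ x y → C.trans (g.cong (f.·-hom x y)) (g.·-hom _ _)
    ; ⇒-hom = λ x y → C.trans (g.cong (f.⇒-hom x y)) (g.⇒-hom _ _)
    ; one-hom = C.trans (g.cong f.one-hom) g.one-hom
    ; zero-hom = C.trans (g.cong f.zero-hom) g.zero-hom }
    where
      module f = CIRLHom f
      module g = CIRLHom g
      module C = CommInvResLattice C

module _ (c ℓ : Level) where

  BrouwerianCat : Category (lsuc (c ⊔ ℓ)) (c ⊔ ℓ) (c ⊔ ℓ)
  BrouwerianCat = record
    { Obj = BrouwerianAlgebra c ℓ
    ; Hom = BrHom
    ; _≈_ = _≗Br_
    ; id = λ {A} → idBr A
    ; _∘_ = compBr
    ; ≈-equiv = λ {A} {B} → record
        { refl = λ x → BrouwerianAlgebra.refl B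
        ; sym = λ p x → BrouwerianAlgebra.sym B (p x)
        ; trans = λ p q x → BrouwerianAlgebra.trans B (p x) (q x) }
    ; ∘-resp-≈ = λ {A} {B} {C} {f} {g} {h} {i} p q x →
        BrouwerianAlgebra.trans C (BrHom.cong f (q x)) (p (BrHom.⟦ i ⟧ x))
    ; identityˡ = λ {A} {B} x → BrouwerianAlgebra.refl B
    ; identityʳ = λ {A} {B} x → BrouwerianAlgebra.refl B
    ; assoc = λ {A} {B} {C} {D} x → BrouwerianAlgebra.refl D
    }

  BooleanPointedBrouwerianCat : Category (lsuc (c ⊔ ℓ)) (c ⊔ ℓ) (c ⊔ ℓ)
  BooleanPointedBrouwerianCat = record
    { Obj = BooleanPointedBrouwerianAlgebra c ℓ
    ; Hom = BPBrHom
    ; _≈_ = _≗BP_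
    ; id = λ {A} → idBP A
    ; _∘_ = compBP
    ; ≈-equiv = λ {A} {B} → record
        { refl = λ x → BooleanPointedBrouwerianAlgebra.refl B
        ; sym = λ p x → BooleanPointedBrouwerianAlgebra.sym B (p x)
        ; trans = λ p q x → BooleanPointedBrouwerianAlgebra.trans B (p x) (q x) }
    ; ∘-resp-≈ = λ {A} {B} {C} {f} {g} {h} {i} p q x →
        BooleanPointedBrouwerianAlgebra.trans C (BPBrHom.cong f (q x)) (p (BPBrHom.⟦ i ⟧ x))
    ; identityˡ = λ {A} {B} x → BooleanPointedBrouwerianAlgebra.refl B
    ; identityʳ = λ {A} {B} x → BooleanPointedBrouwerianAlgebra.refl B
    ; assoc = λ {A} {B} {C} {D} x → BooleanPointedBrouwerianAlgebra.refl D
    }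

  CIRLCat : (P : CommInvResLattice c ℓ → Set (c ⊔ ℓ)) → Category (lsuc (c ⊔ ℓ)) (c ⊔ ℓ) (c ⊔ ℓ)
  CIRLCat P = record
    { Obj = Σ (CommInvResLattice c ℓ) P
    ; Hom = λ A B → CIRLHom (proj₁ A) (proj₁ B)
    ; _≈_ = _≗RL_
    ; id = λ {A} → idRL (proj₁ A)
    ; _∘_ = compRL
    ; ≈-equiv = λ {A} {B} → record
        { refl = λ x → CommInvResLattice.refl (proj₁ B)
        ; sym = λ p x → CommInvResLattice.sym (proj₁ B) (p x)
        ; trans = λ p q x → CommInvResLattice.trans (proj₁ B) (p x) (q x) }
    ; ∘-resp-≈ = λ {A} {B} {C} {f} {g} {h} {i} p q x →
        CommInvResLattice.trans (proj₁ C) (CIRLHom.cong f (q x)) (p (CIRLHom.⟦ i ⟧ x))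
    ; identityˡ = λ {A} {B} x → CommInvResLattice.refl (proj₁ B)
    ; identityʳ = λ {A} {B} x → CommInvResLattice.refl (proj₁ B)
    ; assoc = λ {A} {B} {C} {D} x → CommInvResLattice.refl (proj₁ D)
    }

  IdemCIRLDecompCat : Category (lsuc (c ⊔ ℓ)) (c ⊔ ℓ) (c ⊔ ℓ)
  IdemCIRLDecompCat = CIRLCat (λ A → IsIdempotentCIRL A × SatisfiesDecomp A)

  IdemCIRLDecompZeroOneCat : Category (lsuc (c ⊔ ℓ)) (c ⊔ ℓ) (c ⊔ ℓ)
  IdemCIRLDecompZeroOneCat =
    CIRLCat (λ A → IsIdempotentCIRL A × SatisfiesDecomp A × SatisfiesZeroOne A)

-- A Brouwerian algebra B with a constant z such that 1 ≤ x ∨ (x ⇒ z) gives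
-- a commutative idempotent involutive residuated lattice, its twist product:
-- pairs (a , b) with positive part a and negative part b, ordered by a
-- increasing and b decreasing, with involution (a , b) ↦ (b , a), product
-- (a ∧ c , ((b ⇒ z) ⇒ d) ∧ ((d ⇒ z) ⇒ b)), unit (1 , z) and zero (z , 1).
-- Conversely, the negative cone {x | x ≤ 1} of such a lattice L is a
-- Brouwerian algebra under x ⇒ y := 1 ∧ (x → y), with Boolean point 0.
-- The twist product of B has negative cone B, via (a , b) ↦ a; and L is
-- the twist product of its negative cone, via x ↦ (x , ¬ x), precisely
-- because of the decomposition law x ≈ (1 ∧ x) · (0 ∨ x).  Every Brouwerian
-- algebra has the Boolean point z = 1, and then 0 ≈ 1 in its twist product,
-- which gives the second equivalence.

module Submission where

open import Level using (Level)
open import Data.List using (List; []; _∷_)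
open import Data.Product using (_×_; _,_; proj₁; proj₂)
open import Relation.Binary.Core using (Rel)
open import Relation.Binary.Lattice.Definitions using (Supremum; Infimum)
open import Algebra.Core using (Op₂)
open import Algebra.Bundles using (IdempotentCommutativeMonoid)
open import Algebra.Lattice.Bundles using (Lattice)
open import Algebra.Structures using (IsCommutativeMonoid)
open import Algebra.Lattice.Structures using (IsLattice; IsDistributiveLattice)
import Algebra.Lattice.Properties.Lattice as LatticeProperties
import Algebra.Solver.IdempotentCommutativeMonoid as ICMSolver
import Relation.Binary.Lattice as OrderLattice
import Relation.Binary.Lattice.Properties.Lattice as OrderLatticeProperties
import Relation.Binary.Lattice.Properties.DistributiveLattice as OrderDistributiveLatticeProperties
open import Defs

module LatticeOrder {a ℓ} {A : Set a} {_≈_ : Rel A ℓ} {_∨_ _∧_ : Op₂ A}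
                    (isLattice : IsLattice _≈_ _∨_ _∧_) where
  open IsLattice isLattice

  private
    lattice : Lattice a ℓ
    lattice = record { isLattice = isLattice }

  open LatticeProperties lattice public using (∧-idem)
  private
    module O = OrderLattice.Lattice (LatticeProperties.∨-∧-orderTheoreticLattice lattice)

  infix 4 _≤_
  _≤_ : Rel A ℓ
  x ≤ y = (x ∧ y) ≈ x

  ≤-refl : ∀ {x} → x ≤ x
  ≤-refl = sym O.refl

  ≤-reflexive : ∀ {x y} → x ≈ y → x ≤ y
  ≤-reflexive p = sym (O.reflexive p)

  ≤-trans : ∀ {x y z} → x ≤ y → y ≤ z → x ≤ z
  ≤-trans p q = sym (O.trans (sym p) (sym q))

  ≤-antisym : ∀ {x y} → x ≤ y → y ≤ x → x ≈ y
  ≤-antisym p q = O.antisym (sym p) (sym q)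

  ≤-respˡ : ∀ {x x′ y} → x ≈ x′ → x ≤ y → x′ ≤ y
  ≤-respˡ e p = ≤-trans (≤-reflexive (sym e)) p

  ≤-respʳ : ∀ {x y y′} → y ≈ y′ → x ≤ y → x ≤ y′
  ≤-respʳ e p = ≤-trans p (≤-reflexive e)

  x∧y≤x : ∀ x y → (x ∧ y) ≤ x
  x∧y≤x x y = sym (O.x∧y≤x x y)

  x∧y≤y : ∀ x y → (x ∧ y) ≤ y
  x∧y≤y x y = sym (O.x∧y≤y x y)

  ∧-greatest : ∀ {x y z} → z ≤ x → z ≤ y → z ≤ (x ∧ y)
  ∧-greatest p q = sym (O.∧-greatest (sym p) (sym q))

  x≤x∨y : ∀ x y → x ≤ (x ∨ y)
  x≤x∨y x y = sym (O.x≤x∨y x y)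

  y≤x∨y : ∀ x y → y ≤ (x ∨ y)
  y≤x∨y x y = sym (O.y≤x∨y x y)

  ∨-least : ∀ {x y z} → x ≤ z → y ≤ z → (x ∨ y) ≤ z
  ∨-least p q = sym (O.∨-least (sym p) (sym q))

  ∧-monotonic : ∀ {x x′ y y′} → x ≤ x′ → y ≤ y′ → (x ∧ y) ≤ (x′ ∧ y′)
  ∧-monotonic p q = ∧-greatest (≤-trans (x∧y≤x _ _) p) (≤-trans (x∧y≤y _ _) q)

  ∨-monotonic : ∀ {x x′ y y′} → x ≤ x′ → y ≤ y′ → (x ∨ y) ≤ (x′ ∨ y′)
  ∨-monotonic p q = ∨-least (≤-trans p (x≤x∨y _ _)) (≤-trans q (y≤x∨y _ _))

  x≤y⇒x∨y≈y : ∀ {x y} → x ≤ y → (x ∨ y) ≈ y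
  x≤y⇒x∨y≈y p = ≤-antisym (∨-least p ≤-refl) (y≤x∨y _ _)

module PreorderLattice {a ℓ} {X : Set a} (_⊑_ : Rel X ℓ)
    (⊑-refl : ∀ {x} → x ⊑ x) (⊑-trans : ∀ {x y z} → x ⊑ y → y ⊑ z → x ⊑ z)
    (_⊔_ _⊓_ : Op₂ X) (supremum : Supremum _⊑_ _⊔_) (infimum : Infimum _⊑_ _⊓_) where

  infix 4 _≃_
  _≃_ : Rel X ℓ
  x ≃ y = x ⊑ y × y ⊑ x

  orderLattice : OrderLattice.Lattice a ℓ ℓ
  orderLattice = record
    { _≈_ = _≃_ ; _≤_ = _⊑_ ; _∨_ = _⊔_ ; _∧_ = _⊓_
    ; isLattice = record
      { isPartialOrder = record
        { isPreorder = record
          { isEquivalence = record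
            { refl  = ⊑-refl , ⊑-refl
            ; sym   = λ (p , q) → q , p
            ; trans = λ (p , q) (p′ , q′) → ⊑-trans p p′ , ⊑-trans q′ q }
          ; reflexive = proj₁
          ; trans     = ⊑-trans }
        ; antisym = _,_ }
      ; supremum = supremum
      ; infimum  = infimum } }

  isLattice : IsLattice _≃_ _⊔_ _⊓_
  isLattice = OrderLatticeProperties.isAlgLattice orderLattice

  ⊑⇒≤ : ∀ {x y} → x ⊑ y → (x ⊓ y) ≃ x
  ⊑⇒≤ p = proj₁ (infimum _ _) , proj₂ (proj₂ (infimum _ _)) _ ⊑-refl p

  ≤⇒⊑ : ∀ {x y} → (x ⊓ y) ≃ x → x ⊑ y
  ≤⇒⊑ (_ , p) = ⊑-trans p (proj₁ (proj₂ (infimum _ _)))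

  isDistributiveLattice : (∀ x y z → (x ⊓ (y ⊔ z)) ⊑ ((x ⊓ y) ⊔ (x ⊓ z))) →
                          IsDistributiveLattice _≃_ _⊔_ _⊓_
  isDistributiveLattice distrib = record
    { isLattice = isLattice
    ; ∨-distrib-∧ = D.∨-distrib-∧
    ; ∧-distrib-∨ = D.∧-distrib-∨ }
    where
      open OrderLattice.Lattice orderLattice using (∨-least; x≤x∨y; y≤x∨y; meetSemilattice)
      open import Relation.Binary.Lattice.Properties.MeetSemilattice meetSemilattice using (∧-monotonic)

      distributiveOrderLattice : OrderLattice.DistributiveLattice a ℓ ℓ
      distributiveOrderLattice = record
        { isDistributiveLattice = record
          { isLattice = OrderLattice.Lattice.isLattice orderLattice
          ; ∧-distribˡ-∨ = λ x y z →
              distrib x y z , ∨-least (∧-monotonic ⊑-refl (x≤x∨y y z)) (∧-monotonic ⊑-refl (y≤x∨y y z)) } }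
      module D = OrderDistributiveLatticeProperties distributiveOrderLattice

module BrouwerianProperties {c ℓ} (B : BrouwerianAlgebra c ℓ) where
  open BrouwerianAlgebra B
  open LatticeOrder isLattice public hiding (_≤_)

  transpose-⇒ : ∀ {x y z} → (x ∧ y) ≤ z → y ≤ (x ⇒ z)
  transpose-⇒ = proj₁ (residuation _ _ _)

  transpose-∧ : ∀ {x y z} → y ≤ (x ⇒ z) → (x ∧ y) ≤ z
  transpose-∧ = proj₂ (residuation _ _ _)

  ⇒-eval : ∀ x y → (x ∧ (x ⇒ y)) ≤ y
  ⇒-eval x y = transpose-∧ ≤-refl

  y≤x⇒y : ∀ {x y} → y ≤ (x ⇒ y)
  y≤x⇒y = transpose-⇒ (x∧y≤y _ _)

  ⇒-antitoneˡ : ∀ {x x′ y} → x′ ≤ x → (x ⇒ y) ≤ (x′ ⇒ y)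
  ⇒-antitoneˡ p = transpose-⇒ (≤-trans (∧-monotonic p ≤-refl) (⇒-eval _ _))

  ∧-≤-⇒ : ∀ {r x y} → r ≤ x → r ≤ (x ⇒ y) → r ≤ y
  ∧-≤-⇒ p q = ≤-trans (∧-greatest p q) (⇒-eval _ _)

  curry-≤ : ∀ x y w → ((x ∧ y) ⇒ w) ≤ (x ⇒ (y ⇒ w))
  curry-≤ x y w = transpose-⇒ (transpose-⇒ (≤-trans
    (∧-greatest (∧-greatest (≤-trans (x∧y≤y _ _) (x∧y≤x _ _)) (x∧y≤x _ _))
                (≤-trans (x∧y≤y _ _) (x∧y≤y _ _)))
    (⇒-eval _ _)))

  Valid : Carrier → Set ℓ
  Valid x = one ≤ x

  infixl 5 _$ᵛ_
  _$ᵛ_ : ∀ {x y} → Valid (x ⇒ y) → Valid x → Valid y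
  p $ᵛ q = ∧-≤-⇒ q p

  ≤⇒valid : ∀ {x y} → x ≤ y → Valid (x ⇒ y)
  ≤⇒valid p = transpose-⇒ (≤-trans (x∧y≤x _ _) p)

  valid⇒≤ : ∀ {x y} → Valid (x ⇒ y) → x ≤ y
  valid⇒≤ p = ∧-≤-⇒ ≤-refl (≤-trans (one-top _) p)

BooleanPoint : ∀ {c ℓ} (B : BrouwerianAlgebra c ℓ) → BrouwerianAlgebra.Carrier B → Set (c Level.⊔ ℓ)
BooleanPoint B z = ∀ x → one ≤ (x ∨ (x ⇒ z))
  where open BrouwerianAlgebra B

-- Brouwerian algebras model intuitionistic propositional logic, so every
-- sequent derivable in Dyckhoff's contraction-free calculus G4ip holds in
-- them.  The Brouwerian inequalities needed below are proved by derivations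
-- found by proof search and verified by `check`.
module G4ip where
  open import Data.Bool using (Bool; true; false; _∧_)
  open import Data.Maybe using (Maybe; just; nothing; is-just; zipWith)
  import Data.Maybe as Maybe
  open import Data.Nat using (ℕ; zero; suc)
  import Data.Nat.Properties as ℕ
  open import Relation.Binary.PropositionalEquality using (_≡_; refl; cong; cong₂)
  open import Relation.Nullary.Decidable using (dec⇒maybe)

  infixr 7 _⋀_
  infixr 6 _⋁_
  infixr 5 _⊃_
  data Formula : Set where
    var : ℕ → Formula
    ⊤ᶠ : Formula
    _⋀_ _⋁_ _⊃_ : Formula → Formula → Formula

  _≟ᶠ_ : (f g : Formula) → Maybe (f ≡ g)
  var m ≟ᶠ var n = Maybe.map (cong var) (dec⇒maybe (m ℕ.≟ n))
  ⊤ᶠ ≟ᶠ ⊤ᶠ = just refl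
  (f ⋀ g) ≟ᶠ (f′ ⋀ g′) = zipWith (cong₂ _⋀_) (f ≟ᶠ f′) (g ≟ᶠ g′)
  (f ⋁ g) ≟ᶠ (f′ ⋁ g′) = zipWith (cong₂ _⋁_) (f ≟ᶠ f′) (g ≟ᶠ g′)
  (f ⊃ g) ≟ᶠ (f′ ⊃ g′) = zipWith (cong₂ _⊃_) (f ≟ᶠ f′) (g ≟ᶠ g′)
  _ ≟ᶠ _ = nothing

  -- Left rules name the position of the principal formula in the context;
  -- ⊃L also names the position of its antecedent in the remaining context.
  data Derivation : Set where
    ax : ℕ → Derivation
    ⊤R : Derivation
    ∧R : Derivation → Derivation → Derivation
    ∨R₁ ∨R₂ ⊃R : Derivation → Derivation
    ∧L ⊤L ⊤⊃L ∧⊃L ∨⊃L : ℕ → Derivation → Derivation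
    ∨L ⊃⊃L : ℕ → Derivation → Derivation → Derivation
    ⊃L : ℕ → ℕ → Derivation → Derivation

  _‼_ : List Formula → ℕ → Maybe Formula
  [] ‼ _ = nothing
  (f ∷ Γ) ‼ zero = just f
  (f ∷ Γ) ‼ suc n = Γ ‼ n

  _─_ : List Formula → ℕ → List Formula
  [] ─ _ = []
  (f ∷ Γ) ─ zero = Γ
  (f ∷ Γ) ─ suc n = f ∷ (Γ ─ n)

  check : List Formula → Formula → Derivation → Bool
  check Γ g (ax i) with Γ ‼ i
  ... | just f = is-just (f ≟ᶠ g)
  ... | nothing = false
  check Γ ⊤ᶠ ⊤R = true
  check Γ (f ⋀ g) (∧R p q) = check Γ f p ∧ check Γ g q
  check Γ (f ⋁ g) (∨R₁ p) = check Γ f p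
  check Γ (f ⋁ g) (∨R₂ p) = check Γ g p
  check Γ (f ⊃ g) (⊃R p) = check (f ∷ Γ) g p
  check Γ k (∧L i p) with Γ ‼ i
  ... | just (f ⋀ g) = check (f ∷ g ∷ Γ ─ i) k p
  ... | _ = false
  check Γ k (∨L i p q) with Γ ‼ i
  ... | just (f ⋁ g) = check (f ∷ Γ ─ i) k p ∧ check (g ∷ Γ ─ i) k q
  ... | _ = false
  check Γ k (⊤L i p) with Γ ‼ i
  ... | just ⊤ᶠ = check (Γ ─ i) k p
  ... | _ = false
  check Γ k (⊤⊃L i p) with Γ ‼ i
  ... | just (⊤ᶠ ⊃ g) = check (g ∷ Γ ─ i) k p
  ... | _ = false
  check Γ k (∧⊃L i p) with Γ ‼ i
  ... | just ((f₁ ⋀ f₂) ⊃ g) = check ((f₁ ⊃ f₂ ⊃ g) ∷ Γ ─ i) k p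
  ... | _ = false
  check Γ k (∨⊃L i p) with Γ ‼ i
  ... | just ((f₁ ⋁ f₂) ⊃ g) = check ((f₁ ⊃ g) ∷ (f₂ ⊃ g) ∷ Γ ─ i) k p
  ... | _ = false
  check Γ k (⊃L i j p) with Γ ‼ i | (Γ ─ i) ‼ j
  ... | just (f ⊃ g) | just f′ = is-just (f ≟ᶠ f′) ∧ check (g ∷ Γ ─ i) k p
  ... | _ | _ = false
  check Γ k (⊃⊃L i p q) with Γ ‼ i
  ... | just ((f₁ ⊃ f₂) ⊃ g) = check ((f₂ ⊃ g) ∷ Γ ─ i) (f₁ ⊃ f₂) p ∧ check (g ∷ Γ ─ i) k q
  ... | _ = false
  check _ _ _ = false

module G4ipSoundness {c ℓ} (B : BrouwerianAlgebra c ℓ) where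
  open import Data.Bool using (T)
  open import Data.Bool.Properties using (T-∧)
  open import Data.Maybe using (just)
  open import Data.Nat using (ℕ; zero; suc)
  open import Function using (Equivalence)
  open import Relation.Binary.PropositionalEquality using (_≡_; refl)
  open G4ip
  open BrouwerianAlgebra B
  open BrouwerianProperties B

  _!_ : List Carrier → ℕ → Carrier
  [] ! _ = one
  (x ∷ ρ) ! zero = x
  (x ∷ ρ) ! suc n = ρ ! n

  ⟦_⟧ : Formula → List Carrier → Carrier
  ⟦ var n ⟧ ρ = ρ ! n
  ⟦ ⊤ᶠ ⟧ ρ = one
  ⟦ f ⋀ g ⟧ ρ = ⟦ f ⟧ ρ ∧ ⟦ g ⟧ ρ
  ⟦ f ⋁ g ⟧ ρ = ⟦ f ⟧ ρ ∨ ⟦ g ⟧ ρ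
  ⟦ f ⊃ g ⟧ ρ = ⟦ f ⟧ ρ ⇒ ⟦ g ⟧ ρ

  ⟦_⟧* : List Formula → List Carrier → Carrier
  ⟦ [] ⟧* ρ = one
  ⟦ f ∷ Γ ⟧* ρ = ⟦ f ⟧ ρ ∧ ⟦ Γ ⟧* ρ

  ‼-split : ∀ Γ i {f} → Γ ‼ i ≡ just f → ∀ ρ → ⟦ Γ ⟧* ρ ≤ (⟦ f ⟧ ρ ∧ ⟦ Γ ─ i ⟧* ρ)
  ‼-split (x ∷ Γ) zero refl ρ = ≤-refl
  ‼-split (x ∷ Γ) (suc i) e ρ =
    let r = ‼-split Γ i e ρ in
    ∧-greatest (≤-trans (x∧y≤y _ _) (≤-trans r (x∧y≤x _ _)))
               (∧-monotonic ≤-refl (≤-trans r (x∧y≤y _ _)))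

  ‼-≤ : ∀ Γ i {f} → Γ ‼ i ≡ just f → ∀ ρ → ⟦ Γ ⟧* ρ ≤ ⟦ f ⟧ ρ
  ‼-≤ Γ i e ρ = ≤-trans (‼-split Γ i e ρ) (x∧y≤x _ _)

  -- Each left rule replaces the principal formula by formulas that it entails.
  sound : ∀ Γ g p → T (check Γ g p) → ∀ ρ → ⟦ Γ ⟧* ρ ≤ ⟦ g ⟧ ρ
  sound Γ g (ax i) pr ρ with Γ ‼ i in e
  ... | just f with f ≟ᶠ g
  ...   | just refl = ‼-≤ Γ i e ρ
  sound Γ ⊤ᶠ ⊤R pr ρ = one-top _
  sound Γ (f ⋀ g) (∧R p q) pr ρ =
    let s = Equivalence.to T-∧ pr in ∧-greatest (sound Γ f p (proj₁ s) ρ) (sound Γ g q (proj₂ s) ρ)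
  sound Γ (f ⋁ g) (∨R₁ p) pr ρ = ≤-trans (sound Γ f p pr ρ) (x≤x∨y _ _)
  sound Γ (f ⋁ g) (∨R₂ p) pr ρ = ≤-trans (sound Γ g p pr ρ) (y≤x∨y _ _)
  sound Γ (f ⊃ g) (⊃R p) pr ρ = transpose-⇒ (sound (f ∷ Γ) g p pr ρ)
  sound Γ k (∧L i p) pr ρ with Γ ‼ i in e
  ... | just (f ⋀ g) =
    ≤-trans (‼-split Γ i e ρ) (≤-trans (≤-reflexive (∧-assoc _ _ _)) (sound _ k p pr ρ))
  sound Γ k (∨L i p q) pr ρ with Γ ‼ i in e
  ... | just (f ⋁ g) =
    let s = Equivalence.to T-∧ pr in
    ≤-trans (‼-split Γ i e ρ) (≤-trans (≤-reflexive (∧-distribʳ-∨ _ _ _))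
      (∨-least (sound _ k p (proj₁ s) ρ) (sound _ k q (proj₂ s) ρ)))
  sound Γ k (⊤L i p) pr ρ with Γ ‼ i in e
  ... | just ⊤ᶠ = ≤-trans (‼-split Γ i e ρ) (≤-trans (x∧y≤y _ _) (sound _ k p pr ρ))
  sound Γ k (⊤⊃L i p) pr ρ with Γ ‼ i in e
  ... | just (⊤ᶠ ⊃ g) = ≤-trans (‼-split Γ i e ρ)
    (≤-trans (∧-monotonic (∧-≤-⇒ (one-top _) ≤-refl) ≤-refl) (sound _ k p pr ρ))
  sound Γ k (∧⊃L i p) pr ρ with Γ ‼ i in e
  ... | just ((f₁ ⋀ f₂) ⊃ g) = ≤-trans (‼-split Γ i e ρ)
    (≤-trans (∧-monotonic (curry-≤ _ _ _) ≤-refl) (sound _ k p pr ρ))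
  sound Γ k (∨⊃L i p) pr ρ with Γ ‼ i in e
  ... | just ((f₁ ⋁ f₂) ⊃ g) = ≤-trans (‼-split Γ i e ρ)
    (≤-trans (∧-greatest (≤-trans (x∧y≤x _ _) (⇒-antitoneˡ (x≤x∨y _ _)))
                         (∧-monotonic (⇒-antitoneˡ (y≤x∨y _ _)) ≤-refl))
             (sound _ k p pr ρ))
  sound Γ k (⊃L i j p) pr ρ with Γ ‼ i in e | (Γ ─ i) ‼ j in e′
  ... | just (f ⊃ g) | just f′ with f ≟ᶠ f′ | pr
  ...   | just refl | pr′ = ≤-trans (‼-split Γ i e ρ)
    (≤-trans (∧-greatest (∧-≤-⇒ (≤-trans (x∧y≤y _ _) (‼-≤ (Γ ─ i) j e′ ρ)) (x∧y≤x _ _)) (x∧y≤y _ _))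
             (sound (g ∷ Γ ─ i) k p (proj₂ (Equivalence.to T-∧ pr′)) ρ))
  sound Γ k (⊃⊃L i p q) pr ρ with Γ ‼ i in e
  ... | just ((f₁ ⊃ f₂) ⊃ g) =
    let s = Equivalence.to T-∧ pr
        split = ‼-split Γ i e ρ
        premise = ≤-trans split (∧-monotonic (⇒-antitoneˡ (transpose-⇒ (x∧y≤y _ _))) ≤-refl)
        f₁⊃f₂ = ≤-trans premise (sound _ _ p (proj₁ s) ρ)
    in ≤-trans (∧-greatest (∧-≤-⇒ f₁⊃f₂ (≤-trans split (x∧y≤x _ _))) (≤-trans split (x∧y≤y _ _)))
               (sound _ k q (proj₂ s) ρ)

  tautology : ∀ f p {_ : T (check [] f p)} ρ → Valid (⟦ f ⟧ ρ)
  tautology f p {pr} ρ = sound [] f p pr ρ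

-- Each inequality below is an intuitionistic tautology once the stated
-- premises and instances of 1 ≤ x ∨ (x ⇒ z) are added as hypotheses.
module TwistIdentities {c ℓ} (B : BrouwerianAlgebra c ℓ) (z : BrouwerianAlgebra.Carrier B)
    (bp : BooleanPoint B z) where
  open BrouwerianAlgebra B
  open BrouwerianProperties B
  open G4ip
  open G4ipSoundness B

  NA NB W : Carrier → Carrier → Carrier
  NA a b = (a ⇒ b) ⇒ (a ∧ z)
  NB a b = a ⇒ b
  W b d = ((b ⇒ z) ⇒ d) ∧ ((d ⇒ z) ⇒ b)

  record Normal (a b : Carrier) : Set ℓ where
    field
      closedʳ  : (a ⇒ b) ≤ b
      closedˡ  : (b ⇒ a) ≤ a
      disjoint : (a ∧ b) ≤ z
  open Normal public

  𝐳 𝐚 𝐛 𝐜 𝐝 𝐞 𝐟 : Formula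
  𝐳 = var 0
  𝐚 = var 1
  𝐛 = var 2
  𝐜 = var 3
  𝐝 = var 4
  𝐞 = var 5
  𝐟 = var 6

  NAᶠ Wᶠ : Formula → Formula → Formula
  NAᶠ a b = (a ⊃ b) ⊃ a ⋀ 𝐳
  Wᶠ b d = ((b ⊃ 𝐳) ⊃ d) ⋀ ((d ⊃ 𝐳) ⊃ b)

  bpᶠ : Formula → Formula
  bpᶠ x = x ⋁ (x ⊃ 𝐳)

  normalise-normal : ∀ a b → Normal (NA a b) (NB a b)
  normalise-normal a b = record
    { closedʳ =
        valid⇒≤ (tautology (bpᶠ 𝐛 ⊃ (NAᶠ 𝐚 𝐛 ⊃ 𝐚 ⊃ 𝐛) ⊃ 𝐚 ⊃ 𝐛)
          (⊃R (∨L 0 (⊃R (⊃R (ax 2))) (⊃R (⊃R (⊃⊃L 1 (∧⊃L 0 (⊃L 0 0 (⊃R (⊃L 0 1 (⊃L 3 0 (⊃L 2 0 (⊃L 0 2 (∧R (ax 3) (ax 1))))))))) (⊃L 0 0 (ax 0)))))))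
          (z ∷ a ∷ b ∷ []) $ᵛ bp b)
    ; closedˡ =
        valid⇒≤ (tautology (((𝐚 ⊃ 𝐛) ⊃ NAᶠ 𝐚 𝐛) ⊃ NAᶠ 𝐚 𝐛)
          (⊃R (⊃R (∧R (⊃⊃L 1 (ax 1) (⊃⊃L 0 (ax 1) (∧L 0 (ax 0)))) (⊃⊃L 1 (ax 1) (⊃⊃L 0 (ax 1) (∧L 0 (ax 1)))))))
          (z ∷ a ∷ b ∷ []))
    ; disjoint =
        valid⇒≤ (tautology (NAᶠ 𝐚 𝐛 ⋀ (𝐚 ⊃ 𝐛) ⊃ 𝐳)
          (⊃R (∧L 0 (⊃⊃L 0 (ax 1) (∧L 0 (ax 1)))))
          (z ∷ a ∷ b ∷ []))
    }

  NA-normal : ∀ {a b} → Normal a b → NA a b ≈ a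
  NA-normal {a} {b} n = ≤-antisym
    (valid⇒≤ (tautology (((𝐛 ⊃ 𝐚) ⊃ 𝐚) ⊃ NAᶠ 𝐚 𝐛 ⊃ 𝐚)
      (⊃R (⊃R (⊃⊃L 1 (⊃R (⊃⊃L 2 (⊃L 0 0 (∧L 0 (⊃L 3 0 (⊃R (ax 4))))) (∧L 0 (ax 0)))) (ax 0))))
      (z ∷ a ∷ b ∷ []) $ᵛ ≤⇒valid (closedˡ n)))
    (valid⇒≤ (tautology ((𝐚 ⋀ 𝐛 ⊃ 𝐳) ⊃ 𝐚 ⊃ NAᶠ 𝐚 𝐛)
      (⊃R (∧⊃L 0 (⊃R (⊃L 1 0 (⊃R (⊃L 0 1 (⊃L 1 0 (∧R (ax 2) (ax 0)))))))))
      (z ∷ a ∷ b ∷ []) $ᵛ ≤⇒valid (disjoint n)))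

  NA-meet≤ˡ : ∀ {a b} c d → Normal a b → NA (a ∧ c) (b ∨ d) ≤ a
  NA-meet≤ˡ {a} {b} c d n =
    valid⇒≤ (tautology (((𝐛 ⊃ 𝐚) ⊃ 𝐚) ⊃ NAᶠ (𝐚 ⋀ 𝐜) (𝐛 ⋁ 𝐝) ⊃ 𝐚)
      (⊃R (⊃R (⊃⊃L 1 (⊃R (⊃⊃L 2 (∨⊃L 0 (⊃L 0 1 (∧L 0 (∧L 0 (⊃L 5 0 (⊃R (∧L 0 (∨R₁ (ax 7))))))))) (∧L 0 (∧L 0 (ax 0))))) (ax 0))))
      (z ∷ a ∷ b ∷ c ∷ d ∷ []) $ᵛ ≤⇒valid (closedˡ n))

  NA-meet≤ʳ : ∀ a b {c d} → Normal c d → NA (a ∧ c) (b ∨ d) ≤ c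
  NA-meet≤ʳ a b {c} {d} n =
    valid⇒≤ (tautology (((𝐝 ⊃ 𝐜) ⊃ 𝐜) ⊃ NAᶠ (𝐚 ⋀ 𝐜) (𝐛 ⋁ 𝐝) ⊃ 𝐜)
      (⊃R (⊃R (⊃⊃L 1 (⊃R (⊃⊃L 2 (∨⊃L 0 (⊃L 1 1 (∧L 0 (∧L 0 (⊃L 5 1 (⊃R (∧L 0 (∨R₂ (ax 7))))))))) (∧L 0 (∧L 0 (ax 1))))) (ax 0))))
      (z ∷ a ∷ b ∷ c ∷ d ∷ []) $ᵛ ≤⇒valid (closedˡ n))

  ≤-NA-meet : ∀ {a b c d e f} → Normal e f → e ≤ a → e ≤ c → b ≤ f → d ≤ f →
              e ≤ NA (a ∧ c) (b ∨ d)
  ≤-NA-meet {a} {b} {c} {d} {e} {f} n e≤a e≤c b≤f d≤f =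
    valid⇒≤ (tautology ((𝐞 ⋀ 𝐟 ⊃ 𝐳) ⊃ (𝐞 ⊃ 𝐚) ⊃ (𝐞 ⊃ 𝐜) ⊃ (𝐛 ⊃ 𝐟) ⊃ (𝐝 ⊃ 𝐟) ⊃ 𝐞 ⊃ NAᶠ (𝐚 ⋀ 𝐜) (𝐛 ⋁ 𝐝))
      (⊃R (∧⊃L 0 (⊃R (⊃R (⊃R (⊃R (⊃R (⊃L 3 0 (⊃L 4 1 (⊃L 5 2 (⊃R (∧⊃L 0 (⊃L 0 1 (⊃L 0 2 (∨L 0 (⊃L 6 0 (⊃L 2 0 (∧R (∧R (ax 3) (ax 4)) (ax 0)))) (⊃L 5 0 (⊃L 2 0 (∧R (∧R (ax 3) (ax 4)) (ax 0)))))))))))))))))))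
      (z ∷ a ∷ b ∷ c ∷ d ∷ e ∷ f ∷ []) $ᵛ ≤⇒valid (disjoint n) $ᵛ ≤⇒valid e≤a $ᵛ ≤⇒valid e≤c $ᵛ ≤⇒valid b≤f $ᵛ ≤⇒valid d≤f)

  NB-meet-≤ : ∀ {a b c d e f} → Normal e f → e ≤ a → e ≤ c → b ≤ f → d ≤ f →
              NB (a ∧ c) (b ∨ d) ≤ f
  NB-meet-≤ {a} {b} {c} {d} {e} {f} n e≤a e≤c b≤f d≤f =
    valid⇒≤ (tautology (((𝐞 ⊃ 𝐟) ⊃ 𝐟) ⊃ (𝐞 ⊃ 𝐚) ⊃ (𝐞 ⊃ 𝐜) ⊃ (𝐛 ⊃ 𝐟) ⊃ (𝐝 ⊃ 𝐟) ⊃ (𝐚 ⋀ 𝐜 ⊃ 𝐛 ⋁ 𝐝) ⊃ 𝐟)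
      (⊃R (⊃R (⊃R (⊃R (⊃R (⊃R (∧⊃L 0 (⊃⊃L 5 (⊃R (⊃L 5 0 (⊃L 6 1 (⊃L 4 0 (⊃L 0 1 (∨L 0 (⊃L 6 0 (ax 0)) (⊃L 5 0 (ax 0)))))))) (ax 0)))))))))
      (z ∷ a ∷ b ∷ c ∷ d ∷ e ∷ f ∷ []) $ᵛ ≤⇒valid (closedʳ n) $ᵛ ≤⇒valid e≤a $ᵛ ≤⇒valid e≤c $ᵛ ≤⇒valid b≤f $ᵛ ≤⇒valid d≤f)

  NA-meet : ∀ {a b c d} → Normal a b → Normal c d → NA (a ∧ c) (b ∨ d) ≈ a ∧ c
  NA-meet {a} {b} {c} {d} n n′ = ≤-antisym
    (valid⇒≤ (tautology (((𝐛 ⊃ 𝐚) ⊃ 𝐚) ⊃ ((𝐝 ⊃ 𝐜) ⊃ 𝐜) ⊃ NAᶠ (𝐚 ⋀ 𝐜) (𝐛 ⋁ 𝐝) ⊃ 𝐚 ⋀ 𝐜)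
      (⊃R (⊃R (⊃R (∧R (⊃⊃L 1 (⊃R (⊃⊃L 2 (∨⊃L 0 (⊃L 1 1 (∧L 0 (∧L 0 (⊃L 5 1 (⊃R (∧L 0 (∨R₂ (ax 7))))))))) (∧L 0 (∧L 0 (ax 1))))) (⊃⊃L 2 (⊃R (⊃⊃L 3 (∨⊃L 0 (⊃L 0 1 (∧L 0 (∧L 0 (⊃L 5 0 (⊃R (∧L 0 (∨R₁ (ax 7))))))))) (∧L 0 (∧L 0 (ax 0))))) (ax 0))) (⊃⊃L 1 (⊃R (⊃⊃L 2 (∨⊃L 0 (⊃L 1 1 (∧L 0 (∧L 0 (⊃L 5 1 (⊃R (∧L 0 (∨R₂ (ax 7))))))))) (∧L 0 (∧L 0 (ax 1))))) (ax 0))))))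
      (z ∷ a ∷ b ∷ c ∷ d ∷ []) $ᵛ ≤⇒valid (closedˡ n) $ᵛ ≤⇒valid (closedˡ n′)))
    (valid⇒≤ (tautology ((𝐚 ⋀ 𝐛 ⊃ 𝐳) ⊃ (𝐜 ⋀ 𝐝 ⊃ 𝐳) ⊃ 𝐚 ⋀ 𝐜 ⊃ NAᶠ (𝐚 ⋀ 𝐜) (𝐛 ⋁ 𝐝))
      (⊃R (∧⊃L 0 (⊃R (∧⊃L 0 (⊃R (∧L 0 (⊃L 2 1 (⊃L 3 1 (⊃R (∧⊃L 0 (⊃L 0 2 (⊃L 0 3 (∨L 0 (⊃L 1 0 (∧R (∧R (ax 3) (ax 4)) (ax 0))) (⊃L 2 0 (∧R (∧R (ax 3) (ax 4)) (ax 0))))))))))))))))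
      (z ∷ a ∷ b ∷ c ∷ d ∷ []) $ᵛ ≤⇒valid (disjoint n) $ᵛ ≤⇒valid (disjoint n′)))

  W-assoc : ∀ b d f → W (W b d) f ≈ W b (W d f)
  W-assoc b d f = ≤-antisym
    (valid⇒≤ (tautology (Wᶠ (Wᶠ 𝐛 𝐝) 𝐟 ⊃ Wᶠ 𝐛 (Wᶠ 𝐝 𝐟))
      (⊃R (∧L 0 (∧R (⊃R (∧R (⊃R (⊃⊃L 2 (⊃R (∧L 0 (⊃⊃L 0 (ax 4) (⊃L 3 0 (ax 0))))) (ax 0))) (⊃R (⊃⊃L 3 (ax 1) (∧L 0 (⊃⊃L 0 (ax 3) (ax 0))))))) (⊃R (∧⊃L 0 (⊃⊃L 2 (⊃R (⊃⊃L 2 (⊃L 0 0 (⊃R (ax 2))) (⊃⊃L 0 (⊃R (⊃L 0 1 (⊃L 3 0 (∧L 0 (⊃⊃L 0 (⊃L 0 1 (⊃L 3 0 (⊃R (ax 1)))) (ax 0)))))) (ax 0)))) (∧L 0 (⊃⊃L 1 (⊃R (⊃⊃L 2 (⊃R (⊃⊃L 4 (⊃R (⊃L 0 3 (⊃L 3 0 (⊃L 5 1 (⊃⊃L 6 (⊃L 0 2 (⊃L 4 0 (⊃R (ax 5)))) (ax 0)))))) (⊃⊃L 0 (⊃L 0 2 (⊃L 2 0 (⊃L 4 1 (⊃R (ax 2))))) (ax 0)))) (⊃⊃L 3 (⊃R (⊃L 0 1 (⊃L 4 0 (⊃⊃L 5 (⊃L 0 1 (⊃L 3 0 (⊃R (ax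 4)))) (ax 0))))) (⊃⊃L 0 (⊃L 0 0 (⊃L 3 0 (⊃R (ax 3)))) (ax 0))))) (ax 0)))))))))
      (z ∷ one ∷ b ∷ one ∷ d ∷ one ∷ f ∷ [])))
    (valid⇒≤ (tautology (Wᶠ 𝐛 (Wᶠ 𝐝 𝐟) ⊃ Wᶠ (Wᶠ 𝐛 𝐝) 𝐟)
      (⊃R (∧L 0 (∧R (⊃R (∧⊃L 0 (⊃⊃L 1 (⊃R (⊃⊃L 2 (⊃R (⊃L 0 1 (⊃L 3 0 (∧L 0 (⊃⊃L 0 (⊃L 0 1 (⊃R (ax 3))) (⊃⊃L 1 (⊃L 0 1 (⊃L 3 0 (⊃R (ax 4)))) (ax 0))))))) (⊃⊃L 0 (⊃L 0 0 (⊃L 2 0 (∧L 0 (⊃R (ax 4))))) (ax 0)))) (∧L 0 (⊃⊃L 0 (⊃R (⊃⊃L 2 (⊃R (⊃⊃L 4 (⊃L 0 2 (⊃R (ax 4))) (⊃⊃L 0 (⊃R (⊃L 0 3 (⊃L 3 0 (⊃L 5 1 (⊃⊃L 6 (⊃L 0 2 (⊃L 4 0 (⊃R (ax 1)))) (ax 0)))))) (ax 0)))) (⊃⊃L 3 (⊃L 0 0 (⊃R (ax 2))) (⊃⊃L 0 (⊃R (⊃L 0 1 (⊃L 4 0 (⊃⊃L 5 (⊃L 0 1 (⊃L 3 0 (⊃R (ax 1)))) (ax 0))))) (ax 0))))) (ax 0)))))) (⊃R (∧R (⊃R (⊃⊃L 2 (ax 1) (∧L 0 (⊃⊃L 1 (ax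 3) (ax 0))))) (⊃R (⊃⊃L 3 (⊃R (∧L 0 (⊃⊃L 0 (ax 3) (⊃L 4 0 (ax 0))))) (ax 0))))))))
      (z ∷ one ∷ b ∷ one ∷ d ∷ one ∷ f ∷ [])))

  W-comm-≤ : ∀ b d → W b d ≤ W d b
  W-comm-≤ b d =
    valid⇒≤ (tautology (Wᶠ 𝐛 𝐝 ⊃ Wᶠ 𝐝 𝐛)
      (⊃R (∧L 0 (∧R (ax 1) (ax 0))))
      (z ∷ one ∷ b ∷ one ∷ d ∷ []))

  W-comm : ∀ b d → W b d ≈ W d b
  W-comm b d = ≤-antisym (W-comm-≤ b d) (W-comm-≤ d b)

  W-identityʳ : ∀ b → W b z ≈ b
  W-identityʳ b = ≤-antisym
    (valid⇒≤ (tautology (Wᶠ 𝐛 𝐳 ⊃ 𝐛)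
      (⊃R (∧L 0 (⊃⊃L 1 (⊃R (ax 0)) (ax 0))))
      (z ∷ one ∷ b ∷ [])))
    (valid⇒≤ (tautology (𝐛 ⊃ Wᶠ 𝐛 𝐳)
      (⊃R (∧R (⊃R (⊃L 0 0 (ax 0))) (⊃R (ax 1))))
      (z ∷ one ∷ b ∷ [])))

  W-idem : ∀ b → W b b ≈ b
  W-idem b = ≤-antisym
    (valid⇒≤ (tautology (bpᶠ 𝐛 ⊃ Wᶠ 𝐛 𝐛 ⊃ 𝐛)
      (⊃R (∨L 0 (⊃R (ax 1)) (⊃R (∧L 0 (⊃⊃L 0 (ax 2) (ax 0))))))
      (z ∷ one ∷ b ∷ []) $ᵛ bp b))
    (valid⇒≤ (tautology (𝐛 ⊃ Wᶠ 𝐛 𝐛)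
      (⊃R (∧R (⊃R (ax 1)) (⊃R (ax 1))))
      (z ∷ one ∷ b ∷ [])))

  NA-W-normaliseˡ : ∀ a b c d → NA (NA a b ∧ c) (W (NB a b) d) ≈ NA (a ∧ c) (W b d)
  NA-W-normaliseˡ a b c d = ≤-antisym
    (valid⇒≤ (tautology (NAᶠ (NAᶠ 𝐚 𝐛 ⋀ 𝐜) (Wᶠ (𝐚 ⊃ 𝐛) 𝐝) ⊃ NAᶠ (𝐚 ⋀ 𝐜) (Wᶠ 𝐛 𝐝))
      (⊃R (⊃R (∧⊃L 0 (∧R (∧R (⊃⊃L 1 (∧⊃L 0 (⊃R (∧L 0 (∧R (⊃R (⊃⊃L 0 (⊃R (⊃L 5 0 (⊃L 0 3 (∧L 0 (⊃⊃L 0 (ax 3) (⊃⊃L 1 (⊃R (⊃⊃L 5 (⊃R (⊃⊃L 8 (⊃L 0 2 (⊃R (ax 4))) (⊃⊃L 0 (⊃R (⊃L 0 3 (⊃L 5 0 (⊃L 4 0 (∧L 0 (⊃L 9 2 (⊃R (ax 4)))))))) (∧L 0 (∧L 0 (⊃L 6 2 (ax 0))))))) (∧L 0 (ax 1)))) (ax 0))))))) (⊃⊃L 1 (⊃R (⊃L 5 0 (⊃L 0 3 (∧L 0 (⊃⊃L 0 (⊃L 0 3 (⊃R (ax 5))) (⊃⊃L 1 (⊃L 0 3 (⊃L 3 0 (∧L 0 (⊃R (ax 2))))) (ax 0))))))) (∧L 0 (⊃L 5 0 (⊃L 0 3 (∧L 0 (⊃⊃L 0 (⊃L 0 2 (⊃R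 (ax 4))) (ax 0))))))))) (⊃R (⊃R (⊃L 5 0 (⊃L 0 3 (∧L 0 (⊃⊃L 0 (⊃R (⊃⊃L 2 (ax 4) (⊃⊃L 5 (⊃L 0 0 (∧L 0 (⊃L 4 1 (⊃L 6 0 (⊃R (ax 5)))))) (∧L 0 (ax 1))))) (⊃L 3 0 (⊃⊃L 2 (⊃L 0 0 (⊃R (ax 2))) (ax 0))))))))))))) (∧L 0 (∧L 0 (⊃⊃L 0 (⊃R (⊃L 4 0 (⊃L 0 2 (∧L 0 (⊃⊃L 0 (⊃L 0 4 (⊃R (ax 6))) (⊃⊃L 1 (⊃L 0 4 (⊃L 3 0 (∧L 0 (⊃R (ax 2))))) (ax 0))))))) (∧L 0 (ax 0)))))) (⊃⊃L 1 (∧⊃L 0 (⊃R (∧L 0 (∧R (⊃R (⊃⊃L 0 (⊃R (⊃L 5 0 (⊃L 0 3 (∧L 0 (⊃⊃L 0 (ax 3) (⊃⊃L 1 (⊃R (⊃⊃L 5 (⊃R (⊃⊃L 8 (⊃L 0 2 (⊃R (ax 4))) (⊃⊃L 0 (⊃R (⊃L 0 3 (⊃L 5 0 (⊃L 4 0 (∧L 0 (⊃L 9 2 (⊃R (ax 4)))))))) (∧L 0 (∧L 0 (⊃L 6 2 (ax 0))))))) (∧L 0 (ax 1)))) (ax 0))))))) (⊃⊃L 1 (⊃R (⊃L 5 0 (⊃L 0 3 (∧L 0 (⊃⊃L 0 (⊃L 0 3 (⊃R (ax 5))) (⊃⊃L 1 (⊃L 0 3 (⊃L 3 0 (∧L 0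 (⊃R (ax 2))))) (ax 0))))))) (∧L 0 (⊃L 5 0 (⊃L 0 3 (∧L 0 (⊃⊃L 0 (⊃L 0 2 (⊃R (ax 4))) (ax 0))))))))) (⊃R (⊃R (⊃L 5 0 (⊃L 0 3 (∧L 0 (⊃⊃L 0 (⊃R (⊃⊃L 2 (ax 4) (⊃⊃L 5 (⊃L 0 0 (∧L 0 (⊃L 4 1 (⊃L 6 0 (⊃R (ax 5)))))) (∧L 0 (ax 1))))) (⊃L 3 0 (⊃⊃L 2 (⊃L 0 0 (⊃R (ax 2))) (ax 0))))))))))))) (∧L 0 (∧L 0 (ax 1))))) (⊃⊃L 1 (∧⊃L 0 (⊃R (∧L 0 (∧R (⊃R (⊃⊃L 0 (⊃R (⊃L 5 0 (⊃L 0 3 (∧L 0 (⊃⊃L 0 (ax 3) (⊃⊃L 1 (⊃R (⊃⊃L 5 (⊃R (⊃⊃L 8 (⊃L 0 2 (⊃R (ax 4))) (⊃⊃L 0 (⊃R (⊃L 0 3 (⊃L 5 0 (⊃L 4 0 (∧L 0 (⊃L 9 2 (⊃R (ax 4)))))))) (∧L 0 (∧L 0 (⊃L 6 2 (ax 0))))))) (∧L 0 (ax 1)))) (ax 0))))))) (⊃⊃L 1 (⊃R (⊃L 5 0 (⊃L 0 3 (∧L 0 (⊃⊃L 0 (⊃L 0 3 (⊃R (ax 5))) (⊃⊃L 1 (⊃L 0 3 (⊃L 3 0 (∧L 0 (⊃R (ax 2))))) (ax 0))))))) (∧L 0 (⊃L 5 0 (⊃L 0 3 (∧L 0 (⊃⊃L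 0 (⊃L 0 2 (⊃R (ax 4))) (ax 0))))))))) (⊃R (⊃R (⊃L 5 0 (⊃L 0 3 (∧L 0 (⊃⊃L 0 (⊃R (⊃⊃L 2 (ax 4) (⊃⊃L 5 (⊃L 0 0 (∧L 0 (⊃L 4 1 (⊃L 6 0 (⊃R (ax 5)))))) (∧L 0 (ax 1))))) (⊃L 3 0 (⊃⊃L 2 (⊃L 0 0 (⊃R (ax 2))) (ax 0))))))))))))) (∧L 0 (ax 1)))))))
      (z ∷ a ∷ b ∷ c ∷ d ∷ [])))
    (valid⇒≤ (tautology (NAᶠ (𝐚 ⋀ 𝐜) (Wᶠ 𝐛 𝐝) ⊃ NAᶠ (NAᶠ 𝐚 𝐛 ⋀ 𝐜) (Wᶠ (𝐚 ⊃ 𝐛) 𝐝))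
      (⊃R (⊃R (∧⊃L 0 (∧R (∧R (⊃R (∧R (⊃⊃L 1 (∧⊃L 0 (⊃R (∧R (⊃⊃L 3 (∧⊃L 0 (⊃R (∧L 0 (⊃L 3 0 (⊃L 4 1 (⊃L 5 2 (∧R (⊃R (⊃L 0 0 (⊃L 2 0 (⊃L 0 4 (∧L 0 (⊃⊃L 0 (⊃L 0 1 (⊃R (ax 3))) (ax 0))))))) (⊃R (ax 1))))))))) (∧L 0 (∧L 0 (ax 0)))) (⊃⊃L 3 (∧⊃L 0 (⊃R (∧L 0 (⊃L 3 0 (⊃L 4 1 (⊃L 5 2 (∧R (⊃R (⊃L 0 0 (⊃L 2 0 (⊃L 0 4 (∧L 0 (⊃⊃L 0 (⊃L 0 1 (⊃R (ax 3))) (ax 0))))))) (⊃R (ax 1))))))))) (∧L 0 (ax 1)))))) (⊃⊃L 2 (∧⊃L 0 (⊃R (∧L 0 (⊃L 3 1 (∧L 0 (⊃L 5 2 (∧R (⊃R (⊃L 0 0 (⊃⊃L 2 (⊃L 0 0 (⊃R (ax 2))) (ax 0)))) (⊃R (ax 1))))))))) (∧L 0 (∧L 0 (ax 0))))) (⊃⊃L 1 (∧⊃L 0 (⊃R (∧R (⊃⊃L 3 (∧⊃L 0 (⊃R (∧L 0 (⊃L 3 0 (⊃L 4 1 (⊃L 5 2 (∧R (⊃R (⊃L 0 0 (⊃L 2 0 (⊃L 0 4 (∧L 0 (⊃⊃L 0 (⊃L 0 1 (⊃R (ax 3))) (ax 0))))))) (⊃R (ax 1))))))))) (∧L 0 (∧L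 0 (ax 0)))) (⊃⊃L 3 (∧⊃L 0 (⊃R (∧L 0 (⊃L 3 0 (⊃L 4 1 (⊃L 5 2 (∧R (⊃R (⊃L 0 0 (⊃L 2 0 (⊃L 0 4 (∧L 0 (⊃⊃L 0 (⊃L 0 1 (⊃R (ax 3))) (ax 0))))))) (⊃R (ax 1))))))))) (∧L 0 (ax 1)))))) (⊃⊃L 2 (∧⊃L 0 (⊃R (∧L 0 (⊃L 3 1 (∧L 0 (⊃L 5 2 (∧R (⊃R (⊃L 0 0 (⊃⊃L 2 (⊃L 0 0 (⊃R (ax 2))) (ax 0)))) (⊃R (ax 1))))))))) (∧L 0 (ax 1)))))) (⊃⊃L 0 (∧⊃L 0 (⊃R (∧R (⊃⊃L 2 (∧⊃L 0 (⊃R (∧L 0 (⊃L 3 0 (⊃L 4 1 (∧R (⊃R (⊃L 0 1 (⊃L 1 0 (⊃L 0 3 (∧L 0 (⊃⊃L 0 (⊃L 0 1 (⊃R (ax 3))) (ax 0))))))) (⊃R (ax 2)))))))) (∧L 0 (∧L 0 (ax 0)))) (⊃⊃L 2 (∧⊃L 0 (⊃R (∧L 0 (⊃L 3 0 (⊃L 4 1 (∧R (⊃R (⊃L 0 1 (⊃L 1 0 (⊃L 0 3 (∧L 0 (⊃⊃L 0 (⊃L 0 1 (⊃R (ax 3))) (ax 0))))))) (⊃R (ax 2)))))))) (∧L 0 (ax 1)))))) (⊃⊃L 1 (∧⊃L 0 (⊃R (∧L 0 (⊃L 3 1 (∧L 0 (∧R (⊃R (⊃⊃L 1 (⊃R (⊃L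 0 3 (⊃L 2 0 (ax 0)))) (ax 0))) (⊃R (⊃⊃L 1 (⊃R (⊃L 0 3 (⊃⊃L 3 (ax 3) (⊃L 0 3 (⊃⊃L 6 (⊃R (⊃L 0 1 (⊃L 4 0 (ax 0)))) (⊃⊃L 0 (⊃L 0 0 (∧L 0 (∧L 0 (⊃L 5 2 (⊃L 6 0 (⊃R (ax 6))))))) (∧L 0 (ax 1)))))))) (⊃L 1 0 (⊃⊃L 2 (⊃L 0 0 (⊃L 0 2 (⊃R (ax 2)))) (⊃L 0 2 (ax 0)))))))))))) (∧L 0 (∧L 0 (ax 1)))))) (⊃⊃L 0 (∧⊃L 0 (⊃R (∧R (⊃⊃L 2 (∧⊃L 0 (⊃R (∧L 0 (⊃L 3 0 (⊃L 4 1 (∧R (⊃R (⊃L 0 1 (⊃L 1 0 (⊃L 0 3 (∧L 0 (⊃⊃L 0 (⊃L 0 1 (⊃R (ax 3))) (ax 0))))))) (⊃R (ax 2)))))))) (∧L 0 (∧L 0 (ax 0)))) (⊃⊃L 2 (∧⊃L 0 (⊃R (∧L 0 (⊃L 3 0 (⊃L 4 1 (∧R (⊃R (⊃L 0 1 (⊃L 1 0 (⊃L 0 3 (∧L 0 (⊃⊃L 0 (⊃L 0 1 (⊃R (ax 3))) (ax 0))))))) (⊃R (ax 2)))))))) (∧L 0 (ax 1)))))) (⊃⊃L 1 (∧⊃L 0 (⊃R (∧L 0 (⊃L 3 1 (∧L 0 (∧R (⊃R (⊃⊃L 1 (⊃R (⊃L 0 3 (⊃L 2 0 (ax 0)))) (ax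 0))) (⊃R (⊃⊃L 1 (⊃R (⊃L 0 3 (⊃⊃L 3 (ax 3) (⊃L 0 3 (⊃⊃L 6 (⊃R (⊃L 0 1 (⊃L 4 0 (ax 0)))) (⊃⊃L 0 (⊃L 0 0 (∧L 0 (∧L 0 (⊃L 5 2 (⊃L 6 0 (⊃R (ax 6))))))) (∧L 0 (ax 1)))))))) (⊃L 1 0 (⊃⊃L 2 (⊃L 0 0 (⊃L 0 2 (⊃R (ax 2)))) (⊃L 0 2 (ax 0)))))))))))) (∧L 0 (ax 1))))))))
      (z ∷ a ∷ b ∷ c ∷ d ∷ [])))

  NB-W-normaliseˡ : ∀ a b c d → NB (NA a b ∧ c) (W (NB a b) d) ≈ NB (a ∧ c) (W b d)
  NB-W-normaliseˡ a b c d = ≤-antisym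
    (valid⇒≤ (tautology (bpᶠ 𝐛 ⊃ (NAᶠ 𝐚 𝐛 ⋀ 𝐜 ⊃ Wᶠ (𝐚 ⊃ 𝐛) 𝐝) ⊃ 𝐚 ⋀ 𝐜 ⊃ Wᶠ 𝐛 𝐝)
      (⊃R (∨L 0 (⊃R (∧⊃L 0 (⊃R (∧L 0 (∧R (⊃R (⊃L 0 3 (⊃⊃L 3 (∧⊃L 0 (⊃L 0 1 (⊃L 0 0 (⊃L 0 2 (∧L 0 (⊃R (⊃L 0 3 (∧R (ax 4) (ax 3))))))))) (⊃L 0 2 (∧L 0 (⊃⊃L 0 (⊃L 0 1 (⊃R (ax 3))) (ax 0))))))) (⊃R (ax 4))))))) (⊃R (∧⊃L 0 (⊃R (∧L 0 (∧R (⊃R (⊃⊃L 3 (∧⊃L 0 (⊃L 0 1 (⊃R (⊃L 0 2 (⊃L 2 0 (⊃L 2 0 (⊃L 0 3 (∧L 0 (⊃L 6 3 (∧R (ax 5) (ax 0))))))))))) (⊃L 0 2 (∧L 0 (⊃⊃L 0 (⊃R (⊃L 0 3 (⊃L 3 0 (ax 0)))) (ax 0)))))) (⊃R (⊃⊃L 3 (∧⊃L 0 (⊃L 0 1 (⊃R (⊃L 0 2 (⊃L 5 0 (⊃L 2 0 (⊃L 0 4 (∧L 0 (∧R (ax 5) (ax 2)))))))))) (⊃L 0 2 (∧L 0 (⊃⊃L 0 (⊃R (⊃L 0 3 (⊃L 6 0 (ax 0)))) (⊃L 2 0 (⊃⊃L 2 (⊃L 0 0 (⊃L 0 2 (⊃L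 5 0 (⊃R (ax 1))))) (⊃L 0 2 (ax 0))))))))))))))))
      (z ∷ a ∷ b ∷ c ∷ d ∷ []) $ᵛ bp b))
    (valid⇒≤ (tautology (bpᶠ 𝐝 ⊃ (𝐚 ⋀ 𝐜 ⊃ Wᶠ 𝐛 𝐝) ⊃ NAᶠ 𝐚 𝐛 ⋀ 𝐜 ⊃ Wᶠ (𝐚 ⊃ 𝐛) 𝐝)
      (⊃R (∨L 0 (⊃R (∧⊃L 0 (⊃R (∧L 0 (∧R (⊃R (ax 4)) (⊃R (⊃L 0 3 (⊃R (⊃L 4 0 (⊃L 0 3 (∧L 0 (⊃⊃L 0 (⊃L 0 2 (⊃R (ax 4))) (⊃⊃L 1 (⊃L 0 2 (⊃R (ax 4))) (ax 0)))))))))))))) (⊃R (∧⊃L 0 (⊃R (∧L 0 (∧R (⊃R (⊃⊃L 0 (⊃R (⊃L 4 0 (⊃L 0 3 (∧L 0 (⊃⊃L 0 (ax 3) (⊃L 6 0 (⊃⊃L 2 (⊃L 0 0 (⊃L 4 0 (⊃R (ax 1)))) (ax 0)))))))) (⊃⊃L 1 (⊃R (⊃L 4 0 (⊃L 0 3 (∧L 0 (⊃⊃L 0 (⊃L 0 3 (⊃L 6 0 (⊃R (ax 1)))) (⊃L 6 0 (⊃⊃L 2 (⊃L 0 0 (⊃L 4 0 (∧L 0 (⊃R (ax 2))))) (ax 0)))))))) (∧L 0 (⊃L 4 0 (⊃L 0 3 (∧L 0 (⊃⊃L 0 (⊃L 0 2 (⊃L 6 0 (⊃R (ax 1)))) (ax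 0))))))))) (⊃R (⊃R (⊃L 4 0 (⊃L 0 3 (∧L 0 (⊃⊃L 0 (⊃R (⊃⊃L 2 (ax 4) (⊃⊃L 5 (⊃L 0 0 (∧L 0 (⊃L 4 1 (⊃L 6 0 (⊃L 8 1 (⊃R (ax 6))))))) (∧L 0 (ax 1))))) (⊃L 3 0 (⊃L 6 1 (⊃⊃L 3 (⊃L 0 0 (⊃R (ax 2))) (ax 0)))))))))))))))))
      (z ∷ a ∷ b ∷ c ∷ d ∷ []) $ᵛ bp d))

  ProductBelow : Carrier → Carrier → Carrier → Carrier → Carrier → Carrier → Set ℓ
  ProductBelow a b c d e f = ((a ∧ c) ∧ f) ≤ ((b ∨ d) ∨ e) × (((a ∧ c) ∧ f) ∧ z) ≤ ((b ∧ d) ∧ e)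

  productBelow⁺ : ∀ {a b c d e f} → NA (a ∧ c) (W b d) ≤ e → f ≤ NB (a ∧ c) (W b d) →
                  ProductBelow a b c d e f
  productBelow⁺ {a} {b} {c} {d} {e} {f} ≤e f≤ =
    valid⇒≤ (tautology (bpᶠ 𝐝 ⊃ (𝐟 ⊃ 𝐚 ⋀ 𝐜 ⊃ Wᶠ 𝐛 𝐝) ⊃ (𝐚 ⋀ 𝐜) ⋀ 𝐟 ⊃ (𝐛 ⋁ 𝐝) ⋁ 𝐞)
      (⊃R (∨L 0 (⊃R (⊃R (∧L 0 (∧L 0 (⊃L 3 2 (∧⊃L 0 (⊃L 0 0 (⊃L 0 1 (∧L 0 (∨R₁ (∨R₂ (ax 5)))))))))))) (⊃R (⊃R (∧L 0 (∧L 0 (⊃L 3 2 (∧⊃L 0 (⊃L 0 0 (⊃L 0 1 (∧L 0 (∨R₁ (∨R₁ (⊃⊃L 1 (ax 5) (ax 0)))))))))))))))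
      (z ∷ a ∷ b ∷ c ∷ d ∷ e ∷ f ∷ []) $ᵛ bp d $ᵛ ≤⇒valid f≤) ,
    valid⇒≤ (tautology ((NAᶠ (𝐚 ⋀ 𝐜) (Wᶠ 𝐛 𝐝) ⊃ 𝐞) ⊃ (𝐟 ⊃ 𝐚 ⋀ 𝐜 ⊃ Wᶠ 𝐛 𝐝) ⊃ ((𝐚 ⋀ 𝐜) ⋀ 𝐟) ⋀ 𝐳 ⊃ (𝐛 ⋀ 𝐝) ⋀ 𝐞)
      (⊃R (⊃R (⊃R (∧L 0 (∧L 0 (∧L 0 (⊃L 4 2 (∧⊃L 0 (⊃L 0 0 (⊃L 0 1 (∧L 0 (∧R (∧R (⊃⊃L 0 (⊃L 0 4 (⊃R (ax 6))) (⊃⊃L 1 (⊃L 0 4 (⊃R (ax 6))) (ax 0))) (⊃⊃L 0 (⊃L 0 4 (⊃R (ax 6))) (ax 0))) (⊃⊃L 0 (⊃L 0 4 (⊃R (ax 6))) (⊃⊃L 1 (⊃L 0 4 (⊃R (ax 6))) (⊃⊃L 6 (∧⊃L 0 (∧⊃L 0 (⊃L 0 2 (⊃L 0 3 (⊃L 0 5 (⊃R (∧⊃L 0 (⊃L 0 3 (⊃L 0 4 (∧L 0 (∧R (∧R (ax 5) (ax 6)) (ax 8)))))))))))) (ax 0))))))))))))))))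
      (z ∷ a ∷ b ∷ c ∷ d ∷ e ∷ f ∷ []) $ᵛ ≤⇒valid ≤e $ᵛ ≤⇒valid f≤)

  productBelow⁻ : ∀ {a b c d e f} → Normal e f → ProductBelow a b c d e f →
                  NA (a ∧ c) (W b d) ≤ e × f ≤ NB (a ∧ c) (W b d)
  productBelow⁻ {a} {b} {c} {d} {e} {f} n (k , k′) =
    valid⇒≤ (tautology (((𝐟 ⊃ 𝐞) ⊃ 𝐞) ⊃ bpᶠ 𝐞 ⊃ ((𝐚 ⋀ 𝐜) ⋀ 𝐟 ⊃ (𝐛 ⋁ 𝐝) ⋁ 𝐞) ⊃ (((𝐚 ⋀ 𝐜) ⋀ 𝐟) ⋀ 𝐳 ⊃ (𝐛 ⋀ 𝐝) ⋀ 𝐞) ⊃ NAᶠ (𝐚 ⋀ 𝐜) (Wᶠ 𝐛 𝐝) ⊃ 𝐞)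
      (⊃R (⊃R (∨L 0 (⊃R (∧⊃L 0 (∧⊃L 0 (⊃R (∧⊃L 0 (∧⊃L 0 (∧⊃L 0 (⊃R (ax 3))))))))) (⊃R (∧⊃L 0 (∧⊃L 0 (⊃R (∧⊃L 0 (∧⊃L 0 (∧⊃L 0 (⊃R (⊃⊃L 4 (⊃R (⊃⊃L 2 (∧⊃L 0 (⊃R (∧L 0 (⊃L 5 0 (⊃L 0 1 (⊃L 0 3 (⊃L 6 1 (⊃L 0 2 (⊃L 0 4 (∨L 0 (∨L 0 (∧R (⊃R (⊃L 0 0 (⊃L 2 0 (∧L 0 (∧L 0 (ax 1)))))) (⊃R (ax 1))) (∧R (⊃R (ax 1)) (⊃R (⊃L 0 0 (⊃L 2 0 (∧L 0 (∧L 0 (ax 0)))))))) (⊃L 6 0 (⊃L 7 0 (⊃L 3 0 (∧L 0 (∧L 0 (∧R (⊃R (ax 2)) (⊃R (ax 1)))))))))))))))))) (∧L 0 (∧L 0 (⊃L 5 0 (⊃L 0 1 (⊃L 0 3 (⊃L 0 2 (∧L 0 (ax 1)))))))))) (ax 0)))))))))))))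
      (z ∷ a ∷ b ∷ c ∷ d ∷ e ∷ f ∷ []) $ᵛ ≤⇒valid (closedˡ n) $ᵛ bp e $ᵛ ≤⇒valid k $ᵛ ≤⇒valid k′) ,
    valid⇒≤ (tautology ((𝐞 ⋀ 𝐟 ⊃ 𝐳) ⊃ ((𝐚 ⋀ 𝐜) ⋀ 𝐟 ⊃ (𝐛 ⋁ 𝐝) ⋁ 𝐞) ⊃ (((𝐚 ⋀ 𝐜) ⋀ 𝐟) ⋀ 𝐳 ⊃ (𝐛 ⋀ 𝐝) ⋀ 𝐞) ⊃ 𝐟 ⊃ 𝐚 ⋀ 𝐜 ⊃ Wᶠ 𝐛 𝐝)
      (⊃R (∧⊃L 0 (⊃R (∧⊃L 0 (∧⊃L 0 (⊃R (∧⊃L 0 (∧⊃L 0 (∧⊃L 0 (⊃R (⊃R (∧L 0 (⊃L 3 0 (⊃L 0 1 (⊃L 0 2 (⊃L 4 1 (⊃L 0 2 (⊃L 0 3 (∨L 0 (∨L 0 (∧R (⊃R (⊃L 0 0 (⊃L 2 0 (∧L 0 (∧L 0 (ax 1)))))) (⊃R (ax 1))) (∧R (⊃R (ax 1)) (⊃R (⊃L 0 0 (⊃L 2 0 (∧L 0 (∧L 0 (ax 0)))))))) (⊃L 5 0 (⊃L 0 4 (⊃L 2 0 (∧L 0 (∧L 0 (∧R (⊃R (ax 2)) (⊃R (ax 1)))))))))))))))))))))))))))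
      (z ∷ a ∷ b ∷ c ∷ d ∷ e ∷ f ∷ []) $ᵛ ≤⇒valid (disjoint n) $ᵛ ≤⇒valid k $ᵛ ≤⇒valid k′)

  productBelow-swap : ∀ {a b c d e f} → ProductBelow a b c d e f → ProductBelow a b f e d c
  productBelow-swap {a} {b} {c} {d} {e} {f} (k , k′) =
    valid⇒≤ (tautology (((𝐚 ⋀ 𝐜) ⋀ 𝐟 ⊃ (𝐛 ⋁ 𝐝) ⋁ 𝐞) ⊃ (𝐚 ⋀ 𝐟) ⋀ 𝐜 ⊃ (𝐛 ⋁ 𝐞) ⋁ 𝐝)
      (⊃R (∧⊃L 0 (∧⊃L 0 (⊃R (∧L 0 (∧L 0 (⊃L 3 0 (⊃L 0 2 (⊃L 0 1 (∨L 0 (∨L 0 (∨R₁ (∨R₁ (ax 0))) (∨R₂ (ax 0))) (∨R₁ (∨R₂ (ax 0)))))))))))))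
      (z ∷ a ∷ b ∷ c ∷ d ∷ e ∷ f ∷ []) $ᵛ ≤⇒valid k) ,
    valid⇒≤ (tautology ((((𝐚 ⋀ 𝐜) ⋀ 𝐟) ⋀ 𝐳 ⊃ (𝐛 ⋀ 𝐝) ⋀ 𝐞) ⊃ ((𝐚 ⋀ 𝐟) ⋀ 𝐜) ⋀ 𝐳 ⊃ (𝐛 ⋀ 𝐞) ⋀ 𝐝)
      (⊃R (∧⊃L 0 (∧⊃L 0 (∧⊃L 0 (⊃R (∧L 0 (∧L 0 (∧L 0 (⊃L 4 0 (⊃L 0 2 (⊃L 0 1 (⊃L 0 3 (∧L 0 (∧L 0 (∧R (∧R (ax 0) (ax 2)) (ax 1))))))))))))))))
      (z ∷ a ∷ b ∷ c ∷ d ∷ e ∷ f ∷ []) $ᵛ ≤⇒valid k′)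

  NA-one-z : NA one z ≈ one
  NA-one-z = ≤-antisym
    (one-top _)
    (valid⇒≤ (tautology (⊤ᶠ ⊃ NAᶠ ⊤ᶠ 𝐳)
      (⊃R (⊤L 0 (⊃R (⊤⊃L 0 (∧R ⊤R (ax 0))))))
      (z ∷ [])))

  NA-z-one : NA z one ≈ z
  NA-z-one = ≤-antisym
    (valid⇒≤ (tautology (NAᶠ 𝐳 ⊤ᶠ ⊃ 𝐳)
      (⊃R (⊃⊃L 0 (⊤⊃L 0 (∧L 0 (⊃R ⊤R))) (∧L 0 (ax 0))))
      (z ∷ [])))
    (valid⇒≤ (tautology (𝐳 ⊃ NAᶠ 𝐳 ⊤ᶠ)
      (⊃R (⊃R (⊃L 0 0 (⊤L 0 (∧R (ax 0) (ax 0))))))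
      (z ∷ [])))

  NA-z : ∀ a → NA a z ≈ a
  NA-z a = ≤-antisym
    (valid⇒≤ (tautology (bpᶠ 𝐚 ⊃ NAᶠ 𝐚 𝐳 ⊃ 𝐚)
      (⊃R (∨L 0 (⊃R (ax 1)) (⊃R (⊃⊃L 0 (ax 1) (∧L 0 (ax 0))))))
      (z ∷ a ∷ []) $ᵛ bp a))
    (valid⇒≤ (tautology (𝐚 ⊃ NAᶠ 𝐚 𝐳)
      (⊃R (⊃R (⊃L 0 0 (∧R (ax 1) (ax 0)))))
      (z ∷ a ∷ [])))

  NA-meet-one : ∀ {a b} → Normal a b →
                NA (NA one z ∧ NA a b) (NB one z ∨ NB a b) ≈ NA a (a ⇒ (z ∨ b))
  NA-meet-one {a} {b} n = ≤-antisym
    (valid⇒≤ (tautology (((𝐛 ⊃ 𝐚) ⊃ 𝐚) ⊃ NAᶠ (NAᶠ ⊤ᶠ 𝐳 ⋀ NAᶠ 𝐚 𝐛) ((⊤ᶠ ⊃ 𝐳) ⋁ (𝐚 ⊃ 𝐛)) ⊃ NAᶠ 𝐚 (𝐚 ⊃ 𝐳 ⋁ 𝐛))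
      (⊃R (⊃R (⊃R (∧R (⊃⊃L 1 (∨⊃L 0 (⊃R (∧L 0 (∨R₁ (⊃R (⊤L 0 (⊃⊃L 0 (⊃R (⊤L 0 (⊃⊃L 2 (⊃R (⊤L 0 (⊃⊃L 5 (⊃R (⊃⊃L 4 (⊃L 0 0 (∧L 0 (⊃L 3 0 (⊃L 4 2 (∧L 0 (∧L 0 (⊃L 7 2 (∧L 0 (⊤L 0 (⊃L 9 4 (⊃L 0 4 (∨L 0 (⊃R (ax 9)) (⊃R (ax 1)))))))))))))) (∧L 0 (ax 0)))) (⊃L 5 0 (⊃L 0 0 (∨L 0 (ax 0) (⊃⊃L 4 (⊃L 0 0 (∧L 0 (⊃L 4 1 (∧L 0 (∧L 0 (⊃L 7 2 (∧L 0 (⊤L 0 (⊃R (ax 7)))))))))) (∧L 0 (ax 1))))))))) (∧L 0 (ax 1))))) (∧L 0 (ax 1))))))))) (∧L 0 (∧L 0 (⊃⊃L 0 (⊃L 0 1 (∧L 0 (⊤L 0 (⊃R (ax 1))))) (∧L 0 (⊤L 0 (⊃⊃L 4 (⊃R (⊃⊃L 3 (⊃L 0 0 (∧L 0 (⊃L 3 0 (⊃L 6 0 (⊃L 0 0 (∨L 0 (⊃R (ax 5)) (⊃R (ax 1)))))))) (∧L 0 (ax 0)))) (ax 0)))))))) (⊃⊃L 1 (∨⊃L 0 (⊃R (∧L 0 (∨R₁ (⊃R (⊤L 0 (⊃⊃L 0 (⊃R (⊤L 0 (⊃⊃L 2 (⊃R (⊤L 0 (⊃⊃L 5 (⊃R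 (⊃⊃L 4 (⊃L 0 0 (∧L 0 (⊃L 3 0 (⊃L 4 2 (∧L 0 (∧L 0 (⊃L 7 2 (∧L 0 (⊤L 0 (⊃L 9 4 (⊃L 0 4 (∨L 0 (⊃R (ax 9)) (⊃R (ax 1)))))))))))))) (∧L 0 (ax 0)))) (⊃L 5 0 (⊃L 0 0 (∨L 0 (ax 0) (⊃⊃L 4 (⊃L 0 0 (∧L 0 (⊃L 4 1 (∧L 0 (∧L 0 (⊃L 7 2 (∧L 0 (⊤L 0 (⊃R (ax 7)))))))))) (∧L 0 (ax 1))))))))) (∧L 0 (ax 1))))) (∧L 0 (ax 1))))))))) (∧L 0 (ax 1)))))))
      (z ∷ a ∷ b ∷ []) $ᵛ ≤⇒valid (closedˡ n)))
    (valid⇒≤ (tautology (NAᶠ 𝐚 (𝐚 ⊃ 𝐳 ⋁ 𝐛) ⊃ NAᶠ (NAᶠ ⊤ᶠ 𝐳 ⋀ NAᶠ 𝐚 𝐛) ((⊤ᶠ ⊃ 𝐳) ⋁ (𝐚 ⊃ 𝐛)))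
      (⊃R (⊃R (∧⊃L 0 (∧R (∧R (⊃R (⊤⊃L 0 (∧R ⊤R (ax 0)))) (⊃R (∧R (⊃⊃L 1 (∧⊃L 0 (⊤⊃L 0 (⊃R (⊤⊃L 0 (⊃L 1 0 (∧R ⊤R (ax 1))))))) (⊃⊃L 0 (∧⊃L 0 (⊃R (∧R (⊃⊃L 3 (⊃R (⊃L 2 0 (⊃L 3 1 (⊃L 4 2 (⊃R (∨R₁ (⊃⊃L 5 (∨⊃L 0 (⊃L 1 2 (∧L 0 (⊃L 2 1 (∧L 0 (⊃L 6 1 (∨L 0 (⊤⊃L 0 (⊃R (∨R₁ (ax 1)))) (⊃L 0 0 (⊃R (∨R₁ (ax 3))))))))))) (∧L 0 (ax 1))))))))) (∧L 0 (ax 0))) (⊃⊃L 3 (⊃R (⊃L 2 0 (⊃L 3 1 (⊃L 4 2 (⊃R (∨R₁ (⊃⊃L 5 (∨⊃L 0 (⊃L 1 2 (∧L 0 (⊃L 2 1 (∧L 0 (⊃L 6 1 (∨L 0 (⊤⊃L 0 (⊃R (∨R₁ (ax 1)))) (⊃L 0 0 (⊃R (∨R₁ (ax 3))))))))))) (∧L 0 (ax 1))))))))) (∧L 0 (ax 1)))))) (∨L 0 (⊤⊃L 0 (⊃⊃L 2 (⊃R (⊃L 3 0 (⊃R (∨R₁ (ax 4))))) (∧L 0 (ax 0)))) (⊃⊃L 2 (⊃R (⊃L 2 0 (⊃L 3 1 (⊃R (∨R₁ (⊃⊃L 4 (∨⊃L 0 (⊃L 1 2 (∧L 0 (⊃L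 2 1 (∧L 0 (⊃R (∨R₁ (ax 2)))))))) (∧L 0 (ax 1)))))))) (∧L 0 (ax 0)))))) (⊃⊃L 1 (∧⊃L 0 (⊤⊃L 0 (⊃R (⊤⊃L 0 (⊃L 1 0 (∧R ⊤R (ax 1))))))) (⊃⊃L 0 (∧⊃L 0 (⊃R (∧R (⊃⊃L 3 (⊃R (⊃L 2 0 (⊃L 3 1 (⊃L 4 2 (⊃R (∨R₁ (⊃⊃L 5 (∨⊃L 0 (⊃L 1 2 (∧L 0 (⊃L 2 1 (∧L 0 (⊃L 6 1 (∨L 0 (⊤⊃L 0 (⊃R (∨R₁ (ax 1)))) (⊃L 0 0 (⊃R (∨R₁ (ax 3))))))))))) (∧L 0 (ax 1))))))))) (∧L 0 (ax 0))) (⊃⊃L 3 (⊃R (⊃L 2 0 (⊃L 3 1 (⊃L 4 2 (⊃R (∨R₁ (⊃⊃L 5 (∨⊃L 0 (⊃L 1 2 (∧L 0 (⊃L 2 1 (∧L 0 (⊃L 6 1 (∨L 0 (⊤⊃L 0 (⊃R (∨R₁ (ax 1)))) (⊃L 0 0 (⊃R (∨R₁ (ax 3))))))))))) (∧L 0 (ax 1))))))))) (∧L 0 (ax 1)))))) (∨L 0 (⊤⊃L 0 (ax 0)) (⊃⊃L 2 (⊃R (⊃L 2 0 (⊃L 3 1 (⊃R (∨R₁ (⊃⊃L 4 (∨⊃L 0 (⊃L 1 2 (∧L 0 (⊃L 2 1 (∧L 0 (⊃R (∨R₁ (ax 2)))))))) (∧L 0 (ax 1)))))))) (∧L 0 (ax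 1))))))))) (⊃⊃L 0 (∧⊃L 0 (⊤⊃L 0 (⊃R (⊤⊃L 0 (⊃L 1 0 (∧R ⊤R (ax 1))))))) (⊃⊃L 0 (∧⊃L 0 (⊃R (∧R (⊃⊃L 2 (⊃R (⊃L 2 0 (⊃L 3 1 (⊃R (∨R₁ (⊃⊃L 4 (∨⊃L 0 (⊃L 1 3 (∧L 0 (⊃L 2 1 (∧L 0 (⊃L 5 1 (∨L 0 (⊤⊃L 0 (⊃R (∨R₁ (ax 1)))) (⊃L 0 0 (⊃R (∨R₁ (ax 3))))))))))) (∧L 0 (ax 1)))))))) (∧L 0 (ax 0))) (⊃⊃L 2 (⊃R (⊃L 2 0 (⊃L 3 1 (⊃R (∨R₁ (⊃⊃L 4 (∨⊃L 0 (⊃L 1 3 (∧L 0 (⊃L 2 1 (∧L 0 (⊃L 5 1 (∨L 0 (⊤⊃L 0 (⊃R (∨R₁ (ax 1)))) (⊃L 0 0 (⊃R (∨R₁ (ax 3))))))))))) (∧L 0 (ax 1)))))))) (∧L 0 (ax 1)))))) (∨L 0 (⊤⊃L 0 (ax 0)) (⊃⊃L 1 (⊃R (⊃L 2 0 (⊃R (∨R₁ (⊃⊃L 3 (∨⊃L 0 (⊃L 1 2 (∧L 0 (⊃L 2 1 (∧L 0 (⊃R (∨R₁ (ax 2)))))))) (∧L 0 (ax 1))))))) (∧L 0 (ax 1))))))))))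
      (z ∷ a ∷ b ∷ [])))

  NB-meet-one : ∀ {a b} → Normal a b →
                NB (NA one z ∧ NA a b) (NB one z ∨ NB a b) ≈ a ⇒ (a ⇒ (z ∨ b))
  NB-meet-one {a} {b} n = ≤-antisym
    (valid⇒≤ (tautology (bpᶠ 𝐛 ⊃ (NAᶠ ⊤ᶠ 𝐳 ⋀ NAᶠ 𝐚 𝐛 ⊃ (⊤ᶠ ⊃ 𝐳) ⋁ (𝐚 ⊃ 𝐛)) ⊃ 𝐚 ⊃ 𝐚 ⊃ 𝐳 ⋁ 𝐛)
      (⊃R (∨L 0 (⊃R (∧⊃L 0 (⊃R (⊃R (∨R₂ (ax 3)))))) (⊃R (∧⊃L 0 (⊃R (⊃R (∨R₁ (⊃⊃L 2 (∧⊃L 0 (⊤⊃L 0 (⊃R (⊤⊃L 0 (⊃L 1 0 (∧R ⊤R (ax 1))))))) (⊃⊃L 0 (∧⊃L 0 (⊃L 0 0 (⊃R (⊃L 0 1 (⊃L 4 0 (⊃L 2 0 (∨L 0 (⊤⊃L 0 (∧R (ax 3) (ax 0))) (⊃L 0 2 (∧R (ax 3) (ax 1)))))))))) (∨L 0 (⊤⊃L 0 (ax 0)) (⊃L 0 0 (⊃L 3 0 (ax 0)))))))))))))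
      (z ∷ a ∷ b ∷ []) $ᵛ bp b))
    (valid⇒≤ (tautology (((𝐛 ⊃ 𝐚) ⊃ 𝐚) ⊃ (𝐚 ⊃ 𝐚 ⊃ 𝐳 ⋁ 𝐛) ⊃ NAᶠ ⊤ᶠ 𝐳 ⋀ NAᶠ 𝐚 𝐛 ⊃ (⊤ᶠ ⊃ 𝐳) ⋁ (𝐚 ⊃ 𝐛))
      (⊃R (⊃R (⊃R (∧L 0 (∨R₁ (⊃R (⊤L 0 (⊃⊃L 0 (⊃R (⊤L 0 (⊃⊃L 3 (⊃R (⊃⊃L 3 (⊃L 0 0 (∧L 0 (⊃L 3 0 (⊃L 4 2 (∧L 0 (⊤L 0 (⊃L 5 1 (⊃L 0 1 (∨L 0 (⊃R (ax 6)) (⊃R (ax 1))))))))))) (∧L 0 (ax 0)))) (⊃L 3 0 (⊃L 0 0 (∨L 0 (ax 0) (⊃⊃L 3 (⊃L 0 0 (∧L 0 (⊃L 4 1 (∧L 0 (⊤L 0 (⊃R (ax 4))))))) (∧L 0 (ax 1))))))))) (∧L 0 (ax 1))))))))))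
      (z ∷ a ∷ b ∷ []) $ᵛ ≤⇒valid (closedˡ n)))

  NA-meet-one-normal : ∀ {a b} → Normal a b → NA a (a ⇒ (z ∨ b)) ≈ a
  NA-meet-one-normal {a} {b} n = ≤-antisym
    (valid⇒≤ (tautology (bpᶠ 𝐚 ⊃ NAᶠ 𝐚 (𝐚 ⊃ 𝐳 ⋁ 𝐛) ⊃ 𝐚)
      (⊃R (∨L 0 (⊃R (ax 1)) (⊃R (⊃⊃L 0 (⊃R (⊃L 2 0 (⊃R (∨R₁ (ax 1))))) (∧L 0 (ax 0))))))
      (z ∷ a ∷ b ∷ []) $ᵛ bp a))
    (valid⇒≤ (tautology ((𝐚 ⋀ 𝐛 ⊃ 𝐳) ⊃ 𝐚 ⊃ NAᶠ 𝐚 (𝐚 ⊃ 𝐳 ⋁ 𝐛))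
      (⊃R (∧⊃L 0 (⊃R (⊃L 1 0 (⊃R (⊃L 0 1 (⊃L 0 1 (∨L 0 (∧R (ax 2) (ax 0)) (⊃L 1 0 (∧R (ax 2) (ax 0)))))))))))
      (z ∷ a ∷ b ∷ []) $ᵛ ≤⇒valid (disjoint n)))

  NA-decomposition : ∀ {a b} → Normal a b →
    NA (a ∧ (b ⇒ (b ⇒ (z ∨ a)))) (W (a ⇒ (z ∨ b)) (NA b (b ⇒ (z ∨ a)))) ≈ a
  NA-decomposition {a} {b} n = ≤-antisym
    (valid⇒≤ (tautology (((𝐛 ⊃ 𝐚) ⊃ 𝐚) ⊃ NAᶠ (𝐚 ⋀ (𝐛 ⊃ 𝐛 ⊃ 𝐳 ⋁ 𝐚)) (Wᶠ (𝐚 ⊃ 𝐳 ⋁ 𝐛) (NAᶠ 𝐛 (𝐛 ⊃ 𝐳 ⋁ 𝐚))) ⊃ 𝐚)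
      (⊃R (⊃R (⊃⊃L 1 (⊃R (⊃⊃L 2 (∧⊃L 0 (⊃R (∧L 0 (⊃L 1 2 (⊃L 0 2 (∨L 0 (⊃L 4 1 (∧R (⊃R (⊃R (⊃L 0 5 (⊃L 0 5 (∨L 0 (∧R (ax 6) (ax 0)) (∧R (ax 6) (ax 3))))))) (⊃R (⊃R (∨R₁ (ax 3)))))) (⊃L 4 0 (∧R (⊃R (⊃R (⊃L 0 5 (⊃L 0 5 (∨L 0 (∧R (ax 6) (ax 0)) (∧R (ax 6) (⊃⊃L 1 (∨⊃L 0 (⊃L 1 6 (⊃L 1 0 (⊃R (∨R₁ (ax 1)))))) (ax 0)))))))) (⊃R (⊃R (∨R₁ (⊃⊃L 1 (∧⊃L 0 (⊃L 0 5 (⊃R (⊃L 0 6 (⊃L 0 6 (∨L 0 (⊃L 1 0 (∧R (ax 7) (ax 0))) (∧R (ax 7) (⊃⊃L 6 (⊃R (⊃R (⊃L 0 8 (⊃L 0 8 (∨L 0 (⊃L 4 0 (∧R (ax 9) (ax 0))) (∧R (ax 9) (⊃⊃L 1 (∨⊃L 0 (⊃L 1 9 (⊃L 1 0 (⊃L 5 0 (⊃R (∨R₁ (ax 1))))))) (ax 0)))))))) (⊃⊃L 0 (⊃R (⊃R (∨R₁ (⊃⊃L 1 (∧⊃L 0 (⊃L 0 8 (⊃R (⊃L 0 9 (⊃L 0 9 (∨L 0 (⊃L 1 0 (⊃L 5 0 (∧R (ax 10) (ax 0)))) (∧R (ax 10) (⊃⊃L 3 (∨⊃L 0 (⊃L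 1 10 (∧L 0 (∧L 0 (⊃L 1 12 (⊃L 0 12 (∨L 0 (⊃L 3 0 (∧L 0 (∧L 0 (⊃L 1 14 (⊃L 0 14 (∨L 0 (⊃L 7 0 (⊃L 10 0 (⊃R (∨R₁ (ax 1))))) (⊃L 7 2 (⊃L 10 0 (⊃R (∨R₁ (ax 1))))))))))) (⊃L 3 2 (∧L 0 (∧L 0 (⊃L 1 14 (⊃L 0 14 (∨L 0 (⊃L 7 0 (⊃L 10 0 (⊃R (∨R₁ (ax 1))))) (⊃L 7 2 (⊃L 10 0 (⊃R (∨R₁ (ax 1)))))))))))))))))) (∧L 0 (ax 1)))))))))) (ax 0))))) (∧L 0 (ax 1))))))))))) (ax 0))))))))))))) (∧L 0 (∧L 0 (ax 0))))) (ax 0))))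
      (z ∷ a ∷ b ∷ []) $ᵛ ≤⇒valid (closedˡ n)))
    (valid⇒≤ (tautology ((𝐚 ⋀ 𝐛 ⊃ 𝐳) ⊃ 𝐚 ⊃ NAᶠ (𝐚 ⋀ (𝐛 ⊃ 𝐛 ⊃ 𝐳 ⋁ 𝐚)) (Wᶠ (𝐚 ⊃ 𝐳 ⋁ 𝐛) (NAᶠ 𝐛 (𝐛 ⊃ 𝐳 ⋁ 𝐚))))
      (⊃R (∧⊃L 0 (⊃R (⊃L 1 0 (⊃R (∧⊃L 0 (⊃L 0 1 (∧R (∧R (ax 2) (⊃R (⊃L 2 0 (⊃R (∨R₁ (ax 1)))))) (⊃⊃L 0 (⊃R (⊃L 2 0 (⊃R (∨R₁ (ax 1))))) (∧L 0 (⊃⊃L 0 (⊃R (⊃L 0 3 (∨L 0 (ax 0) (⊃L 3 0 (ax 0))))) (⊃⊃L 0 (⊃R (⊃L 3 0 (⊃R (∨R₁ (ax 1))))) (∧L 0 (ax 1))))))))))))))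
      (z ∷ a ∷ b ∷ []) $ᵛ ≤⇒valid (disjoint n)))

  NB-decomposition : ∀ {a b} → Normal a b →
    NB (a ∧ (b ⇒ (b ⇒ (z ∨ a)))) (W (a ⇒ (z ∨ b)) (NA b (b ⇒ (z ∨ a)))) ≈ b
  NB-decomposition {a} {b} n = ≤-antisym
    (valid⇒≤ (tautology (((𝐚 ⊃ 𝐛) ⊃ 𝐛) ⊃ (𝐚 ⋀ (𝐛 ⊃ 𝐛 ⊃ 𝐳 ⋁ 𝐚) ⊃ Wᶠ (𝐚 ⊃ 𝐳 ⋁ 𝐛) (NAᶠ 𝐛 (𝐛 ⊃ 𝐳 ⋁ 𝐚))) ⊃ 𝐛)
      (⊃R (⊃R (∧⊃L 0 (⊃⊃L 1 (⊃R (⊃L 2 0 (⊃⊃L 0 (⊃R (⊃L 3 0 (⊃R (∨R₂ (ax 4))))) (∧L 0 (⊃⊃L 1 (⊃R (⊃⊃L 0 (⊃R (⊃L 5 0 (⊃R (∨R₁ (⊃⊃L 3 (∨⊃L 0 (⊃L 1 6 (∧L 0 (⊃L 2 1 (∧L 0 (⊃L 7 1 (⊃L 0 8 (∨L 0 (⊃R (∨R₁ (ax 1))) (⊃R (∨R₁ (ax 3))))))))))) (∧L 0 (ax 1))))))) (∧L 0 (ax 1)))) (⊃L 0 1 (∨L 0 (⊃⊃L 1 (⊃L 0 0 (⊃R (ax 2))) (⊃⊃L 0 (⊃R (⊃L 4 0 (⊃R (∨R₁ (ax 4))))) (∧L 0 (ax 0)))) (ax 0)))))))) (ax 0)))))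
      (z ∷ a ∷ b ∷ []) $ᵛ ≤⇒valid (closedʳ n)))
    (valid⇒≤ (tautology (𝐛 ⊃ 𝐚 ⋀ (𝐛 ⊃ 𝐛 ⊃ 𝐳 ⋁ 𝐚) ⊃ Wᶠ (𝐚 ⊃ 𝐳 ⋁ 𝐛) (NAᶠ 𝐛 (𝐛 ⊃ 𝐳 ⋁ 𝐚)))
      (⊃R (⊃R (∧L 0 (⊃L 1 1 (⊃L 0 1 (∨L 0 (∧R (⊃R (⊃R (⊃L 0 3 (⊃L 0 3 (∨L 0 (∧R (ax 4) (ax 0)) (∧R (ax 4) (ax 2))))))) (⊃R (⊃R (∨R₁ (ax 2))))) (∧R (⊃R (⊃R (⊃L 0 3 (⊃L 0 3 (∨L 0 (∧R (ax 4) (ax 0)) (∧R (ax 4) (⊃⊃L 1 (∨⊃L 0 (⊃L 1 4 (⊃L 1 0 (⊃R (∨R₁ (ax 1)))))) (ax 0)))))))) (⊃R (⊃R (∨R₂ (ax 4)))))))))))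
      (z ∷ a ∷ b ∷ [])))

  NA-cone-embedding : ∀ {a b} → Normal a b →
    NA (NA a z) (NA a z ⇒ (z ∨ (a ⇒ z))) ≈ NA a (a ⇒ (z ∨ b))
  NA-cone-embedding {a} {b} n = ≤-antisym
    (valid⇒≤ (tautology ((𝐚 ⋀ 𝐛 ⊃ 𝐳) ⊃ NAᶠ (NAᶠ 𝐚 𝐳) (NAᶠ 𝐚 𝐳 ⊃ 𝐳 ⋁ (𝐚 ⊃ 𝐳)) ⊃ NAᶠ 𝐚 (𝐚 ⊃ 𝐳 ⋁ 𝐛))
      (⊃R (∧⊃L 0 (⊃R (⊃R (∧R (⊃⊃L 1 (⊃R (⊃R (∨R₁ (⊃⊃L 0 (⊃R (⊃L 4 0 (⊃L 0 0 (∨L 0 (ax 0) (⊃L 5 1 (⊃L 0 0 (ax 0))))))) (∧L 0 (ax 1)))))) (∧L 0 (⊃⊃L 0 (⊃L 0 0 (∧L 0 (⊃L 3 0 (⊃L 0 0 (∨L 0 (⊃L 4 1 (⊃R (ax 2))) (⊃L 4 1 (⊃L 0 0 (⊃R (ax 1))))))))) (∧L 0 (ax 0))))) (⊃⊃L 1 (⊃R (⊃R (∨R₁ (⊃⊃L 0 (⊃R (⊃L 4 0 (⊃L 0 0 (∨L 0 (ax 0) (⊃L 5 1 (⊃L 0 0 (ax 0))))))) (∧L 0 (ax 1)))))) (∧L 0 (ax 1))))))))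
      (z ∷ a ∷ b ∷ []) $ᵛ ≤⇒valid (disjoint n)))
    (valid⇒≤ (tautology (NAᶠ 𝐚 (𝐚 ⊃ 𝐳 ⋁ 𝐛) ⊃ NAᶠ (NAᶠ 𝐚 𝐳) (NAᶠ 𝐚 𝐳 ⊃ 𝐳 ⋁ (𝐚 ⊃ 𝐳)))
      (⊃R (⊃R (∧R (⊃R (∧R (⊃⊃L 1 (∧⊃L 0 (⊃R (∧R (⊃⊃L 3 (⊃R (⊃L 2 0 (⊃L 3 1 (⊃L 0 0 (⊃L 4 2 (⊃R (∨R₁ (ax 1)))))))) (∧L 0 (ax 0))) (⊃⊃L 3 (⊃R (⊃L 2 0 (⊃L 3 1 (⊃L 0 0 (⊃L 4 2 (⊃R (∨R₁ (ax 1)))))))) (∧L 0 (ax 1)))))) (⊃⊃L 0 (∧⊃L 0 (⊃R (∧R (⊃⊃L 3 (⊃R (⊃L 2 0 (⊃L 3 1 (⊃L 0 0 (∨L 0 (⊃L 4 2 (⊃R (∨R₁ (ax 1)))) (⊃L 0 1 (⊃L 4 2 (⊃R (∨R₁ (ax 1)))))))))) (∧L 0 (ax 0))) (⊃⊃L 3 (⊃R (⊃L 2 0 (⊃L 3 1 (⊃L 0 0 (∨L 0 (⊃L 4 2 (⊃R (∨R₁ (ax 1)))) (⊃L 0 1 (⊃L 4 2 (⊃R (∨R₁ (ax 1)))))))))) (∧L 0 (ax 1)))))) (∨L 0 (⊃⊃L 2 (⊃R (⊃L 3 0 (⊃R (∨R₁ (ax 1))))) (∧L 0 (ax 0))) (⊃⊃L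 2 (⊃R (⊃L 2 0 (⊃L 3 1 (⊃R (∨R₁ (ax 1)))))) (∧L 0 (ax 0)))))) (⊃⊃L 1 (∧⊃L 0 (⊃R (∧R (⊃⊃L 3 (⊃R (⊃L 2 0 (⊃L 3 1 (⊃L 0 0 (⊃L 4 2 (⊃R (∨R₁ (ax 1)))))))) (∧L 0 (ax 0))) (⊃⊃L 3 (⊃R (⊃L 2 0 (⊃L 3 1 (⊃L 0 0 (⊃L 4 2 (⊃R (∨R₁ (ax 1)))))))) (∧L 0 (ax 1)))))) (⊃⊃L 0 (∧⊃L 0 (⊃R (∧R (⊃⊃L 3 (⊃R (⊃L 2 0 (⊃L 3 1 (⊃L 0 0 (∨L 0 (⊃L 4 2 (⊃R (∨R₁ (ax 1)))) (⊃L 0 1 (⊃L 4 2 (⊃R (∨R₁ (ax 1)))))))))) (∧L 0 (ax 0))) (⊃⊃L 3 (⊃R (⊃L 2 0 (⊃L 3 1 (⊃L 0 0 (∨L 0 (⊃L 4 2 (⊃R (∨R₁ (ax 1)))) (⊃L 0 1 (⊃L 4 2 (⊃R (∨R₁ (ax 1)))))))))) (∧L 0 (ax 1)))))) (∨L 0 (ax 0) (⊃⊃L 2 (⊃R (⊃L 2 0 (⊃L 3 1 (⊃R (∨R₁ (ax 1)))))) (∧L 0 (ax 1)))))))) (⊃⊃L 0 (∧⊃L 0 (⊃R (∧R (⊃⊃L 2 (⊃R (⊃L 2 0 (⊃L 3 1 (⊃L 0 0 (⊃R (∨R₁ (ax 2))))))) (∧L 0 (ax 0))) (⊃⊃L 2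 (⊃R (⊃L 2 0 (⊃L 3 1 (⊃L 0 0 (⊃R (∨R₁ (ax 2))))))) (∧L 0 (ax 1)))))) (⊃⊃L 0 (∧⊃L 0 (⊃R (∧R (⊃⊃L 2 (⊃R (⊃L 2 0 (⊃L 3 1 (⊃L 0 0 (∨L 0 (⊃R (∨R₁ (ax 1))) (⊃L 0 1 (⊃R (∨R₁ (ax 1))))))))) (∧L 0 (ax 0))) (⊃⊃L 2 (⊃R (⊃L 2 0 (⊃L 3 1 (⊃L 0 0 (∨L 0 (⊃R (∨R₁ (ax 1))) (⊃L 0 1 (⊃R (∨R₁ (ax 1))))))))) (∧L 0 (ax 1)))))) (∨L 0 (ax 0) (⊃⊃L 1 (⊃R (⊃L 2 0 (⊃R (∨R₁ (ax 1))))) (∧L 0 (ax 1)))))))))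
      (z ∷ a ∷ b ∷ [])))

  NB-cone-embedding : ∀ {a b} → Normal a b →
    NA a z ⇒ (NA a z ⇒ (z ∨ (a ⇒ z))) ≈ a ⇒ (a ⇒ (z ∨ b))
  NB-cone-embedding {a} {b} n = ≤-antisym
    (valid⇒≤ (tautology ((NAᶠ 𝐚 𝐳 ⊃ NAᶠ 𝐚 𝐳 ⊃ 𝐳 ⋁ (𝐚 ⊃ 𝐳)) ⊃ 𝐚 ⊃ 𝐚 ⊃ 𝐳 ⋁ 𝐛)
      (⊃R (⊃R (⊃R (∨R₁ (⊃⊃L 2 (∧⊃L 0 (⊃L 0 0 (⊃R (⊃L 0 1 (⊃L 1 0 (∧R (ax 2) (ax 1))))))) (⊃⊃L 0 (∧⊃L 0 (⊃L 0 0 (⊃R (⊃L 0 1 (⊃L 1 0 (∨L 0 (∧R (ax 2) (ax 0)) (⊃L 0 1 (∧R (ax 2) (ax 0))))))))) (∨L 0 (ax 0) (⊃L 0 0 (ax 0)))))))))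
      (z ∷ a ∷ b ∷ [])))
    (valid⇒≤ (tautology ((𝐚 ⋀ 𝐛 ⊃ 𝐳) ⊃ (𝐚 ⊃ 𝐚 ⊃ 𝐳 ⋁ 𝐛) ⊃ NAᶠ 𝐚 𝐳 ⊃ NAᶠ 𝐚 𝐳 ⊃ 𝐳 ⋁ (𝐚 ⊃ 𝐳))
      (⊃R (∧⊃L 0 (⊃R (⊃R (⊃R (∨R₁ (⊃⊃L 0 (⊃R (⊃L 3 0 (⊃L 0 0 (∨L 0 (ax 0) (⊃L 4 1 (⊃L 0 0 (ax 0))))))) (∧L 0 (ax 1)))))))))
      (z ∷ a ∷ b ∷ []) $ᵛ ≤⇒valid (disjoint n)))

  cone-join : ∀ a b c d → ((a ⇒ (a ⇒ (z ∨ b))) ∧ (c ⇒ (c ⇒ (z ∨ d)))) ⇒ (a ∨ c) ≈ a ∨ c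
  cone-join a b c d = ≤-antisym
    (valid⇒≤ (tautology (bpᶠ 𝐚 ⊃ bpᶠ 𝐜 ⊃ ((𝐚 ⊃ 𝐚 ⊃ 𝐳 ⋁ 𝐛) ⋀ (𝐜 ⊃ 𝐜 ⊃ 𝐳 ⋁ 𝐝) ⊃ 𝐚 ⋁ 𝐜) ⊃ 𝐚 ⋁ 𝐜)
      (⊃R (∨L 0 (⊃R (∨L 0 (⊃R (∧⊃L 0 (∨R₁ (ax 2)))) (⊃R (∧⊃L 0 (∨R₁ (ax 2)))))) (⊃R (∨L 0 (⊃R (∧⊃L 0 (∨R₂ (ax 1)))) (⊃R (∧⊃L 0 (⊃⊃L 0 (⊃R (⊃L 3 0 (⊃R (∨R₁ (ax 1))))) (⊃⊃L 0 (⊃R (⊃L 2 0 (⊃R (∨R₁ (ax 1))))) (ax 0)))))))))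
      (z ∷ a ∷ b ∷ c ∷ d ∷ []) $ᵛ bp a $ᵛ bp c))
    y≤x⇒y

  cone-implication : ∀ {a b} c d → Normal a b →
    (a ∧ (c ⇒ (c ⇒ (z ∨ d)))) ⇒ W (a ⇒ (z ∨ b)) c ≈ a ⇒ c
  cone-implication {a} {b} c d n = ≤-antisym
    (valid⇒≤ (tautology ((𝐚 ⋀ 𝐛 ⊃ 𝐳) ⊃ bpᶠ 𝐜 ⊃ (𝐚 ⋀ (𝐜 ⊃ 𝐜 ⊃ 𝐳 ⋁ 𝐝) ⊃ Wᶠ (𝐚 ⊃ 𝐳 ⋁ 𝐛) 𝐜) ⊃ 𝐚 ⊃ 𝐜)
      (⊃R (∧⊃L 0 (⊃R (∨L 0 (⊃R (∧⊃L 0 (⊃R (ax 2)))) (⊃R (∧⊃L 0 (⊃R (⊃L 1 0 (⊃L 3 1 (⊃⊃L 1 (⊃R (⊃L 4 0 (⊃R (∨R₁ (ax 1))))) (∧L 0 (⊃⊃L 0 (⊃R (⊃L 0 3 (∨L 0 (ax 0) (⊃L 3 0 (ax 0))))) (ax 0)))))))))))))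
      (z ∷ a ∷ b ∷ c ∷ d ∷ []) $ᵛ ≤⇒valid (disjoint n) $ᵛ bp c))
    (valid⇒≤ (tautology ((𝐚 ⊃ 𝐜) ⊃ 𝐚 ⋀ (𝐜 ⊃ 𝐜 ⊃ 𝐳 ⋁ 𝐝) ⊃ Wᶠ (𝐚 ⊃ 𝐳 ⋁ 𝐛) 𝐜)
      (⊃R (⊃R (∧L 0 (⊃L 2 0 (⊃L 2 0 (⊃L 0 0 (∨L 0 (∧R (⊃R (ax 2)) (⊃R (⊃L 0 1 (⊃R (∨R₁ (ax 1)))))) (∧R (⊃R (ax 2)) (⊃R (⊃L 0 1 (⊃R (∨R₁ (ax 1)))))))))))))
      (z ∷ a ∷ b ∷ c ∷ d ∷ [])))

-- Elements are arbitrary pairs, and two pairs are equal when their normal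
-- forms (NA a b , NB a b) agree; normal pairs are their own normal forms.
module TwistProduct {c ℓ} (B : BrouwerianAlgebra c ℓ) (z : BrouwerianAlgebra.Carrier B)
    (bp : BooleanPoint B z) where
  open BrouwerianAlgebra B
  open BrouwerianProperties B
  open TwistIdentities B z bp public

  Pair : Set c
  Pair = Carrier × Carrier

  na nb : Pair → Carrier
  na (a , b) = NA a b
  nb (a , b) = NB a b

  normalise : Pair → Pair
  normalise p = na p , nb p

  infix 4 _⊑_ _≋_ _≃_
  _⊑_ : Rel Pair ℓ
  p ⊑ q = na p ≤ na q × nb q ≤ nb p

  _≋_ : Rel Pair ℓ
  (a , b) ≋ (a′ , b′) = a ≈ a′ × b ≈ b′

  ⊑-refl : ∀ {p} → p ⊑ p
  ⊑-refl = ≤-refl , ≤-refl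

  ⊑-trans : ∀ {p q r} → p ⊑ q → q ⊑ r → p ⊑ r
  ⊑-trans (p , p′) (q , q′) = ≤-trans p q , ≤-trans q′ p′

  _≃_ : Rel Pair ℓ
  p ≃ q = p ⊑ q × q ⊑ p

  ≃-refl : ∀ {p} → p ≃ p
  ≃-refl = ⊑-refl , ⊑-refl

  ≃-sym : ∀ {p q} → p ≃ q → q ≃ p
  ≃-sym (p , q) = q , p

  ≃-trans : ∀ {p q r} → p ≃ q → q ≃ r → p ≃ r
  ≃-trans (p , p′) (q , q′) = ⊑-trans p q , ⊑-trans q′ p′

  NA-cong : ∀ {a a′ b b′} → a ≈ a′ → b ≈ b′ → NA a b ≈ NA a′ b′
  NA-cong p q = ⇒-cong (⇒-cong p q) (∧-cong p refl)

  W-cong : ∀ {b b′ d d′} → b ≈ b′ → d ≈ d′ → W b d ≈ W b′ d′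
  W-cong p q = ∧-cong (⇒-cong (⇒-cong p refl) q) (⇒-cong (⇒-cong q refl) p)

  ≃-by-normal-forms : ∀ {p q} → na p ≈ na q → nb p ≈ nb q → p ≃ q
  ≃-by-normal-forms e e′ = (≤-reflexive e , ≤-reflexive (sym e′)) , (≤-reflexive (sym e) , ≤-reflexive e′)

  normal-forms-by-≃ : ∀ {p q} → p ≃ q → na p ≈ na q × nb p ≈ nb q
  normal-forms-by-≃ ((p , p′) , (q , q′)) = ≤-antisym p q , ≤-antisym q′ p′

  ≋⇒≃ : ∀ {p q} → p ≋ q → p ≃ q
  ≋⇒≃ (e , e′) = ≃-by-normal-forms (NA-cong e e′) (⇒-cong e e′)

  ≋-trans : ∀ {p q r} → p ≋ q → q ≋ r → p ≋ r
  ≋-trans (e₁ , e₂) (e₁′ , e₂′) = trans e₁ e₁′ , trans e₂ e₂′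

  normal : ∀ p → Normal (na p) (nb p)
  normal (a , b) = normalise-normal a b

  normal-swap : ∀ {a b} → Normal a b → Normal b a
  normal-swap n = record
    { closedʳ = closedˡ n ; closedˡ = closedʳ n ; disjoint = ≤-respˡ (∧-comm _ _) (disjoint n) }

  NB-normal : ∀ {a b} → Normal a b → NB a b ≈ b
  NB-normal n = ≤-antisym (closedʳ n) y≤x⇒y

  normalise-≃ : ∀ p → normalise p ≃ p
  normalise-≃ p = ≃-by-normal-forms (NA-normal (normal p)) (NB-normal (normal p))

  ∼_ : Pair → Pair
  ∼ p = nb p , na p

  na-∼ : ∀ p → na (∼ p) ≈ nb p
  na-∼ p = NA-normal (normal-swap (normal p))

  nb-∼ : ∀ p → nb (∼ p) ≈ na p
  nb-∼ p = NB-normal (normal-swap (normal p))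

  ∼-≋ : ∀ {p q} → p ≋ q → ∼ p ≋ ∼ q
  ∼-≋ (e , e′) = ⇒-cong e e′ , NA-cong e e′

  ∼-antitone : ∀ {p q} → p ⊑ q → ∼ q ⊑ ∼ p
  ∼-antitone {p} {q} (l , l′) =
    ≤-respʳ (sym (na-∼ p)) (≤-respˡ (sym (na-∼ q)) l′) ,
    ≤-respʳ (sym (nb-∼ q)) (≤-respˡ (sym (nb-∼ p)) l)

  ∼-cong : ∀ {p q} → p ≃ q → ∼ p ≃ ∼ q
  ∼-cong (l , l′) = ∼-antitone l′ , ∼-antitone l

  ∼-involutive : ∀ p → ∼ ∼ p ≃ p
  ∼-involutive p = ≃-by-normal-forms (trans (na-∼ (∼ p)) (nb-∼ p)) (trans (nb-∼ (∼ p)) (na-∼ p))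

  infixr 7 _⊓_
  infixr 6 _⊔_
  _⊓_ _⊔_ : Pair → Pair → Pair
  p ⊓ q = na p ∧ na q , nb p ∨ nb q
  p ⊔ q = ∼ (∼ p ⊓ ∼ q)

  ⊓-≋ : ∀ {p p′ q q′} → p ≋ p′ → q ≋ q′ → p ⊓ q ≋ p′ ⊓ q′
  ⊓-≋ (e₁ , e₂) (e₁′ , e₂′) = ∧-cong (NA-cong e₁ e₂) (NA-cong e₁′ e₂′) , ∨-cong (⇒-cong e₁ e₂) (⇒-cong e₁′ e₂′)

  ⊓-infimum : ∀ p q → p ⊓ q ⊑ p × p ⊓ q ⊑ q × (∀ w → w ⊑ p → w ⊑ q → w ⊑ p ⊓ q)
  ⊓-infimum p q =
    (NA-meet≤ˡ _ _ (normal p) , ≤-trans (x≤x∨y _ _) y≤x⇒y) ,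
    (NA-meet≤ʳ _ _ (normal q) , ≤-trans (y≤x∨y _ _) y≤x⇒y) ,
    λ w (wp , pw) (wq , qw) → ≤-NA-meet (normal w) wp wq pw qw , NB-meet-≤ (normal w) wp wq pw qw

  ⊔-supremum : ∀ p q → p ⊑ p ⊔ q × q ⊑ p ⊔ q × (∀ w → p ⊑ w → q ⊑ w → p ⊔ q ⊑ w)
  ⊔-supremum p q =
    let lb₁ , lb₂ , greatest = ⊓-infimum (∼ p) (∼ q) in
    ⊑-trans (proj₂ (∼-involutive p)) (∼-antitone lb₁) ,
    ⊑-trans (proj₂ (∼-involutive q)) (∼-antitone lb₂) ,
    λ w pw qw → ⊑-trans (∼-antitone (greatest (∼ w) (∼-antitone pw) (∼-antitone qw))) (proj₁ (∼-involutive w))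

  open PreorderLattice _⊑_ ⊑-refl ⊑-trans _⊔_ _⊓_ ⊔-supremum ⊓-infimum public
    using (⊑⇒≤; ≤⇒⊑) renaming (isLattice to twist-isLattice)

  infixl 8 _⊗_
  _⊗_ : Pair → Pair → Pair
  (a , b) ⊗ (c , d) = a ∧ c , W b d

  𝟏 𝟎 : Pair
  𝟏 = one , z
  𝟎 = z , one

  ⊗-≋ : ∀ {p p′ q q′} → p ≋ p′ → q ≋ q′ → p ⊗ q ≋ p′ ⊗ q′
  ⊗-≋ (e₁ , e₂) (e₁′ , e₂′) = ∧-cong e₁ e₁′ , W-cong e₂ e₂′

  ⊗-normaliseˡ : ∀ p q → normalise p ⊗ q ≃ p ⊗ q
  ⊗-normaliseˡ (a , b) (c , d) = ≃-by-normal-forms (NA-W-normaliseˡ a b c d) (NB-W-normaliseˡ a b c d)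

  ⊗-comm : ∀ p q → p ⊗ q ≃ q ⊗ p
  ⊗-comm p q = ≋⇒≃ (∧-comm _ _ , W-comm _ _)

  ⊗-congˡ : ∀ {p p′} q → p ≃ p′ → p ⊗ q ≃ p′ ⊗ q
  ⊗-congˡ {p} {p′} q e =
    let na≈ , nb≈ = normal-forms-by-≃ e in
    ≃-trans (≃-sym (⊗-normaliseˡ p q))
      (≃-trans (≋⇒≃ (∧-cong na≈ refl , W-cong nb≈ refl)) (⊗-normaliseˡ p′ q))

  ⊗-cong : ∀ {p p′ q q′} → p ≃ p′ → q ≃ q′ → p ⊗ q ≃ p′ ⊗ q′
  ⊗-cong {p} {p′} {q} {q′} e e′ =
    ≃-trans (⊗-congˡ q e) (≃-trans (⊗-comm p′ q) (≃-trans (⊗-congˡ p′ e′) (⊗-comm q′ p′)))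

  ⊗-assoc : ∀ p q r → (p ⊗ q) ⊗ r ≃ p ⊗ (q ⊗ r)
  ⊗-assoc p q r = ≋⇒≃ (∧-assoc _ _ _ , W-assoc _ _ _)

  ⊗-identityʳ : ∀ p → p ⊗ 𝟏 ≃ p
  ⊗-identityʳ (a , b) = ≋⇒≃ (one-top a , W-identityʳ b)

  -- Proofs entering the algebra structure are opaque, so that instances for
  -- different but equal arguments are compared without unfolding them.
  opaque
    ⊗-idem : ∀ p → p ⊗ p ≃ p
    ⊗-idem (a , b) = ≋⇒≃ (∧-idem a , W-idem b)

  infixr 5 _⊸_
  _⊸_ : Pair → Pair → Pair
  p ⊸ q = ∼ (p ⊗ ∼ q)

  ProductBelow-cong : ∀ {a b c d e f a′ b′ c′ d′ e′ f′} →
    a ≈ a′ → b ≈ b′ → c ≈ c′ → d ≈ d′ → e ≈ e′ → f ≈ f′ →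
    ProductBelow a b c d e f → ProductBelow a′ b′ c′ d′ e′ f′
  ProductBelow-cong ea eb ec ed ee ef (k , k′) =
    ≤-respˡ (∧-cong (∧-cong ea ec) ef) (≤-respʳ (∨-cong (∨-cong eb ed) ee) k) ,
    ≤-respˡ (∧-cong (∧-cong (∧-cong ea ec) ef) refl) (≤-respʳ (∧-cong (∧-cong eb ed) ee) k′)

  ProductBelowᵖ : Pair → Pair → Pair → Set ℓ
  ProductBelowᵖ p q r = ProductBelow (na p) (nb p) (na q) (nb q) (na r) (nb r)

  ⊗-normalise : ∀ p q → normalise p ⊗ normalise q ≃ p ⊗ q
  ⊗-normalise p q = ≃-trans (⊗-normaliseˡ p (normalise q)) (⊗-cong ≃-refl (normalise-≃ q))

  ⊗⊑⇒ProductBelow : ∀ p q r → p ⊗ q ⊑ r → ProductBelowᵖ p q r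
  ⊗⊑⇒ProductBelow p q r le =
    let ≤r , r≤ = ⊑-trans (proj₁ (⊗-normalise p q)) le in productBelow⁺ ≤r r≤

  ProductBelow⇒⊗⊑ : ∀ p q r → ProductBelowᵖ p q r → p ⊗ q ⊑ r
  ProductBelow⇒⊗⊑ p q r k = ⊑-trans (proj₂ (⊗-normalise p q)) (productBelow⁻ (normal r) k)

  -- A ProductBelow condition is symmetric in its second and (negated) third
  -- argument: this is residuation.
  ProductBelow-∼-swap : ∀ p q r → ProductBelowᵖ p q r → ProductBelowᵖ p (∼ r) (∼ q)
  ProductBelow-∼-swap p q r k = ProductBelow-cong refl refl
    (sym (na-∼ r)) (sym (nb-∼ r)) (sym (na-∼ q)) (sym (nb-∼ q)) (productBelow-swap k)

  ⊑∼-swap : ∀ {p q} → p ⊑ ∼ q → q ⊑ ∼ p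
  ⊑∼-swap {p} {q} le = ⊑-trans (proj₂ (∼-involutive q)) (∼-antitone le)

  ⊗-residual⁺ : ∀ p q r → p ⊗ q ⊑ r → q ⊑ p ⊸ r
  ⊗-residual⁺ p q r le =
    ⊑∼-swap (ProductBelow⇒⊗⊑ p (∼ r) (∼ q) (ProductBelow-∼-swap p q r (⊗⊑⇒ProductBelow p q r le)))

  ⊗-residual⁻ : ∀ p q r → q ⊑ p ⊸ r → p ⊗ q ⊑ r
  ⊗-residual⁻ p q r le =
    let k = ProductBelow-∼-swap p (∼ r) (∼ q) (⊗⊑⇒ProductBelow p (∼ r) (∼ q) (⊑∼-swap le))
        na-q , nb-q = normal-forms-by-≃ (∼-involutive q)
        na-r , nb-r = normal-forms-by-≃ (∼-involutive r)
    in ProductBelow⇒⊗⊑ p q r (ProductBelow-cong refl refl na-q nb-q na-r nb-r k)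

  opaque
    ⊸-cong : ∀ {p p′ q q′} → p ≃ p′ → q ≃ q′ → p ⊸ q ≃ p′ ⊸ q′
    ⊸-cong e e′ = ∼-cong (⊗-cong e (∼-cong e′))

  ∼𝟎≃𝟏 : ∼ 𝟎 ≃ 𝟏
  ∼𝟎≃𝟏 = ≋⇒≃ (≤-antisym (one-top _) y≤x⇒y , NA-z-one)

  ⊸𝟎≃∼ : ∀ p → p ⊸ 𝟎 ≃ ∼ p
  ⊸𝟎≃∼ p = ∼-cong (≃-trans (⊗-cong ≃-refl ∼𝟎≃𝟏) (⊗-identityʳ p))

  opaque
    ⊸𝟎-involutive : ∀ p → (p ⊸ 𝟎) ⊸ 𝟎 ≃ p
    ⊸𝟎-involutive p = ≃-trans (⊸𝟎≃∼ (p ⊸ 𝟎)) (≃-trans (∼-cong (⊸𝟎≃∼ p)) (∼-involutive p))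

  ⊓-cong : ∀ {p p′ q q′} → p ≃ p′ → q ≃ q′ → p ⊓ q ≃ p′ ⊓ q′
  ⊓-cong = IsLattice.∧-cong twist-isLattice

  negPart : Pair → Pair
  negPart p = na p , na p ⇒ (z ∨ nb p)

  𝟏⊓≃negPart : ∀ p → 𝟏 ⊓ p ≃ negPart p
  𝟏⊓≃negPart p = ≃-trans (⊓-cong ≃-refl (≃-sym (normalise-≃ p)))
    (≃-by-normal-forms (NA-meet-one (normal p)) (NB-meet-one (normal p)))

  posPart : Pair → Pair
  posPart p = ∼ (nb p , nb p ⇒ (z ∨ na p))

  𝟎⊔≃posPart : ∀ p → 𝟎 ⊔ p ≃ posPart p
  𝟎⊔≃posPart p = ∼-cong (≃-trans (⊓-cong ∼𝟎≃𝟏 ≃-refl) (≃-trans (𝟏⊓≃negPart (∼ p))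
    (≋⇒≃ (na-∼ p , ⇒-cong (na-∼ p) (∨-cong refl (nb-∼ p))))))

  opaque
    decomposition : ∀ p → p ≃ (𝟏 ⊓ p) ⊗ (𝟎 ⊔ p)
    decomposition p = ≃-sym (≃-trans (⊗-cong (𝟏⊓≃negPart p) (𝟎⊔≃posPart p))
      (≃-by-normal-forms (NA-decomposition (normal p)) (NB-decomposition (normal p))))

  opaque
    twistCIRL-isLattice : IsLattice _≃_ _⊔_ _⊓_
    twistCIRL-isLattice = twist-isLattice

    twist-isCommutativeMonoid : IsCommutativeMonoid _≃_ _⊗_ 𝟏
    twist-isCommutativeMonoid = record
      { isMonoid = record
        { isSemigroup = record
          { isMagma = record { isEquivalence = IsLattice.isEquivalence twist-isLattice ; ∙-cong = ⊗-cong }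
          ; assoc = ⊗-assoc }
        ; identity = (λ p → ≃-trans (⊗-comm 𝟏 p) (⊗-identityʳ p)) , ⊗-identityʳ }
      ; comm = ⊗-comm }

    twist-residuation : ∀ p q r → (p ⊗ q ⊓ r ≃ p ⊗ q → q ⊓ (p ⊸ r) ≃ q)
                                × (q ⊓ (p ⊸ r) ≃ q → p ⊗ q ⊓ r ≃ p ⊗ q)
    twist-residuation p q r = (λ le → ⊑⇒≤ (⊗-residual⁺ p q r (≤⇒⊑ le)))
                            , (λ le → ⊑⇒≤ (⊗-residual⁻ p q r (≤⇒⊑ le)))

  twistCIRL : CommInvResLattice c ℓ
  twistCIRL = record
    { Carrier = Pair
    ; _≈_ = _≃_
    ; _∨_ = _⊔_
    ; _∧_ = _⊓_
    ; _·_ = _⊗_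
    ; one = 𝟏
    ; _⇒_ = _⊸_
    ; zero = 𝟎
    ; isLattice = twistCIRL-isLattice
    ; isCommutativeMonoid = twist-isCommutativeMonoid
    ; ⇒-cong = ⊸-cong
    ; residuation = twist-residuation
    ; involutive = ⊸𝟎-involutive
    }

  twistCIRL-idempotent : IsIdempotentCIRL twistCIRL
  twistCIRL-idempotent = ⊗-idem

  twistCIRL-decomposition : SatisfiesDecomp twistCIRL
  twistCIRL-decomposition = decomposition

module CIRLProperties {c ℓ} (L : CommInvResLattice c ℓ) where
  open CommInvResLattice L
  open LatticeOrder isLattice public hiding (_≤_)
  open IsCommutativeMonoid isCommutativeMonoid public using ()
    renaming (assoc to ·-assoc; comm to ·-comm; identityˡ to ·-identityˡ;
              identityʳ to ·-identityʳ; ∙-cong to ·-cong)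

  transpose-⇒ : ∀ {x y w} → (x · y) ≤ w → y ≤ (x ⇒ w)
  transpose-⇒ = proj₁ (residuation _ _ _)

  transpose-· : ∀ {x y w} → y ≤ (x ⇒ w) → (x · y) ≤ w
  transpose-· = proj₂ (residuation _ _ _)

  ⇒-eval : ∀ x w → (x · (x ⇒ w)) ≤ w
  ⇒-eval x w = transpose-· ≤-refl

  ·-monoʳ-≤ : ∀ x {y y′} → y ≤ y′ → (x · y) ≤ (x · y′)
  ·-monoʳ-≤ x p = transpose-· (≤-trans p (transpose-⇒ ≤-refl))

  ·-monoˡ-≤ : ∀ {x x′} y → x ≤ x′ → (x · y) ≤ (x′ · y)
  ·-monoˡ-≤ y p = ≤-respˡ (·-comm _ _) (≤-respʳ (·-comm _ _) (·-monoʳ-≤ y p))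

  ·-mono-≤ : ∀ {x x′ y y′} → x ≤ x′ → y ≤ y′ → (x · y) ≤ (x′ · y′)
  ·-mono-≤ p q = ≤-trans (·-monoˡ-≤ _ p) (·-monoʳ-≤ _ q)

  ·-distribˡ-∨-≤ : ∀ x y w → (x · (y ∨ w)) ≤ ((x · y) ∨ (x · w))
  ·-distribˡ-∨-≤ x y w = transpose-· (∨-least (transpose-⇒ (x≤x∨y _ _)) (transpose-⇒ (y≤x∨y _ _)))

  ·-distribʳ-∨-≤ : ∀ x y w → ((x ∨ y) · w) ≤ ((x · w) ∨ (y · w))
  ·-distribʳ-∨-≤ x y w = ≤-respˡ (·-comm w _)
    (≤-trans (·-distribˡ-∨-≤ w x y) (∨-monotonic (≤-reflexive (·-comm w x)) (≤-reflexive (·-comm w y))))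

  ¬_ : Carrier → Carrier
  ¬ x = x ⇒ zero

  ¬-involutive : ∀ x → (¬ (¬ x)) ≈ x
  ¬-involutive = involutive

  ¬-antitone : ∀ {x y} → x ≤ y → (¬ y) ≤ (¬ x)
  ¬-antitone p = transpose-⇒ (≤-trans (·-monoˡ-≤ _ p) (⇒-eval _ zero))

  ¬-cong : ∀ {x y} → x ≈ y → (¬ x) ≈ (¬ y)
  ¬-cong p = ⇒-cong p refl

  x·¬x≤0 : ∀ x → (x · (¬ x)) ≤ zero
  x·¬x≤0 x = ⇒-eval x zero

  ≤-via-¬ : ∀ {t u} → ((¬ u) · t) ≤ zero → t ≤ u
  ≤-via-¬ {u = u} p = ≤-respʳ (¬-involutive u) (transpose-⇒ p)

  ¬1≈0 : (¬ one) ≈ zero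
  ¬1≈0 = ≤-antisym (≤-respˡ (·-identityˡ _) (⇒-eval one zero)) (transpose-⇒ (≤-reflexive (·-identityˡ zero)))

  ¬0≈1 : (¬ zero) ≈ one
  ¬0≈1 = trans (¬-cong (sym ¬1≈0)) (¬-involutive one)

  ⇒≈¬[·¬] : ∀ x w → (x ⇒ w) ≈ (¬ (x · (¬ w)))
  ⇒≈¬[·¬] x w = ≤-antisym
    (transpose-⇒ (≤-respˡ (sym (swap x (¬ w) (x ⇒ w)))
      (transpose-· (≤-respʳ (sym (¬-involutive w)) (⇒-eval x w)))))
    (transpose-⇒ (≤-respʳ (¬-involutive w)
      (transpose-⇒ (≤-respˡ (swap x (¬ w) _) (⇒-eval (x · (¬ w)) zero)))))
    where
      swap : ∀ x v u → ((x · v) · u) ≈ (v · (x · u))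
      swap x v u = trans (·-cong (·-comm x v) refl) (·-assoc v x u)

  ¬-∨ : ∀ x y → (¬ (x ∨ y)) ≈ ((¬ x) ∧ (¬ y))
  ¬-∨ x y = ≤-antisym (∧-greatest (¬-antitone (x≤x∨y x y)) (¬-antitone (y≤x∨y x y)))
    (transpose-⇒ (≤-respˡ (·-comm _ (x ∨ y)) (≤-trans (·-distribˡ-∨-≤ _ x y)
      (∨-least (≤-respˡ (·-comm x _) (≤-trans (·-monoʳ-≤ x (x∧y≤x _ _)) (x·¬x≤0 x)))
               (≤-respˡ (·-comm y _) (≤-trans (·-monoʳ-≤ y (x∧y≤y _ _)) (x·¬x≤0 y)))))))

  ¬-∧ : ∀ x y → (¬ (x ∧ y)) ≈ ((¬ x) ∨ (¬ y))
  ¬-∧ x y = trans (¬-cong (sym (trans (¬-∨ (¬ x) (¬ y)) (∧-cong (¬-involutive x) (¬-involutive y)))))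
                  (¬-involutive _)

  ↓ : Carrier → Carrier
  ↓ x = one ∧ x

  ↓≤1 : ∀ x → ↓ x ≤ one
  ↓≤1 x = x∧y≤x one x

  ↓x≤x : ∀ x → ↓ x ≤ x
  ↓x≤x x = x∧y≤y one x

  ↓-fixed : ∀ {a} → a ≤ one → ↓ a ≈ a
  ↓-fixed p = ≤-antisym (↓x≤x _) (∧-greatest p ≤-refl)

  ↓-idem : ∀ x → ↓ (↓ x) ≈ ↓ x
  ↓-idem x = ↓-fixed (↓≤1 x)

  ↓-mono : ∀ {x y} → x ≤ y → ↓ x ≤ ↓ y
  ↓-mono p = ∧-monotonic ≤-refl p

  ↓-cong : ∀ {x y} → x ≈ y → ↓ x ≈ ↓ y
  ↓-cong p = ∧-cong refl p

  ↓-∧ : ∀ x y → ↓ (x ∧ y) ≈ (↓ x ∧ ↓ y)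
  ↓-∧ x y = ≤-antisym (∧-greatest (↓-mono (x∧y≤x x y)) (↓-mono (x∧y≤y x y)))
                      (∧-greatest (≤-trans (x∧y≤x _ _) (↓≤1 x)) (∧-monotonic (↓x≤x x) (↓x≤x y)))

  ·-decreasingˡ : ∀ {a} b → a ≤ one → (a · b) ≤ b
  ·-decreasingˡ b p = ≤-respʳ (·-identityˡ b) (·-monoˡ-≤ b p)

  ·-decreasingʳ : ∀ a {b} → b ≤ one → (a · b) ≤ a
  ·-decreasingʳ a p = ≤-respʳ (·-identityʳ a) (·-monoʳ-≤ a p)

module IdempotentDecomposable {c ℓ} (L : CommInvResLattice c ℓ)
    (idem : IsIdempotentCIRL L) (dec : SatisfiesDecomp L) where
  open CommInvResLattice L
  open CIRLProperties L public

  icm : IdempotentCommutativeMonoid c ℓ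
  icm = record { isIdempotentCommutativeMonoid = record
    { isCommutativeMonoid = isCommutativeMonoid ; idem = idem } }
  module S = ICMSolver icm

  negative-·≈∧ : ∀ {a b} → a ≤ one → b ≤ one → (a · b) ≈ (a ∧ b)
  negative-·≈∧ {a} {b} p q = ≤-antisym (∧-greatest (·-decreasingʳ a q) (·-decreasingˡ b p))
    (≤-respˡ (idem (a ∧ b)) (·-mono-≤ (x∧y≤x a b) (x∧y≤y a b)))

  0≤1 : zero ≤ one
  0≤1 = ≤-respʳ (sym (trans (dec one) (trans (·-cong (∧-idem one) refl) (·-identityˡ _))))
                (x≤x∨y zero one)

  0≤¬-negative : ∀ {n} → n ≤ one → zero ≤ (¬ n)
  0≤¬-negative p = ≤-respˡ ¬1≈0 (¬-antitone p)

  negative-distrib : ∀ {a b d} → a ≤ one → b ≤ one → d ≤ one → (a ∧ (b ∨ d)) ≤ ((a ∧ b) ∨ (a ∧ d))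
  negative-distrib {a} {b} {d} pa pb pd =
    ≤-respˡ (negative-·≈∧ pa (∨-least pb pd))
      (≤-respʳ (∨-cong (negative-·≈∧ pa pb) (negative-·≈∧ pa pd)) (·-distribˡ-∨-≤ a b d))

  decomposition-¬ : ∀ x → x ≈ (↓ x · (¬ (↓ (¬ x))))
  decomposition-¬ x = trans (dec x)
    (·-cong refl (sym (trans (¬-∧ one (¬ x)) (∨-cong ¬1≈0 (¬-involutive x)))))

  ·¬-≤ : ∀ {k v} → (k ∧ zero) ≤ v → (k · (¬ v)) ≤ k
  ·¬-≤ {k} {v} p =
    let ¬v≤ : (¬ v) ≤ ((¬ k) ∨ one)
        ¬v≤ = ≤-respʳ (trans (¬-∧ k zero) (∨-cong refl ¬0≈1)) (¬-antitone p)
        k¬k≤k : (k · (¬ k)) ≤ k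
        k¬k≤k = ≤-via-¬ (≤-respˡ (S.solve 2 (λ K N → K S.⊕ N S.⊜ N S.⊕ (K S.⊕ N)) refl k (¬ k)) (x·¬x≤0 k))
    in ≤-trans (·-monoʳ-≤ k ¬v≤)
               (≤-trans (·-distribˡ-∨-≤ k (¬ k) one) (∨-least k¬k≤k (≤-reflexive (·-identityʳ k))))

  ·¬¬¬≤0 : ∀ {k u v w} → k ≤ u → (k ∧ zero) ≤ v → (k ∧ zero) ≤ w →
           (k · (((¬ u) · (¬ v)) · (¬ w))) ≤ zero
  ·¬¬¬≤0 {k} {u} {v} {w} ku kv kw =
    ≤-respˡ (S.solve 4 (λ K U V W → ((K S.⊕ W) S.⊕ V) S.⊕ U S.⊜ K S.⊕ ((U S.⊕ V) S.⊕ W)) refl k (¬ u) (¬ v) (¬ w))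
      (≤-trans (·-monoˡ-≤ (¬ u) (≤-trans (·-monoˡ-≤ (¬ v) (·¬-≤ kw)) (·¬-≤ kv)))
               (≤-trans (·-monoˡ-≤ (¬ u) ku) (x·¬x≤0 u)))

  -- The image in L of the twist-product condition ProductBelow.
  ConeProductBelow : Carrier → Carrier → Carrier → Carrier → Set ℓ
  ConeProductBelow n b d e = n ≤ ((b ∨ d) ∨ e) × (n ∧ zero) ≤ ((b ∧ d) ∧ e)

  ConeProductBelow⇒·¬¬¬≤0 : ∀ {n b d e} → n ≤ one → b ≤ one → d ≤ one → e ≤ one →
    ConeProductBelow n b d e → (n · (((¬ b) · (¬ d)) · (¬ e))) ≤ zero
  ConeProductBelow⇒·¬¬¬≤0 {n} {b} {d} {e} pn pb pd pe (k , k′) =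
    ≤-trans (·-monoˡ-≤ P split) (≤-trans distrib (∨-least (∨-least case-b case-d) case-e))
    where
      P = ((¬ b) · (¬ d)) · (¬ e)
      split : n ≤ (((n ∧ b) ∨ (n ∧ d)) ∨ (n ∧ e))
      split = ≤-trans (∧-greatest ≤-refl k)
        (≤-trans (negative-distrib pn (∨-least pb pd) pe) (∨-monotonic (negative-distrib pn pb pd) ≤-refl))
      distrib : ((((n ∧ b) ∨ (n ∧ d)) ∨ (n ∧ e)) · P) ≤ ((((n ∧ b) · P) ∨ ((n ∧ d) · P)) ∨ ((n ∧ e) · P))
      distrib = ≤-trans (·-distribʳ-∨-≤ _ _ P) (∨-monotonic (·-distribʳ-∨-≤ _ _ P) ≤-refl)
      low : ∀ {u} → ((n ∧ u) ∧ zero) ≤ (n ∧ zero)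
      low = ∧-monotonic (x∧y≤x _ _) ≤-refl
      0b : (n ∧ zero) ≤ b
      0b = ≤-trans k′ (≤-trans (x∧y≤x _ _) (x∧y≤x _ _))
      0d : (n ∧ zero) ≤ d
      0d = ≤-trans k′ (≤-trans (x∧y≤x _ _) (x∧y≤y _ _))
      0e : (n ∧ zero) ≤ e
      0e = ≤-trans k′ (x∧y≤y _ _)
      case-b : ((n ∧ b) · P) ≤ zero
      case-b = ·¬¬¬≤0 (x∧y≤y n b) (≤-trans low 0d) (≤-trans low 0e)
      case-d : ((n ∧ d) · P) ≤ zero
      case-d = ≤-respˡ (·-cong refl (S.solve 3 (λ B D E → (D S.⊕ B) S.⊕ E S.⊜ (B S.⊕ D) S.⊕ E) refl (¬ b) (¬ d) (¬ e)))
        (·¬¬¬≤0 (x∧y≤y n d) (≤-trans low 0b) (≤-trans low 0e))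
      case-e : ((n ∧ e) · P) ≤ zero
      case-e = ≤-respˡ (·-cong refl (S.solve 3 (λ B D E → (E S.⊕ B) S.⊕ D S.⊜ (B S.⊕ D) S.⊕ E) refl (¬ b) (¬ d) (¬ e)))
        (·¬¬¬≤0 (x∧y≤y n e) (≤-trans low 0b) (≤-trans low 0d))

  -- t = n ∧ 0 is idempotent, so t ≤ t · t · t lies below the three factors.
  ·¬¬¬≤0⇒zero-part : ∀ {n b d e} → zero ≤ (¬ d) → zero ≤ (¬ e) →
    ((¬ b) · ((n · (¬ d)) · (¬ e))) ≤ zero → (n ∧ zero) ≤ b
  ·¬¬¬≤0⇒zero-part {n} {b} {d} {e} 0≤¬d 0≤¬e h = ≤-via-¬
    (≤-respˡ (·-cong refl (S.solve 1 (λ T → (T S.⊕ T) S.⊕ T S.⊜ T) refl t))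
      (≤-trans (·-monoʳ-≤ (¬ b) (·-mono-≤ (·-mono-≤ (x∧y≤x n zero) (≤-trans t≤0 0≤¬d)) (≤-trans t≤0 0≤¬e))) h))
    where
      t = n ∧ zero
      t≤0 = x∧y≤y n zero

  ·¬¬¬≤0⇒ConeProductBelow : ∀ {n b d e} → b ≤ one → d ≤ one → e ≤ one →
    (n · (((¬ b) · (¬ d)) · (¬ e))) ≤ zero → ConeProductBelow n b d e
  ·¬¬¬≤0⇒ConeProductBelow {n} {b} {d} {e} pb pd pe h =
    ≤-via-¬ (≤-respˡ (·-comm n (¬ m)) (≤-trans (·-monoʳ-≤ n ¬m≤P) h)) ,
    ∧-greatest (∧-greatest
      (·¬¬¬≤0⇒zero-part (0≤¬-negative pd) (0≤¬-negative pe)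
        (≤-respˡ (S.solve 4 (λ N B D E → N S.⊕ ((B S.⊕ D) S.⊕ E) S.⊜ B S.⊕ ((N S.⊕ D) S.⊕ E)) refl n (¬ b) (¬ d) (¬ e)) h))
      (·¬¬¬≤0⇒zero-part (0≤¬-negative pb) (0≤¬-negative pe)
        (≤-respˡ (S.solve 4 (λ N B D E → N S.⊕ ((B S.⊕ D) S.⊕ E) S.⊜ D S.⊕ ((N S.⊕ B) S.⊕ E)) refl n (¬ b) (¬ d) (¬ e)) h)))
      (·¬¬¬≤0⇒zero-part (0≤¬-negative pb) (0≤¬-negative pd)
        (≤-respˡ (S.solve 4 (λ N B D E → N S.⊕ ((B S.⊕ D) S.⊕ E) S.⊜ E S.⊕ ((N S.⊕ B) S.⊕ D)) refl n (¬ b) (¬ d) (¬ e)) h))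
    where
      m = (b ∨ d) ∨ e
      ¬m≈ : (¬ m) ≈ (((¬ b) ∧ (¬ d)) ∧ (¬ e))
      ¬m≈ = trans (¬-∨ _ e) (∧-cong (¬-∨ b d) refl)
      ¬m≤P : (¬ m) ≤ (((¬ b) · (¬ d)) · (¬ e))
      ¬m≤P = ≤-respˡ (S.solve 1 (λ M → (M S.⊕ M) S.⊕ M S.⊜ M) refl (¬ m))
        (≤-respˡ (·-cong (·-cong (sym ¬m≈) (sym ¬m≈)) (sym ¬m≈))
          (·-mono-≤ (·-mono-≤ (≤-trans (x∧y≤x _ _) (x∧y≤x _ _)) (≤-trans (x∧y≤x _ _) (x∧y≤y _ _))) (x∧y≤y _ _)))

-- The negative cone {x | x ≤ 1}, presented on the whole carrier: x and y
-- are identified when 1 ∧ x ≈ 1 ∧ y.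
module NegativeCone {c ℓ} (L : CommInvResLattice c ℓ)
    (idem : IsIdempotentCIRL L) (dec : SatisfiesDecomp L) where
  open CommInvResLattice L
  open IdempotentDecomposable L idem dec

  infix 4 _⊑_
  _⊑_ : Rel Carrier ℓ
  x ⊑ y = ↓ x ≤ ↓ y

  infixr 6 _⊔_
  infixr 5 _⇛_
  _⊔_ _⇛_ : Carrier → Carrier → Carrier
  x ⊔ y = ↓ x ∨ ↓ y
  x ⇛ y = ↓ (↓ x ⇒ ↓ y)

  ↓-⊔ : ∀ x y → ↓ (x ⊔ y) ≈ x ⊔ y
  ↓-⊔ x y = ↓-fixed (∨-least (↓≤1 x) (↓≤1 y))

  ⊔-supremum : ∀ x y → x ⊑ x ⊔ y × y ⊑ x ⊔ y × (∀ w → x ⊑ w → y ⊑ w → x ⊔ y ⊑ w)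
  ⊔-supremum x y =
    ≤-respʳ (sym (↓-⊔ x y)) (x≤x∨y _ _) ,
    ≤-respʳ (sym (↓-⊔ x y)) (y≤x∨y _ _) ,
    λ w p q → ≤-respˡ (sym (↓-⊔ x y)) (∨-least p q)

  ∧-infimum : ∀ x y → (x ∧ y) ⊑ x × (x ∧ y) ⊑ y × (∀ w → w ⊑ x → w ⊑ y → w ⊑ (x ∧ y))
  ∧-infimum x y = ↓-mono (x∧y≤x x y) , ↓-mono (x∧y≤y x y) , λ w p q → ≤-respʳ (sym (↓-∧ x y)) (∧-greatest p q)

  open PreorderLattice _⊑_ ≤-refl ≤-trans _⊔_ _∧_ ⊔-supremum ∧-infimum public
    using (_≃_; ⊑⇒≤; ≤⇒⊑)

  cone-distrib : ∀ x y w → (x ∧ (y ⊔ w)) ⊑ ((x ∧ y) ⊔ (x ∧ w))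
  cone-distrib x y w =
    ≤-respˡ (sym (trans (↓-∧ x _) (∧-cong refl (↓-⊔ y w))))
      (≤-respʳ (sym (trans (↓-⊔ _ _) (∨-cong (↓-∧ x y) (↓-∧ x w))))
        (negative-distrib (↓≤1 x) (↓≤1 y) (↓≤1 w)))

  ≃⇒↓≈ : ∀ {x y} → x ≃ y → ↓ x ≈ ↓ y
  ≃⇒↓≈ (p , q) = ≤-antisym p q

  ↓≈⇒≃ : ∀ {x y} → ↓ x ≈ ↓ y → x ≃ y
  ↓≈⇒≃ e = ≤-reflexive e , ≤-reflexive (sym e)

  ≈⇒≃ : ∀ {x y} → x ≈ y → x ≃ y
  ≈⇒≃ e = ↓≈⇒≃ (↓-cong e)

  ⇛-≈ : ∀ {x x′ y y′} → x ≈ x′ → y ≈ y′ → (x ⇛ y) ≈ (x′ ⇛ y′)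
  ⇛-≈ e e′ = ↓-cong (⇒-cong (↓-cong e) (↓-cong e′))

  ⇛-residual⁺ : ∀ x y w → (x ∧ y) ⊑ w → y ⊑ x ⇛ w
  ⇛-residual⁺ x y w p =
    ≤-respʳ (sym (↓-idem _)) (∧-greatest (↓≤1 y) (transpose-⇒
      (≤-respˡ (sym (trans (negative-·≈∧ (↓≤1 x) (↓≤1 y)) (sym (↓-∧ x y)))) p)))

  ⇛-residual⁻ : ∀ x y w → y ⊑ x ⇛ w → (x ∧ y) ⊑ w
  ⇛-residual⁻ x y w p =
    ≤-respˡ (trans (negative-·≈∧ (↓≤1 x) (↓≤1 y)) (sym (↓-∧ x y)))
      (transpose-· (≤-trans p (≤-trans (≤-reflexive (↓-idem _)) (↓x≤x _))))

  opaque
    cone-isDistributiveLattice : IsDistributiveLattice _≃_ _⊔_ _∧_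
    cone-isDistributiveLattice = PreorderLattice.isDistributiveLattice _⊑_ ≤-refl ≤-trans _⊔_ _∧_
                                   ⊔-supremum ∧-infimum cone-distrib

    cone-⇛-cong : ∀ {x x′ y y′} → x ≃ x′ → y ≃ y′ → (x ⇛ y) ≃ (x′ ⇛ y′)
    cone-⇛-cong e e′ = ≈⇒≃ (↓-cong (⇒-cong (≃⇒↓≈ e) (≃⇒↓≈ e′)))

    cone-one-top : ∀ x → (x ∧ one) ≃ x
    cone-one-top x = ⊑⇒≤ (≤-trans (↓≤1 x) (≤-reflexive (sym (∧-idem one))))

    cone-residuation : ∀ x y w → (((x ∧ y) ∧ w) ≃ (x ∧ y) → (y ∧ (x ⇛ w)) ≃ y)
                               × ((y ∧ (x ⇛ w)) ≃ y → ((x ∧ y) ∧ w) ≃ (x ∧ y))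
    cone-residuation x y w = (λ le → ⊑⇒≤ (⇛-residual⁺ x y w (≤⇒⊑ le)))
                           , (λ le → ⊑⇒≤ (⇛-residual⁻ x y w (≤⇒⊑ le)))

  cone : BrouwerianAlgebra c ℓ
  cone = record
    { Carrier = Carrier
    ; _≈_ = _≃_
    ; _∨_ = _⊔_
    ; _∧_ = _∧_
    ; one = one
    ; _⇒_ = _⇛_
    ; isDistributiveLattice = cone-isDistributiveLattice
    ; ⇒-cong = cone-⇛-cong
    ; one-top = cone-one-top
    ; residuation = cone-residuation
    }

  -- ↓a · ¬↓b, for the normal form (a , b) of a pair in the twist product
  -- of the cone with Boolean point zz.
  ψ : Carrier → Carrier × Carrier → Carrier
  ψ zz (a , b) = ↓ ((a ⇛ b) ⇛ (a ∧ zz)) · ¬ ↓ (a ⇛ b)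

  ↓0≈0 : ↓ zero ≈ zero
  ↓0≈0 = ↓-fixed 0≤1

  -- For n ≤ 1 put y = ¬(n ∨ ↓¬n); decomposing y shows y ≤ 0, hence 1 ≤ n ∨ ↓¬n.
  negative-bp : ∀ n → n ≤ one → one ≤ (n ∨ ↓ (¬ n))
  negative-bp n p = ≤-respʳ (¬-involutive _) (≤-respˡ ¬0≈1 (¬-antitone y≤0))
    where
      k = ↓ (¬ n)
      y = ¬ (n ∨ k)
      y≈ : y ≈ ((¬ n) ∧ (¬ k))
      y≈ = ¬-∨ n k
      0≤y : zero ≤ y
      0≤y = ≤-respʳ (sym y≈) (∧-greatest (0≤¬-negative p) (0≤¬-negative (↓≤1 _)))
      y≤0 : y ≤ zero
      y≤0 = ≤-respˡ (sym (trans (dec y) (·-cong refl (x≤y⇒x∨y≈y 0≤y))))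
        (≤-trans (·-mono-≤ (↓-mono (≤-trans (≤-reflexive y≈) (x∧y≤x _ _))) (≤-trans (≤-reflexive y≈) (x∧y≤y _ _)))
                 (x·¬x≤0 k))

  cone-bp : BooleanPoint cone zero
  cone-bp x = ⊑⇒≤ (≤-trans (↓x≤x one) (≤-respʳ (sym (trans (↓-⊔ _ _) (∨-cong refl ↓¬↓)))
                                               (negative-bp (↓ x) (↓≤1 x))))
    where
      ↓¬↓ : ↓ (x ⇛ zero) ≈ ↓ (¬ ↓ x)
      ↓¬↓ = trans (↓-idem _) (↓-cong (⇒-cong refl ↓0≈0))

  opaque
    cone-boolean-pointed : ∀ x → (x ⊔ (x ⇛ zero)) ≃ one
    cone-boolean-pointed x = BrouwerianProperties.≤-antisym cone (cone-one-top _) (cone-bp x)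

  pointedCone : BooleanPointedBrouwerianAlgebra c ℓ
  pointedCone = record
    { brouwerian = cone
    ; zero = zero
    ; boolean-pointed = cone-boolean-pointed }

-- The Boolean point zz of the cone is a parameter equal to 0, since the second
-- equivalence takes it to be 1.
module Counit {c ℓ} (L : CommInvResLattice c ℓ)
    (idem : IsIdempotentCIRL L) (dec : SatisfiesDecomp L)
    (zz : CommInvResLattice.Carrier L) (zz≈0 : CommInvResLattice._≈_ L zz (CommInvResLattice.zero L))
    (bp : BooleanPoint (NegativeCone.cone L idem dec) zz) where
  open CommInvResLattice L
  open IdempotentDecomposable L idem dec
  module C = NegativeCone L idem dec
  module CA = BrouwerianAlgebra C.cone
  module CP = BrouwerianProperties C.cone
  module T = TwistProduct C.cone zz bp
  open T using (Pair; na; nb; _⊗_; _⊓_; _⊔_; ∼_; _⊸_; normal; ProductBelow)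

  ↓zz≈0 : ↓ zz ≈ zero
  ↓zz≈0 = trans (↓-cong zz≈0) C.↓0≈0

  φ : Carrier → Pair
  φ x = x , ¬ x

  ψ : Pair → Carrier
  ψ = C.ψ zz

  ↓[↓x⇒↓¬x]≤↓¬x : ∀ x → ↓ (↓ x ⇒ ↓ (¬ x)) ≤ ↓ (¬ x)
  ↓[↓x⇒↓¬x]≤↓¬x x = ∧-greatest (↓≤1 _) (transpose-⇒ (≤-respˡ (·-comm k x) k·x≤0))
    where
      k = ↓ (↓ x ⇒ ↓ (¬ x))
      k·x≤0 : (k · x) ≤ zero
      k·x≤0 = ≤-respˡ (·-cong refl (sym (decomposition-¬ x)))
        (≤-respˡ (trans (·-cong (·-comm (↓ x) k) refl) (·-assoc k (↓ x) _))
          (≤-trans (·-monoˡ-≤ _ (≤-trans (·-monoʳ-≤ (↓ x) (↓x≤x _)) (⇒-eval (↓ x) (↓ (¬ x)))))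
                   (x·¬x≤0 (↓ (¬ x)))))

  φ-normal : ∀ x → T.Normal x (¬ x)
  φ-normal x = record
    { closedʳ = C.⊑⇒≤ (≤-trans (≤-reflexive (↓-idem _)) (↓[↓x⇒↓¬x]≤↓¬x x))
    ; closedˡ = C.⊑⇒≤ (≤-trans (≤-reflexive (↓-idem _))
        (≤-respʳ (↓-cong (¬-involutive x))
          (≤-respˡ (↓-cong (⇒-cong refl (↓-cong (¬-involutive x)))) (↓[↓x⇒↓¬x]≤↓¬x (¬ x)))))
    ; disjoint = C.⊑⇒≤ (≤-respʳ (sym ↓zz≈0) (≤-respˡ (idem _)
        (≤-trans (·-mono-≤ (≤-trans (↓x≤x _) (x∧y≤x x (¬ x))) (≤-trans (↓x≤x _) (x∧y≤y x (¬ x))))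
                 (x·¬x≤0 x))))
    }

  na-φ : ∀ x → na (φ x) C.≃ x
  na-φ x = T.NA-normal (φ-normal x)

  nb-φ : ∀ x → nb (φ x) C.≃ (¬ x)
  nb-φ x = T.NB-normal (φ-normal x)

  ψφ : ∀ x → ψ (φ x) ≈ x
  ψφ x = trans (·-cong (C.≃⇒↓≈ (na-φ x)) (¬-cong (C.≃⇒↓≈ (nb-φ x)))) (sym (decomposition-¬ x))

  ψ-cong : ∀ {p q} → p T.≃ q → ψ p ≈ ψ q
  ψ-cong e = let na≃ , nb≃ = T.normal-forms-by-≃ e in ·-cong (C.≃⇒↓≈ na≃) (¬-cong (C.≃⇒↓≈ nb≃))

  module _ {a b} (a≤1 : a ≤ one) (b≤1 : b ≤ one) (a⇒b : ↓ (a ⇒ b) ≤ b) where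

    ↓[a⇒b]≈b : ↓ (a ⇒ b) ≈ b
    ↓[a⇒b]≈b = ≤-antisym a⇒b (∧-greatest b≤1 (transpose-⇒ (·-decreasingˡ b a≤1)))

    ↓¬[a·¬b]≈b : ↓ (¬ (a · (¬ b))) ≈ b
    ↓¬[a·¬b]≈b = trans (↓-cong (sym (⇒≈¬[·¬] a b))) ↓[a⇒b]≈b

    ↓[a·¬b]≈a : ↓ (b ⇒ a) ≤ a → (a ∧ b) ≤ zero → ↓ (a · (¬ b)) ≈ a
    ↓[a·¬b]≈a b⇒a a∧b≤0 = ≤-antisym ↓x≤a a≤↓x
      where
        x = a · (¬ b)
        ↓x≤a : ↓ x ≤ a
        ↓x≤a = ≤-trans (∧-greatest (↓≤1 x) (transpose-⇒ (≤-trans (·-monoʳ-≤ b (↓x≤x x))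
          (≤-respˡ (S.solve 3 (λ A B N → A S.⊕ (B S.⊕ N) S.⊜ B S.⊕ (A S.⊕ N)) refl a b (¬ b))
            (≤-trans (·-monoʳ-≤ a (≤-trans (x·¬x≤0 b) 0≤1)) (≤-reflexive (·-identityʳ a))))))) b⇒a
        a∧b≤↓x : (a ∧ b) ≤ ↓ x
        a∧b≤↓x = ∧-greatest (≤-trans (x∧y≤x a b) a≤1)
          (≤-respˡ (idem _) (·-mono-≤ (x∧y≤x a b) (≤-trans a∧b≤0 (0≤¬-negative b≤1))))
        a⇒b≈b·¬↓x : (a ⇒ b) ≈ (b · (¬ ↓ x))
        a⇒b≈b·¬↓x = trans (decomposition-¬ (a ⇒ b))
          (·-cong ↓[a⇒b]≈b (¬-cong (↓-cong (trans (¬-cong (⇒≈¬[·¬] a b)) (¬-involutive x)))))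
        ¬x·a≤0 : ((¬ x) · a) ≤ zero
        ¬x·a≤0 = ≤-respˡ (·-cong (trans (sym a⇒b≈b·¬↓x) (⇒≈¬[·¬] a b)) refl)
          (≤-respˡ (S.solve 3 (λ A B N → (A S.⊕ B) S.⊕ N S.⊜ (B S.⊕ N) S.⊕ A) refl a b (¬ ↓ x))
            (≤-respˡ (·-cong (sym (negative-·≈∧ a≤1 b≤1)) refl)
              (≤-trans (·-monoˡ-≤ (¬ ↓ x) a∧b≤↓x) (x·¬x≤0 (↓ x)))))
        a≤↓x : a ≤ ↓ x
        a≤↓x = ∧-greatest a≤1 (≤-via-¬ ¬x·a≤0)

  φψ : ∀ p → φ (ψ p) T.≃ p
  φψ p = T.≃-by-normal-forms
    (CA.trans (na-φ (ψ p)) (C.↓≈⇒≃ (↓[a·¬b]≈a a≤1 b≤1 a⇒b b⇒a a∧b≤0)))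
    (CA.trans (nb-φ (ψ p)) (C.↓≈⇒≃ (↓¬[a·¬b]≈b a≤1 b≤1 a⇒b)))
    where
      n = normal p
      a = ↓ (na p)
      b = ↓ (nb p)
      a≤1 = ↓≤1 (na p)
      b≤1 = ↓≤1 (nb p)
      a⇒b : ↓ (a ⇒ b) ≤ b
      a⇒b = ≤-trans (≤-reflexive (sym (↓-idem _))) (C.≤⇒⊑ (T.closedʳ n))
      b⇒a : ↓ (b ⇒ a) ≤ a
      b⇒a = ≤-trans (≤-reflexive (sym (↓-idem _))) (C.≤⇒⊑ (T.closedˡ n))
      a∧b≤0 : (a ∧ b) ≤ zero
      a∧b≤0 = ≤-respˡ (↓-∧ _ _) (≤-respʳ ↓zz≈0 (C.≤⇒⊑ (T.disjoint n)))

  φ-mono : ∀ {x y} → x ≤ y → φ x T.⊑ φ y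
  φ-mono {x} {y} p =
    CP.≤-respˡ (CA.sym (na-φ x)) (CP.≤-respʳ (CA.sym (na-φ y)) (C.⊑⇒≤ (↓-mono p))) ,
    CP.≤-respˡ (CA.sym (nb-φ y)) (CP.≤-respʳ (CA.sym (nb-φ x)) (C.⊑⇒≤ (↓-mono (¬-antitone p))))

  φ-reflects : ∀ {x y} → φ x T.⊑ φ y → x ≤ y
  φ-reflects {x} {y} (p , q) =
    ≤-respˡ (sym (decomposition-¬ x)) (≤-respʳ (sym (decomposition-¬ y)) (·-mono-≤
      (C.≤⇒⊑ (CP.≤-respˡ (na-φ x) (CP.≤-respʳ (na-φ y) p)))
      (¬-antitone (C.≤⇒⊑ (CP.≤-respˡ (nb-φ y) (CP.≤-respʳ (nb-φ x) q))))))

  φ-cong : ∀ {x y} → x ≈ y → φ x T.≃ φ y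
  φ-cong e = T.≋⇒≃ (C.≈⇒≃ e , C.≈⇒≃ (¬-cong e))

  -- φ is an order embedding onto a lattice, so it preserves meets and joins.
  φ-∧ : ∀ x y → φ (x ∧ y) T.≃ φ x ⊓ φ y
  φ-∧ x y =
    let lb₁ , lb₂ , greatest = T.⊓-infimum (φ x) (φ y)
        ψm , mψ = φψ (φ x ⊓ φ y)
    in greatest _ (φ-mono (x∧y≤x x y)) (φ-mono (x∧y≤y x y)) ,
       T.⊑-trans mψ (φ-mono (∧-greatest (φ-reflects (T.⊑-trans ψm lb₁)) (φ-reflects (T.⊑-trans ψm lb₂))))

  φ-∨ : ∀ x y → φ (x ∨ y) T.≃ φ x ⊔ φ y
  φ-∨ x y =
    let ub₁ , ub₂ , least = T.⊔-supremum (φ x) (φ y)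
        ψj , jψ = φψ (φ x ⊔ φ y)
    in T.⊑-trans (φ-mono (∨-least (φ-reflects (T.⊑-trans ub₁ jψ)) (φ-reflects (T.⊑-trans ub₂ jψ)))) ψj ,
       least _ (φ-mono (x≤x∨y x y)) (φ-mono (y≤x∨y x y))

  -- The decomposition of x, y and ¬ w turns x · y ≤ w into a condition on
  -- negative elements, which is ProductBelow for φ x, φ y, φ w in the cone.
  ·¬-decomposition : ∀ x y w → ((x · y) · (¬ w)) ≈
    (↓ ((x ∧ y) ∧ (¬ w)) · (((¬ ↓ (¬ x)) · (¬ ↓ (¬ y))) · (¬ ↓ w)))
  ·¬-decomposition x y w = trans (·-cong (·-cong (decomposition-¬ x) (decomposition-¬ y)) ¬w≈)
    (trans (S.solve 6 (λ X B Y D W E → ((X S.⊕ B) S.⊕ (Y S.⊕ D)) S.⊕ (W S.⊕ E) S.⊜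
                                       ((X S.⊕ Y) S.⊕ W) S.⊕ ((B S.⊕ D) S.⊕ E)) refl
             (↓ x) (¬ ↓ (¬ x)) (↓ y) (¬ ↓ (¬ y)) (↓ (¬ w)) (¬ ↓ w))
      (·-cong negative-part refl))
    where
      ¬w≈ : (¬ w) ≈ (↓ (¬ w) · (¬ ↓ w))
      ¬w≈ = trans (decomposition-¬ (¬ w)) (·-cong refl (¬-cong (↓-cong (¬-involutive w))))
      negative-part : ((↓ x · ↓ y) · ↓ (¬ w)) ≈ ↓ ((x ∧ y) ∧ (¬ w))
      negative-part = trans (·-cong (negative-·≈∧ (↓≤1 x) (↓≤1 y)) refl)
        (trans (negative-·≈∧ (≤-trans (x∧y≤x _ _) (↓≤1 x)) (↓≤1 _))
               (sym (trans (↓-∧ _ _) (∧-cong (↓-∧ x y) refl))))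

  ProductBelow⇒ConeProductBelow : ∀ x y w → ProductBelow x (¬ x) y (¬ y) w (¬ w) →
    ConeProductBelow (↓ ((x ∧ y) ∧ (¬ w))) (↓ (¬ x)) (↓ (¬ y)) (↓ w)
  ProductBelow⇒ConeProductBelow x y w (k , k′) =
    ≤-respʳ (trans (C.↓-⊔ _ _) (∨-cong (C.↓-⊔ _ _) refl)) (C.≤⇒⊑ k) ,
    ≤-respˡ (trans (↓-∧ _ zz) (∧-cong refl ↓zz≈0))
      (≤-respʳ (trans (↓-∧ _ w) (∧-cong (↓-∧ _ _) refl)) (C.≤⇒⊑ k′))

  ConeProductBelow⇒ProductBelow : ∀ x y w →
    ConeProductBelow (↓ ((x ∧ y) ∧ (¬ w))) (↓ (¬ x)) (↓ (¬ y)) (↓ w) →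
    ProductBelow x (¬ x) y (¬ y) w (¬ w)
  ConeProductBelow⇒ProductBelow x y w (k , k′) =
    C.⊑⇒≤ (≤-respʳ (sym (trans (C.↓-⊔ _ _) (∨-cong (C.↓-⊔ _ _) refl))) k) ,
    C.⊑⇒≤ (≤-respˡ (sym (trans (↓-∧ _ zz) (∧-cong refl ↓zz≈0)))
      (≤-respʳ (sym (trans (↓-∧ _ w) (∧-cong (↓-∧ _ _) refl))) k′))

  φ⊗φ⊑φ⇒· : ∀ x y w → φ x ⊗ φ y T.⊑ φ w → (x · y) ≤ w
  φ⊗φ⊑φ⇒· x y w le = ≤-via-¬ (≤-respˡ (·-comm _ (¬ w)) (≤-respˡ (sym (·¬-decomposition x y w))
    (ConeProductBelow⇒·¬¬¬≤0 (↓≤1 _) (↓≤1 _) (↓≤1 _) (↓≤1 _)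
      (ProductBelow⇒ConeProductBelow x y w
        (T.ProductBelow-cong (na-φ x) (nb-φ x) (na-φ y) (nb-φ y) (na-φ w) (nb-φ w)
          (T.⊗⊑⇒ProductBelow (φ x) (φ y) (φ w) le))))))

  ·⇒φ⊗φ⊑φ : ∀ x y w → (x · y) ≤ w → φ x ⊗ φ y T.⊑ φ w
  ·⇒φ⊗φ⊑φ x y w le = T.ProductBelow⇒⊗⊑ (φ x) (φ y) (φ w)
    (T.ProductBelow-cong (CA.sym (na-φ x)) (CA.sym (nb-φ x)) (CA.sym (na-φ y)) (CA.sym (nb-φ y))
                         (CA.sym (na-φ w)) (CA.sym (nb-φ w))
      (ConeProductBelow⇒ProductBelow x y w (·¬¬¬≤0⇒ConeProductBelow (↓≤1 _) (↓≤1 _) (↓≤1 _)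
        (≤-respˡ (·¬-decomposition x y w) (≤-trans (·-monoˡ-≤ (¬ w) le) (x·¬x≤0 w))))))

  φ-· : ∀ x y → φ (x · y) T.≃ φ x ⊗ φ y
  φ-· x y = T.⊑-trans (φ-mono (φ⊗φ⊑φ⇒· x y _ (proj₂ (φψ (φ x ⊗ φ y))))) (proj₁ (φψ (φ x ⊗ φ y))) ,
            ·⇒φ⊗φ⊑φ x y (x · y) ≤-refl

  ∼φ≃φ¬ : ∀ x → ∼ φ x T.≃ φ (¬ x)
  ∼φ≃φ¬ x = T.≋⇒≃ (nb-φ x , CA.trans (na-φ x) (C.≈⇒≃ (sym (¬-involutive x))))

  φ-⇒ : ∀ x y → φ (x ⇒ y) T.≃ φ x ⊸ φ y
  φ-⇒ x y = T.≃-trans (φ-cong (⇒≈¬[·¬] x y)) (T.≃-trans (T.≃-sym (∼φ≃φ¬ (x · (¬ y))))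
    (T.∼-cong (T.≃-trans (φ-· x (¬ y)) (T.⊗-cong T.≃-refl (T.≃-sym (∼φ≃φ¬ y))))))

  φ-hom : CIRLHom L T.twistCIRL
  φ-hom = record
    { ⟦_⟧ = φ
    ; cong = φ-cong
    ; ∨-hom = φ-∨
    ; ∧-hom = φ-∧
    ; ·-hom = φ-·
    ; ⇒-hom = φ-⇒
    ; one-hom = T.≋⇒≃ (CA.refl , C.≈⇒≃ (trans ¬1≈0 (sym zz≈0)))
    ; zero-hom = T.≋⇒≃ (C.≈⇒≃ (sym zz≈0) , C.≈⇒≃ ¬0≈1)
    }

module Unit {c ℓ} (B : BrouwerianAlgebra c ℓ) (z : BrouwerianAlgebra.Carrier B)
    (bp : BooleanPoint B z) where
  open BrouwerianAlgebra B
  open BrouwerianProperties B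
  module T = TwistProduct B z bp
  open T using (Pair; na; nb; normal; negPart; 𝟏; 𝟎; _⊓_; _⊸_; ∼_; _⊗_)
  module C = NegativeCone T.twistCIRL T.twistCIRL-idempotent T.twistCIRL-decomposition

  na-negPart : ∀ p → na (negPart p) ≈ na p
  na-negPart p = T.NA-meet-one-normal (normal p)

  na-↓ : ∀ p → na (𝟏 ⊓ p) ≈ na p
  na-↓ p = trans (proj₁ (T.normal-forms-by-≃ (T.𝟏⊓≃negPart p))) (na-negPart p)

  η-cong : ∀ {p q} → p C.≃ q → na p ≈ na q
  η-cong {p} {q} (l , r) =
    ≤-antisym (≤-respˡ (na-↓ p) (≤-respʳ (na-↓ q) (proj₁ (T.≤⇒⊑ l))))
              (≤-respˡ (na-↓ q) (≤-respʳ (na-↓ p) (proj₁ (T.≤⇒⊑ r))))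

  η-∧ : ∀ p q → na (p ⊓ q) ≈ (na p ∧ na q)
  η-∧ p q = T.NA-meet (normal p) (normal q)

  η-∨ : ∀ p q → na (p C.⊔ q) ≈ (na p ∨ na q)
  η-∨ p q = trans (proj₁ (T.normal-forms-by-≃ (IsLattice.∨-cong T.twist-isLattice (T.𝟏⊓≃negPart p) (T.𝟏⊓≃negPart q))))
    (trans (T.na-∼ (∼ negPart p ⊓ ∼ negPart q))
      (trans (⇒-cong (∧-cong (T.na-∼ (negPart p)) (T.na-∼ (negPart q)))
                     (∨-cong (trans (T.nb-∼ (negPart p)) (na-negPart p)) (trans (T.nb-∼ (negPart q)) (na-negPart q))))
        (T.cone-join (na p) (nb p) (na q) (nb q))))

  η-⇒ : ∀ p q → na (p C.⇛ q) ≈ (na p ⇒ na q)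
  η-⇒ p q = trans (na-↓ ((𝟏 ⊓ p) ⊸ (𝟏 ⊓ q)))
    (trans (proj₁ (T.normal-forms-by-≃ (T.⊸-cong (T.𝟏⊓≃negPart p) (T.𝟏⊓≃negPart q))))
      (trans (T.na-∼ (negPart p ⊗ ∼ negPart q))
        (trans (⇒-cong refl (T.W-cong refl (na-negPart q)))
          (T.cone-implication (na q) (nb q) (normal p)))))

  η : BrHom C.cone B
  η = record
    { ⟦_⟧ = na ; cong = η-cong ; ∨-hom = η-∨ ; ∧-hom = η-∧ ; ⇒-hom = η-⇒ ; one-hom = T.NA-one-z }

  η⁻¹ : Carrier → Pair
  η⁻¹ a = a , z

  η⁻¹-cong : ∀ {a a′} → a ≈ a′ → η⁻¹ a C.≃ η⁻¹ a′
  η⁻¹-cong e = C.≈⇒≃ (T.≋⇒≃ (e , refl))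

  η-η⁻¹ : ∀ a → na (η⁻¹ a) ≈ a
  η-η⁻¹ = T.NA-z

  η⁻¹-η : ∀ p → η⁻¹ (na p) C.≃ p
  η⁻¹-η p = C.↓≈⇒≃ (T.≃-trans (T.𝟏⊓≃negPart (η⁻¹ (na p))) (T.≃-trans
    (T.≃-by-normal-forms (T.NA-cone-embedding (normal p)) (T.NB-cone-embedding (normal p)))
    (T.≃-sym (T.𝟏⊓≃negPart p))))

  η⁻¹-zero : η⁻¹ z C.≃ 𝟎
  η⁻¹-zero = BrouwerianAlgebra.trans C.cone (η⁻¹-cong (sym T.NA-z-one)) (η⁻¹-η 𝟎)

module _ {c ℓ : Level} where

  BrHom-inverse : {M N : BrouwerianAlgebra c ℓ} (f : BrHom M N)
    (g : BrouwerianAlgebra.Carrier N → BrouwerianAlgebra.Carrier M) →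
    (∀ {y y′} → BrouwerianAlgebra._≈_ N y y′ → BrouwerianAlgebra._≈_ M (g y) (g y′)) →
    (∀ x → BrouwerianAlgebra._≈_ M (g (BrHom.⟦ f ⟧ x)) x) →
    (∀ y → BrouwerianAlgebra._≈_ N (BrHom.⟦ f ⟧ (g y)) y) → BrHom N M
  BrHom-inverse {M} {N} f g g-cong gf fg = record
    { ⟦_⟧ = g ; cong = g-cong
    ; ∨-hom = preserves N._∨_ M._∨_ N.∨-cong f.∨-hom
    ; ∧-hom = preserves N._∧_ M._∧_ N.∧-cong f.∧-hom
    ; ⇒-hom = preserves N._⇒_ M._⇒_ N.⇒-cong f.⇒-hom
    ; one-hom = M.trans (g-cong (N.sym f.one-hom)) (gf _) }
    where
      module M = BrouwerianAlgebra M
      module N = BrouwerianAlgebra N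
      module f = BrHom f
      preserves : (_⊕_ : Op₂ N.Carrier) (_⊗_ : Op₂ M.Carrier) →
        (∀ {a a′ b b′} → a N.≈ a′ → b N.≈ b′ → (a ⊕ b) N.≈ (a′ ⊕ b′)) →
        (∀ x x′ → f.⟦ x ⊗ x′ ⟧ N.≈ (f.⟦ x ⟧ ⊕ f.⟦ x′ ⟧)) →
        ∀ y y′ → g (y ⊕ y′) M.≈ (g y ⊗ g y′)
      preserves _⊕_ _⊗_ cong hom y y′ =
        M.trans (g-cong (cong (N.sym (fg y)) (N.sym (fg y′)))) (M.trans (g-cong (N.sym (hom _ _))) (gf _))

  CIRLHom-inverse : {M N : CommInvResLattice c ℓ} (f : CIRLHom M N)
    (g : CommInvResLattice.Carrier N → CommInvResLattice.Carrier M) →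
    (∀ {y y′} → CommInvResLattice._≈_ N y y′ → CommInvResLattice._≈_ M (g y) (g y′)) →
    (∀ x → CommInvResLattice._≈_ M (g (CIRLHom.⟦ f ⟧ x)) x) →
    (∀ y → CommInvResLattice._≈_ N (CIRLHom.⟦ f ⟧ (g y)) y) → CIRLHom N M
  CIRLHom-inverse {M} {N} f g g-cong gf fg = record
    { ⟦_⟧ = g ; cong = g-cong
    ; ∨-hom = preserves N._∨_ M._∨_ N.∨-cong f.∨-hom
    ; ∧-hom = preserves N._∧_ M._∧_ N.∧-cong f.∧-hom
    ; ·-hom = preserves N._·_ M._·_ (IsCommutativeMonoid.∙-cong N.isCommutativeMonoid) f.·-hom
    ; ⇒-hom = preserves N._⇒_ M._⇒_ N.⇒-cong f.⇒-hom
    ; one-hom = M.trans (g-cong (N.sym f.one-hom)) (gf _)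
    ; zero-hom = M.trans (g-cong (N.sym f.zero-hom)) (gf _) }
    where
      module M = CommInvResLattice M
      module N = CommInvResLattice N
      module f = CIRLHom f
      preserves : (_⊕_ : Op₂ N.Carrier) (_⊗_ : Op₂ M.Carrier) →
        (∀ {a a′ b b′} → a N.≈ a′ → b N.≈ b′ → (a ⊕ b) N.≈ (a′ ⊕ b′)) →
        (∀ x x′ → f.⟦ x ⊗ x′ ⟧ N.≈ (f.⟦ x ⟧ ⊕ f.⟦ x′ ⟧)) →
        ∀ y y′ → g (y ⊕ y′) M.≈ (g y ⊗ g y′)
      preserves _⊕_ _⊗_ cong hom y y′ =
        M.trans (g-cong (cong (N.sym (fg y)) (N.sym (fg y′)))) (M.trans (g-cong (N.sym (hom _ _))) (gf _))

module TwistMap {c ℓ} (A B : BrouwerianAlgebra c ℓ)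
    (zA : BrouwerianAlgebra.Carrier A) (zB : BrouwerianAlgebra.Carrier B)
    (bpA : BooleanPoint A zA) (bpB : BooleanPoint B zB)
    (h : BrHom A B) (h-z : BrouwerianAlgebra._≈_ B (BrHom.⟦ h ⟧ zA) zB) where
  module TA = TwistProduct A zA bpA
  module TB = TwistProduct B zB bpB
  module A = BrouwerianAlgebra A
  module B where
    open BrouwerianAlgebra B public
    open BrouwerianProperties B public using (≤-respˡ; ≤-respʳ)
  module h = BrHom h
  open h using (⟦_⟧)

  map : TA.Pair → TB.Pair
  map (a , b) = ⟦ a ⟧ , ⟦ b ⟧

  h-⇒z : ∀ a → ⟦ a A.⇒ zA ⟧ B.≈ (⟦ a ⟧ B.⇒ zB)
  h-⇒z a = B.trans (h.⇒-hom _ _) (B.⇒-cong B.refl h-z)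

  h-na : ∀ p → ⟦ TA.na p ⟧ B.≈ TB.na (map p)
  h-na (a , b) = B.trans (h.⇒-hom _ _) (B.⇒-cong (h.⇒-hom a b) (B.trans (h.∧-hom a zA) (B.∧-cong B.refl h-z)))

  h-nb : ∀ p → ⟦ TA.nb p ⟧ B.≈ TB.nb (map p)
  h-nb (a , b) = h.⇒-hom a b

  h-W : ∀ b d → ⟦ TA.W b d ⟧ B.≈ TB.W ⟦ b ⟧ ⟦ d ⟧
  h-W b d = B.trans (h.∧-hom _ _)
    (B.∧-cong (B.trans (h.⇒-hom _ _) (B.⇒-cong (h-⇒z b) B.refl))
              (B.trans (h.⇒-hom _ _) (B.⇒-cong (h-⇒z d) B.refl)))

  h-mono : ∀ {x y} → x A.≤ y → ⟦ x ⟧ B.≤ ⟦ y ⟧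
  h-mono {x} {y} p = B.trans (B.sym (h.∧-hom x y)) (h.cong p)

  map-⊑ : ∀ {p q} → p TA.⊑ q → map p TB.⊑ map q
  map-⊑ {p} {q} (l , r) =
    B.≤-respˡ (h-na p) (B.≤-respʳ (h-na q) (h-mono l)) ,
    B.≤-respˡ (h-nb q) (B.≤-respʳ (h-nb p) (h-mono r))

  map-∼ : ∀ p → map (TA.∼ p) TB.≋ TB.∼ map p
  map-∼ p = h-nb p , h-na p

  map-⊓ : ∀ p q → map (p TA.⊓ q) TB.≋ map p TB.⊓ map q
  map-⊓ p q = B.trans (h.∧-hom _ _) (B.∧-cong (h-na p) (h-na q)) ,
              B.trans (h.∨-hom _ _) (B.∨-cong (h-nb p) (h-nb q))

  map-⊗ : ∀ p q → map (p TA.⊗ q) TB.≋ map p TB.⊗ map q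
  map-⊗ p q = h.∧-hom _ _ , h-W _ _

  map-⊔ : ∀ p q → map (p TA.⊔ q) TB.≋ map p TB.⊔ map q
  map-⊔ p q = TB.≋-trans (map-∼ _) (TB.∼-≋ (TB.≋-trans (map-⊓ _ _) (TB.⊓-≋ (map-∼ p) (map-∼ q))))

  map-⊸ : ∀ p q → map (p TA.⊸ q) TB.≋ map p TB.⊸ map q
  map-⊸ p q = TB.≋-trans (map-∼ _) (TB.∼-≋ (TB.≋-trans (map-⊗ _ _) (TB.⊗-≋ (B.refl , B.refl) (map-∼ q))))

  twistMap : CIRLHom TA.twistCIRL TB.twistCIRL
  twistMap = record
    { ⟦_⟧ = map
    ; cong = λ (l , r) → map-⊑ l , map-⊑ r
    ; ∨-hom = λ p q → TB.≋⇒≃ (map-⊔ p q)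
    ; ∧-hom = λ p q → TB.≋⇒≃ (map-⊓ p q)
    ; ·-hom = λ p q → TB.≋⇒≃ (map-⊗ p q)
    ; ⇒-hom = λ p q → TB.≋⇒≃ (map-⊸ p q)
    ; one-hom = TB.≋⇒≃ (h.one-hom , h-z)
    ; zero-hom = TB.≋⇒≃ (h-z , h.one-hom) }

module ConeMap {c ℓ} (L M : CommInvResLattice c ℓ)
    (idemL : IsIdempotentCIRL L) (decL : SatisfiesDecomp L)
    (idemM : IsIdempotentCIRL M) (decM : SatisfiesDecomp M) (f : CIRLHom L M) where
  module L = CommInvResLattice L
  module M = CommInvResLattice M
  module CL = NegativeCone L idemL decL
  module CM = NegativeCone M idemM decM
  module PL = IdempotentDecomposable L idemL decL
  module PM = IdempotentDecomposable M idemM decM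
  module f = CIRLHom f
  open f using (⟦_⟧)

  f-↓ : ∀ x → ⟦ PL.↓ x ⟧ M.≈ PM.↓ ⟦ x ⟧
  f-↓ x = M.trans (f.∧-hom _ _) (M.∧-cong f.one-hom M.refl)

  f-mono : ∀ {x y} → x L.≤ y → ⟦ x ⟧ M.≤ ⟦ y ⟧
  f-mono {x} {y} p = M.trans (M.sym (f.∧-hom x y)) (f.cong p)

  f-⇛ : ∀ x y → ⟦ x CL.⇛ y ⟧ M.≈ (⟦ x ⟧ CM.⇛ ⟦ y ⟧)
  f-⇛ x y = M.trans (f-↓ _) (PM.↓-cong (M.trans (f.⇒-hom _ _) (M.⇒-cong (f-↓ x) (f-↓ y))))

  coneMap : BrHom CL.cone CM.cone
  coneMap = record
    { ⟦_⟧ = ⟦_⟧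
    ; cong = λ (l , r) → PM.≤-respˡ (f-↓ _) (PM.≤-respʳ (f-↓ _) (f-mono l)) ,
                         PM.≤-respˡ (f-↓ _) (PM.≤-respʳ (f-↓ _) (f-mono r))
    ; ∨-hom = λ x y → CM.≈⇒≃ (M.trans (f.∨-hom _ _) (M.∨-cong (f-↓ x) (f-↓ y)))
    ; ∧-hom = λ x y → CM.≈⇒≃ (f.∧-hom x y)
    ; ⇒-hom = λ x y → CM.≈⇒≃ (f-⇛ x y)
    ; one-hom = CM.≈⇒≃ f.one-hom }

  pointedConeMap : BPBrHom CL.pointedCone CM.pointedCone
  pointedConeMap = record { brHom = coneMap ; zero-hom = CM.≈⇒≃ f.zero-hom }

  f-ψ : ∀ {zL zM} → ⟦ zL ⟧ M.≈ zM → ∀ a b → ⟦ CL.ψ zL (a , b) ⟧ M.≈ CM.ψ zM (⟦ a ⟧ , ⟦ b ⟧)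
  f-ψ f-z a b = M.trans (f.·-hom _ _) (PM.·-cong
    (M.trans (f-↓ _) (PM.↓-cong (M.trans (f-⇛ _ _) (CM.⇛-≈ (f-⇛ a b) (M.trans (f.∧-hom _ _) (M.∧-cong M.refl f-z))))))
    (M.trans (f.⇒-hom _ _) (M.⇒-cong (M.trans (f-↓ _) (PM.↓-cong (f-⇛ a b))) f.zero-hom)))

module _ (c ℓ : Level) where
  private
    module BA = BrouwerianAlgebra
    module BPA = BooleanPointedBrouwerianAlgebra
    module RL = CommInvResLattice

  bp-of-pointed : (B : BooleanPointedBrouwerianAlgebra c ℓ) → BooleanPoint (BPA.brouwerian B) (BPA.zero B)
  bp-of-pointed B x = BrouwerianProperties.≤-reflexive (BPA.brouwerian B) (BPA.sym B (BPA.boolean-pointed B x))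

  bp-one : (A : BrouwerianAlgebra c ℓ) → BooleanPoint A (BA.one A)
  bp-one A x = BrouwerianProperties.≤-trans A (BrouwerianProperties.y≤x⇒y A) (BrouwerianProperties.y≤x∨y A _ _)

  private
    module TP (B : BooleanPointedBrouwerianAlgebra c ℓ) = TwistProduct (BPA.brouwerian B) (BPA.zero B) (bp-of-pointed B)
    module U (B : BooleanPointedBrouwerianAlgebra c ℓ) = Unit (BPA.brouwerian B) (BPA.zero B) (bp-of-pointed B)
    module TM {B B′ : BooleanPointedBrouwerianAlgebra c ℓ} (h : BPBrHom B B′) =
      TwistMap (BPA.brouwerian B) (BPA.brouwerian B′) (BPA.zero B) (BPA.zero B′)
               (bp-of-pointed B) (bp-of-pointed B′) (BPBrHom.brHom h) (BPBrHom.zero-hom h)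
    module NC (X : Category.Obj (IdemCIRLDecompCat c ℓ)) =
      NegativeCone (proj₁ X) (proj₁ (proj₂ X)) (proj₂ (proj₂ X))
    module CU (X : Category.Obj (IdemCIRLDecompCat c ℓ)) =
      Counit (proj₁ X) (proj₁ (proj₂ X)) (proj₂ (proj₂ X)) (RL.zero (proj₁ X)) (RL.refl (proj₁ X))
             (bp-of-pointed (NC.pointedCone X))
    module CM {X Y : Category.Obj (IdemCIRLDecompCat c ℓ)} (f : CIRLHom (proj₁ X) (proj₁ Y)) =
      ConeMap (proj₁ X) (proj₁ Y) (proj₁ (proj₂ X)) (proj₂ (proj₂ X)) (proj₁ (proj₂ Y)) (proj₂ (proj₂ Y)) f

  Twist : Functor (BooleanPointedBrouwerianCat c ℓ) (IdemCIRLDecompCat c ℓ)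
  Twist = record
    { F₀ = λ B → TP.twistCIRL B , TP.twistCIRL-idempotent B , TP.twistCIRL-decomposition B
    ; F₁ = TM.twistMap
    ; F-resp-≈ = λ {_} {B} f≈g (a , b) → TP.≋⇒≃ B (f≈g a , f≈g b)
    ; identity = λ {B} _ → TP.≃-refl B
    ; homomorphism = λ {_} {_} {B} _ → TP.≃-refl B
    }

  -- The objects X and Y are passed explicitly to ConeMap: they cannot be
  -- inferred from a homomorphism CIRLHom (proj₁ X) (proj₁ Y).
  Cone : Functor (IdemCIRLDecompCat c ℓ) (BooleanPointedBrouwerianCat c ℓ)
  Cone = record
    { F₀ = NC.pointedCone
    ; F₁ = λ {X} {Y} f → CM.pointedConeMap {X} {Y} f
    ; F-resp-≈ = λ {_} {Y} f≈g x → NC.≈⇒≃ Y (f≈g x)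
    ; identity = λ {X} _ → BPA.refl (NC.pointedCone X)
    ; homomorphism = λ {_} {_} {Z} _ → BPA.refl (NC.pointedCone Z)
    }

  Cone∘Twist≅id : NaturalIsomorphism (Cone ∘F Twist) idF
  Cone∘Twist≅id = record
    { η = λ B → record { brHom = U.η B ; zero-hom = TP.NA-z-one B }
    ; η⁻¹ = λ B → record { brHom = BrHom-inverse (U.η B) (U.η⁻¹ B) (U.η⁻¹-cong B) (U.η⁻¹-η B) (U.η-η⁻¹ B)
                         ; zero-hom = U.η⁻¹-zero B }
    ; isoˡ = U.η⁻¹-η
    ; isoʳ = U.η-η⁻¹
    ; commute = λ {B} {B′} h p → BPA.sym B′ (TM.h-na {B} {B′} h p)
    }

  Twist∘Cone≅id : NaturalIsomorphism (Twist ∘F Cone) idF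
  Twist∘Cone≅id = record
    { η = λ X → CIRLHom-inverse (CU.φ-hom X) (CU.ψ X) (CU.ψ-cong X) (CU.ψφ X) (CU.φψ X)
    ; η⁻¹ = CU.φ-hom
    ; isoˡ = CU.φψ
    ; isoʳ = CU.ψφ
    ; commute = λ {X} {Y} f (a , b) → RL.sym (proj₁ Y) (CM.f-ψ {X} {Y} f (CIRLHom.zero-hom f) a b)
    }

  private
    module TO (A : BrouwerianAlgebra c ℓ) = TwistProduct A (BA.one A) (bp-one A)
    module UO (A : BrouwerianAlgebra c ℓ) = Unit A (BA.one A) (bp-one A)
    module TMO {A A′ : BrouwerianAlgebra c ℓ} (h : BrHom A A′) =
      TwistMap A A′ (BA.one A) (BA.one A′) (bp-one A) (bp-one A′) h (BrHom.one-hom h)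
    module NCO (X : Category.Obj (IdemCIRLDecompZeroOneCat c ℓ)) =
      NegativeCone (proj₁ X) (proj₁ (proj₂ X)) (proj₁ (proj₂ (proj₂ X)))
    module CUO (X : Category.Obj (IdemCIRLDecompZeroOneCat c ℓ)) =
      Counit (proj₁ X) (proj₁ (proj₂ X)) (proj₁ (proj₂ (proj₂ X))) (RL.one (proj₁ X))
             (RL.sym (proj₁ X) (proj₂ (proj₂ (proj₂ X)))) (bp-one (NCO.cone X))
    module CMO {X Y : Category.Obj (IdemCIRLDecompZeroOneCat c ℓ)} (f : CIRLHom (proj₁ X) (proj₁ Y)) =
      ConeMap (proj₁ X) (proj₁ Y) (proj₁ (proj₂ X)) (proj₁ (proj₂ (proj₂ X)))
              (proj₁ (proj₂ Y)) (proj₁ (proj₂ (proj₂ Y))) f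

  TwistOne : Functor (BrouwerianCat c ℓ) (IdemCIRLDecompZeroOneCat c ℓ)
  TwistOne = record
    { F₀ = λ A → TO.twistCIRL A , TO.twistCIRL-idempotent A , TO.twistCIRL-decomposition A , TO.≃-refl A
    ; F₁ = TMO.twistMap
    ; F-resp-≈ = λ {_} {A} f≈g (a , b) → TO.≋⇒≃ A (f≈g a , f≈g b)
    ; identity = λ {A} _ → TO.≃-refl A
    ; homomorphism = λ {_} {_} {A} _ → TO.≃-refl A
    }

  ConeOne : Functor (IdemCIRLDecompZeroOneCat c ℓ) (BrouwerianCat c ℓ)
  ConeOne = record
    { F₀ = NCO.cone
    ; F₁ = λ {X} {Y} f → CMO.coneMap {X} {Y} f
    ; F-resp-≈ = λ {_} {Y} f≈g x → NCO.≈⇒≃ Y (f≈g x)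
    ; identity = λ {X} _ → BA.refl (NCO.cone X)
    ; homomorphism = λ {_} {_} {Z} _ → BA.refl (NCO.cone Z)
    }

  ConeOne∘TwistOne≅id : NaturalIsomorphism (ConeOne ∘F TwistOne) idF
  ConeOne∘TwistOne≅id = record
    { η = UO.η
    ; η⁻¹ = λ A → BrHom-inverse (UO.η A) (UO.η⁻¹ A) (UO.η⁻¹-cong A) (UO.η⁻¹-η A) (UO.η-η⁻¹ A)
    ; isoˡ = UO.η⁻¹-η
    ; isoʳ = UO.η-η⁻¹
    ; commute = λ {A} {A′} h p → BA.sym A′ (TMO.h-na {A} {A′} h p)
    }

  TwistOne∘ConeOne≅id : NaturalIsomorphism (TwistOne ∘F ConeOne) idF
  TwistOne∘ConeOne≅id = record
    { η = λ X → CIRLHom-inverse (CUO.φ-hom X) (CUO.ψ X) (CUO.ψ-cong X) (CUO.ψφ X) (CUO.φψ X)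
    ; η⁻¹ = CUO.φ-hom
    ; isoˡ = CUO.φψ
    ; isoʳ = CUO.ψφ
    ; commute = λ {X} {Y} f (a , b) → RL.sym (proj₁ Y) (CMO.f-ψ {X} {Y} f (CIRLHom.one-hom f) a b)
    }

mainTheorem15 : (c ℓ : Level) →
    Equivalence (BooleanPointedBrouwerianCat c ℓ) (IdemCIRLDecompCat c ℓ)
      × Equivalence (BrouwerianCat c ℓ) (IdemCIRLDecompZeroOneCat c ℓ)
mainTheorem15 c ℓ =
  record { F = Twist c ℓ ; G = Cone c ℓ ; unit = Cone∘Twist≅id c ℓ ; counit = Twist∘Cone≅id c ℓ } ,
  record { F = TwistOne c ℓ ; G = ConeOne c ℓ ; unit = ConeOne∘TwistOne≅id c ℓ ; counit = TwistOne∘ConeOne≅id c ℓ }
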